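{- With notation as in the context, for every $f\in\mathcal{H}$ we have $\widetilde{S(f)}=\tau\,\widetilde{f}\,\tau$ as maps $\mathcal{A}_r\to\mathcal{A}_r$, where $S$ is the antipode of $\mathcal{H}$.
   Context: Let $r\ge1$, $\mu_r$ the $r$-th roots of unity, $\mathcal{A}_r=\mathbb{Q}\langle x,y_s\mid s\in\mu_r\rangle$, $z=x+y_1$, $z_s^{\delta}=x+\delta(s)y_s$ with $\delta(1)=0$, $\delta(s)=1$ for $s\ne1$; $R_w$ is right multiplication by $w$. $\tau$ is the anti-automorphism of $\mathcal{A}_r$ with $\tau(x)=y_1$, $\tau(y_1)=x$, $\tau(y_s)=-y_s$ for $s\ne1$. $\mathcal{H}$: Connes–Kreimer Hopf algebra of rooted trees (commutative algebra with basis the rooted forests, unit the empty forest $\mathbb{I}$; $B_+$ grafts the roots of a forest onto a new root, $B_+(\mathbb{I})=\bullet$; coproduct the algebra map with $\Delta(\mathbb{I})=\mathbb{I}\otimes\mathbb{I}$, $\Delta(B_+(f))=B_+(f)\otimes\mathbb{I}+(\mathrm{id}\otimes B_+)\Delta(f)$; counit $\hat{\mathbb{I}}$ vanishing on nonempty forests with $\hat{\mathbb{I}}(\mathbb{I})=1$; antipode $S$ the anti-automorphism with $m(S\otimes\mathrm{id})\Delta=\mathbb{I}\,\hat{\mathbb{I}}=m(\mathrm{id}\otimes S)\Delta$). Rooted tree maps: $\widetilde{\mathbb{I}}=\mathrm{id}$; for forests $f$ of positive degree $\widetilde f\in\mathrm{End}_\mathbb{Q}(\mathcal{A}_r)$ is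 determined by (I) $\widetilde{\bullet}(z_s^{\delta})=z_s^{\delta}(z-z_s^{\delta})$, $\widetilde{\bullet}(z)=0$; (II) $\widetilde{B_+(f)}(z_s^{\delta})=R_{z-z_s^{\delta}}R_{2z-z_s^{\delta}}R_{z-z_s^{\delta}}^{ -1}\widetilde{f}(z_s^{\delta})$, $\widetilde{B_+(f)}(z)=0$; (III) $\widetilde{gh}(u)=\widetilde g(\widetilde h(u))$ for $u\in\{z,z_s^\delta\mid s\in\mu_r\}$; (IV) $\widetilde{f}(wu)=\sum_{(f)}\widetilde{f'}(w)\widetilde{f''}(u)$ for $w\in\mathcal{A}_r$, $u\in\{z,z_s^\delta\}$, $\Delta(f)=\sum_{(f)}f'\otimes f''$; extended linearly to $\mathcal{H}$ (an algebra homomorphism). -}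

module Defs where

open import Data.Nat using (ℕ; zero; suc) renaming (_+_ to _+ℕ_; _⊔_ to _⊔ℕ_)
open import Data.Fin using (Fin; zero; suc)
open import Data.Fin.Properties using () renaming (_≟_ to _≟F_)
open import Data.List using (List; []; _∷_; _++_; map; concatMap; foldr)
open import Data.List.Properties using (≡-dec)
open import Data.Product using (Σ; _×_; _,_; ∃)
open import Data.Rational using (ℚ; 0ℚ; 1ℚ; -_) renaming (_+_ to _+ℚ_; _*_ to _*ℚ_)
open import Relation.Binary.PropositionalEquality using (_≡_; refl; cong)
open import Relation.Nullary using (Dec; yes; no)
open import Relation.Nullary.Decidable using (⌊_⌋)
open import Data.Bool using (if_then_else_)
open import Data.Empty using (⊥)

-- The algebra 𝒜_r = ℚ⟨x, y_s | s ∈ μ_r⟩, with r = suc n ≥ 1.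
-- μ_r is indexed by Fin r; the index `zero` stands for the root 1.

data Letter (r : ℕ) : Set where
  𝕩 : Letter r
  𝕪 : Fin r → Letter r

Word : ℕ → Set
Word r = List (Letter r)

_≟L_ : ∀ {r} (a b : Letter r) → Dec (a ≡ b)
𝕩 ≟L 𝕩 = yes refl
𝕩 ≟L 𝕪 _ = no (λ ())
𝕪 _ ≟L 𝕩 = no (λ ())
𝕪 s ≟L 𝕪 t with s ≟F t
... | yes refl = yes refl
... | no ne = no (λ { refl → ne refl })

_≟W_ : ∀ {r} (u v : Word r) → Dec (u ≡ v)
_≟W_ = ≡-dec _≟L_

Poly : ℕ → Set
Poly r = List (ℚ × Word r)

coeff : ∀ {r} → Poly r → Word r → ℚ
coeff [] w = 0ℚ
coeff ((c , v) ∷ p) w = (if ⌊ v ≟W w ⌋ then c else 0ℚ) +ℚ coeff p w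

infix 4 _≈_
_≈_ : ∀ {r} → Poly r → Poly r → Set
p ≈ q = ∀ w → coeff p w ≡ coeff q w

𝟘 : ∀ {r} → Poly r
𝟘 = []

𝟙 : ∀ {r} → Poly r
𝟙 = (1ℚ , []) ∷ []

infixl 6 _⊕_ _⊖_
infixl 7 _⊛_ _·_

_⊕_ : ∀ {r} → Poly r → Poly r → Poly r
p ⊕ q = p ++ q

_·_ : ∀ {r} → ℚ → Poly r → Poly r
c · p = map (λ { (d , w) → (c *ℚ d , w) }) p

⊝_ : ∀ {r} → Poly r → Poly r
⊝ p = (- 1ℚ) · p

_⊖_ : ∀ {r} → Poly r → Poly r → Poly r
p ⊖ q = p ⊕ (⊝ q)

_⊛_ : ∀ {r} → Poly r → Poly r → Poly r
p ⊛ q = concatMap (λ { (c , v) → map (λ { (d , w) → (c *ℚ d , v ++ w) }) q }) p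

ΣP : ∀ {r} → List (Poly r) → Poly r
ΣP = foldr _⊕_ 𝟘

xP : ∀ {r} → Poly r
xP = (1ℚ , 𝕩 ∷ []) ∷ []

yP : ∀ {r} → Fin r → Poly r
yP s = (1ℚ , 𝕪 s ∷ []) ∷ []

zP : ∀ {n} → Poly (suc n)
zP = xP ⊕ yP zero

δ : ∀ {n} → Fin (suc n) → ℚ
δ zero = 0ℚ
δ (suc _) = 1ℚ

zδ : ∀ {n} → Fin (suc n) → Poly (suc n)
zδ s = xP ⊕ δ s · yP s

data Gen {n : ℕ} : Poly (suc n) → Set where
  gen-z  : Gen zP
  gen-zδ : (s : Fin (suc n)) → Gen (zδ s)

τL : ∀ {n} → Letter (suc n) → Poly (suc n)
τL 𝕩 = yP zero
τL (𝕪 zero) = xP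
τL (𝕪 (suc s)) = ⊝ yP (suc s)

τW : ∀ {n} → Word (suc n) → Poly (suc n)
τW [] = 𝟙
τW (l ∷ w) = τW w ⊛ τL l

τ : ∀ {n} → Poly (suc n) → Poly (suc n)
τ p = ΣP (map (λ { (c , w) → c · τW w }) p)

-- Trees/forests are represented by (planar) representatives: a tree is
-- B₊ of a forest, a forest is a list of trees (product in ℋ = ++).

data Tree : Set where
  B₊ : List Tree → Tree

Forest : Set
Forest = List Tree

• : Tree
• = B₊ []

mulT : List (Forest × Forest) → List (Forest × Forest) → List (Forest × Forest)
mulT xs ys = concatMap (λ { (a , b) → map (λ { (c , d) → (a ++ c , b ++ d) }) ys }) xs

mutual
  ΔT : Tree → List (Forest × Forest)
  ΔT (B₊ fs) = ((B₊ fs ∷ []) , []) ∷ map (λ { (a , b) → (a , B₊ b ∷ []) }) (ΔF fs)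

  ΔF : Forest → List (Forest × Forest)
  ΔF [] = ([] , []) ∷ []
  ΔF (t ∷ ts) = mulT (ΔT t) (ΔF ts)

HC : Set
HC = List (ℚ × Forest)

_⊛H_ : HC → HC → HC
p ⊛H q = concatMap (λ { (c , v) → map (λ { (d , w) → (c *ℚ d , v ++ w) }) q }) p

mutual
  size : Tree → ℕ
  size (B₊ fs) = suc (sizeF fs)

  sizeF : Forest → ℕ
  sizeF [] = 0
  sizeF (t ∷ ts) = size t +ℕ sizeF ts

-- Antipode, computed by the recursion coming from m(S⊗id)Δ = I Î:
--   S(B₊ f) = - Σ_{(a,b) ∈ Δ(f)} S(a) · B₊(b),   S(t₁⋯tₖ) = S(tₖ)⋯S(t₁).
-- The ℕ argument is fuel (recursion on number of vertices); it is always
-- sufficient when instantiated as below.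
mutual
  Sfuel : ℕ → Tree → HC
  Sfuel zero _ = []
  Sfuel (suc n) (B₊ fs) =
    map (λ { (c , g) → (- c , g) })
        (concatMap (λ { (a , b) → SFfuel n a ⊛H ((1ℚ , B₊ b ∷ []) ∷ []) }) (ΔF fs))

  SFfuel : ℕ → Forest → HC
  SFfuel n [] = (1ℚ , []) ∷ []
  SFfuel n (t ∷ ts) = SFfuel n ts ⊛H Sfuel n t

SForest : Forest → HC
SForest f = SFfuel (sizeF f) f

S : HC → HC
S h = concatMap (λ { (c , f) → map (λ { (d , g) → (c *ℚ d , g) }) (SForest f) }) h

-- Rooted tree maps: a family F : Forest → End(𝒜_r) satisfying the
-- defining properties (I)–(IV) (these determine it uniquely).

record IsRootedTreeMaps {n : ℕ} (F : Forest → Poly (suc n) → Poly (suc n)) : Set where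
  field
    resp  : ∀ f {p q} → p ≈ q → F f p ≈ F f q
    additive : ∀ f p q → F f (p ⊕ q) ≈ F f p ⊕ F f q
    homog : ∀ f c p → F f (c · p) ≈ c · F f p
    empty : ∀ p → F [] p ≈ p
    I-zδ : ∀ s → F (• ∷ []) (zδ s) ≈ zδ s ⊛ (zP ⊖ zδ s)
    tree-z : ∀ t → F (t ∷ []) zP ≈ 𝟘
    -- (II) for forests f of positive degree:
    --  F(B₊ f)(z_s^δ) = R_{z-z_s^δ} R_{2z-z_s^δ} R_{z-z_s^δ}^{-1} F(f)(z_s^δ)
    II-zδ : ∀ (t : Tree) (ts : Forest) (s : Fin (suc n)) →
      Σ (Poly (suc n)) λ q →
        (q ⊛ (zP ⊖ zδ s) ≈ F (t ∷ ts) (zδ s))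
        × (F (B₊ (t ∷ ts) ∷ []) (zδ s) ≈ q ⊛ (zP ⊕ zP ⊖ zδ s) ⊛ (zP ⊖ zδ s))
    III : ∀ g h u → Gen u → F (g ++ h) u ≈ F g (F h u)
    IV : ∀ f w u → Gen u →
      F f (w ⊛ u) ≈ ΣP (map (λ { (a , b) → F a w ⊛ F b u }) (ΔF f))

apply : ∀ {n} → (Forest → Poly (suc n) → Poly (suc n)) → HC → Poly (suc n) → Poly (suc n)
apply F h p = ΣP (map (λ { (c , f) → c · F f p }) h)

-- Induction on the number of vertices of a forest f, proving simultaneously
--   S̃(f) = τ f̃ τ   and   K(f) := Σ_{(f)} f̃′ τ f̃″ = ε(f) τ.
-- The two laws are equivalent modulo smaller forests, because f ↦ f̃ is multiplicative and
-- S is the convolution inverse of the identity, i.e. Σ_{(f)} S̃(f′) f̃″ = ε(f).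
-- For a product of forests the first law follows from those of the factors once rooted tree
-- maps are known to commute, since S reverses products. For a single tree the second law is
-- checked on the generators z and z_s^δ (for z_s^δ by unfolding (II)) and propagates to all
-- words, because by (IV) K(f)(wq) = K(f)(q) τ(w) as soon as the law holds below f.
-- Commutativity f̃ g̃ = g̃ f̃ is proved on z_s^δ by pairing against a kernel Kern(g, h) that is
-- symmetric in g and h; Kern is built from polynomials ν(f) in z with
-- Σ_{(f)} f̃′(z_s^δ) (ν(f″)(z − z_s^δ) + ε(f″)) = ε(f) z_s^δ.
--
-- Equality in 𝒜_r is handled through the pairing of a formal sum Σ cᵢ wᵢ with a function g on
-- words, Σ cᵢ g(wᵢ): two elements are equal iff all their pairings agree, which reduces
-- identities in 𝒜_r to ring identities over ℚ.

module Submission where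

open import Data.Bool using (Bool; true; false; if_then_else_)
open import Data.Empty using (⊥-elim)
open import Data.Fin using (Fin; zero; suc)
open import Data.List using (List; []; _∷_; _++_; map; concatMap; length)
import Data.List.Properties as LP
open import Data.List.Relation.Unary.All as All using (All; []; _∷_)
import Data.List.Relation.Unary.All.Properties as All
open import Data.List.Reverse using (Reverse; reverseView; []; _∶_∶ʳ_)
open import Data.Nat using (ℕ; zero; suc; s≤s; z≤n) renaming (_+_ to _+ℕ_; _≤_ to _≤ℕ_; _<_ to _<ℕ_)
import Data.Nat.Properties as NP
open import Data.Nat.Properties using (≤-trans; ≤-refl; m≤n⇒m≤1+n)
open import Algebra.Properties.CommutativeSemigroup NP.+-commutativeSemigroup using (interchange)
open import Data.Product using (Σ; _×_; _,_; proj₁; proj₂)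
open import Data.Rational using (ℚ; 0ℚ; 1ℚ; -_) renaming (_+_ to _+ℚ_; _*_ to _*ℚ_)
import Data.Rational.Properties as QP
open import Data.Rational.Solver using (module +-*-Solver)
open +-*-Solver using (solve; _:=_; _:+_; _:*_; :-_; con)
open import Data.Sum using (_⊎_; inj₁; inj₂)
open import Relation.Binary.Bundles using (Setoid)
import Relation.Binary.Reasoning.Setoid as SetoidReasoning
open import Relation.Binary.PropositionalEquality
open import Relation.Nullary using (yes; no; ¬_)
open import Relation.Nullary.Decidable using (⌊_⌋)

open import Defs

-- Pairing elements of 𝒜_r with functions on words

pair : ∀ {r} → Poly r → (Word r → ℚ) → ℚ
pair [] g = 0ℚ
pair ((c , w) ∷ p) g = c *ℚ g w +ℚ pair p g

δword : ∀ {r} → Word r → Word r → ℚ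
δword a b = if ⌊ a ≟W b ⌋ then 1ℚ else 0ℚ


if-then-0 : ∀ (b : Bool) c → (if b then c else 0ℚ) ≡ c *ℚ (if b then 1ℚ else 0ℚ)
if-then-0 true c = sym (QP.*-identityʳ c)
if-then-0 false c = sym (QP.*-zeroʳ c)

coeff≡pair-δ : ∀ {r} (p : Poly r) w → coeff p w ≡ pair p (λ x → δword x w)
coeff≡pair-δ [] w = refl
coeff≡pair-δ ((c , v) ∷ p) w = cong₂ _+ℚ_ (if-then-0 ⌊ v ≟W w ⌋ c) (coeff≡pair-δ p w)

if-≟W-no : ∀ {r} {w v : Word r} (c : ℚ) → ¬ (w ≡ v) → (if ⌊ w ≟W v ⌋ then c else 0ℚ) ≡ 0ℚ
if-≟W-no {w = w} {v} c ne with w ≟W v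
... | yes e = ⊥-elim (ne e)
... | no _ = refl

deleteWord : ∀ {r} → Word r → Poly r → Poly r
deleteWord v [] = []
deleteWord v ((d , w) ∷ p) with w ≟W v
... | yes _ = deleteWord v p
... | no _ = (d , w) ∷ deleteWord v p

pair-deleteWord : ∀ {r} v (p : Poly r) g → pair p g ≡ coeff p v *ℚ g v +ℚ pair (deleteWord v p) g
pair-deleteWord v [] g = sym (trans (cong (_+ℚ 0ℚ) (QP.*-zeroˡ (g v))) (QP.+-identityʳ 0ℚ))
pair-deleteWord v ((d , w) ∷ p) g with w ≟W v
... | yes refl = trans (cong (d *ℚ g w +ℚ_) (pair-deleteWord w p g))
   (solve 4 (λ d gw c s → d :* gw :+ (c :* gw :+ s) := (d :+ c) :* gw :+ s) refl d (g w) (coeff p w) (pair (deleteWord w p) g))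
... | no _ = trans (cong (d *ℚ g w +ℚ_) (pair-deleteWord v p g))
   (solve 5 (λ d gw c gv s → d :* gw :+ (c :* gv :+ s) := (con 0ℚ :+ c) :* gv :+ (d :* gw :+ s)) refl d (g w) (coeff p v) (g v) (pair (deleteWord v p) g))

coeff-deleteWord-self : ∀ {r} v (p : Poly r) → coeff (deleteWord v p) v ≡ 0ℚ
coeff-deleteWord-self v [] = refl
coeff-deleteWord-self v ((d , w) ∷ p) with w ≟W v
... | yes _ = coeff-deleteWord-self v p
... | no ne = trans (cong (_+ℚ _) (if-≟W-no d ne)) (trans (QP.+-identityˡ _) (coeff-deleteWord-self v p))

coeff-deleteWord-other : ∀ {r} v w (p : Poly r) → ¬ (w ≡ v) → coeff (deleteWord v p) w ≡ coeff p w
coeff-deleteWord-other v w [] ne = refl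
coeff-deleteWord-other v w ((d , x) ∷ p) ne with x ≟W v
... | no _ = cong ((if ⌊ x ≟W w ⌋ then d else 0ℚ) +ℚ_) (coeff-deleteWord-other v w p ne)
... | yes refl with x ≟W w
...   | yes refl = ⊥-elim (ne refl)
...   | no ne2 = trans (coeff-deleteWord-other v w p ne) (sym (QP.+-identityˡ _))


length-deleteWord : ∀ {r} v (p : Poly r) → length (deleteWord v p) ≤ℕ length p
length-deleteWord v [] = z≤n
length-deleteWord v ((d , w) ∷ p) with w ≟W v
... | yes _ = m≤n⇒m≤1+n (length-deleteWord v p)
... | no _ = s≤s (length-deleteWord v p)

deleteWord-head : ∀ {r} c v (p : Poly r) → deleteWord v ((c , v) ∷ p) ≡ deleteWord v p
deleteWord-head c v p with v ≟W v
... | yes _ = refl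
... | no ne = ⊥-elim (ne refl)

pair-of-zero-coeffs-≤ : ∀ {r} n (p : Poly r) → length p ≤ℕ n → (∀ w → coeff p w ≡ 0ℚ) → ∀ g → pair p g ≡ 0ℚ
pair-of-zero-coeffs-≤ n [] _ _ g = refl
pair-of-zero-coeffs-≤ (suc n) ((c , v) ∷ p) (s≤s le) z g =
  trans (pair-deleteWord v ((c , v) ∷ p) g)
  (trans (cong₂ _+ℚ_ (trans (cong (_*ℚ g v) (z v)) (QP.*-zeroˡ (g v)))
                     (trans (cong (λ q → pair q g) (deleteWord-head c v p))
                       (pair-of-zero-coeffs-≤ n (deleteWord v p) (≤-trans (length-deleteWord v p) le) z' g)))
         (QP.+-identityˡ 0ℚ))
  where
  z' : ∀ w → coeff (deleteWord v p) w ≡ 0ℚ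
  z' w with w ≟W v
  ... | yes refl = coeff-deleteWord-self w p
  ... | no ne = trans (sym (cong (λ q → coeff q w) (deleteWord-head c v p)))
                 (trans (coeff-deleteWord-other v w ((c , v) ∷ p) ne) (z w))

pair-of-zero-coeffs : ∀ {r} (p : Poly r) → (∀ w → coeff p w ≡ 0ℚ) → ∀ g → pair p g ≡ 0ℚ
pair-of-zero-coeffs p = pair-of-zero-coeffs-≤ (length p) p ≤-refl

pair-++ : ∀ {r} (p q : Poly r) g → pair (p ++ q) g ≡ pair p g +ℚ pair q g
pair-++ [] q g = sym (QP.+-identityˡ _)
pair-++ ((c , w) ∷ p) q g = trans (cong (c *ℚ g w +ℚ_) (pair-++ p q g)) (sym (QP.+-assoc (c *ℚ g w) (pair p g) (pair q g)))

pair-· : ∀ {r} c (p : Poly r) g → pair (c · p) g ≡ c *ℚ pair p g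
pair-· c [] g = sym (QP.*-zeroʳ c)
pair-· c ((d , w) ∷ p) g = trans (cong ((c *ℚ d) *ℚ g w +ℚ_) (pair-· c p g))
  (solve 4 (λ c d gw s → (c :* d) :* gw :+ c :* s := c :* (d :* gw :+ s)) refl c d (g w) (pair p g))

coeff-++ : ∀ {r} (p q : Poly r) w → coeff (p ++ q) w ≡ coeff p w +ℚ coeff q w
coeff-++ p q w = trans (coeff≡pair-δ (p ++ q) w) (trans (pair-++ p q _) (sym (cong₂ _+ℚ_ (coeff≡pair-δ p w) (coeff≡pair-δ q w))))

coeff-· : ∀ {r} c (p : Poly r) w → coeff (c · p) w ≡ c *ℚ coeff p w
coeff-· c p w = trans (coeff≡pair-δ (c · p) w) (trans (pair-· c p _) (cong (c *ℚ_) (sym (coeff≡pair-δ p w))))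

≈⇒pair≡ : ∀ {r} {p q : Poly r} → p ≈ q → ∀ g → pair p g ≡ pair q g
≈⇒pair≡ {p = p} {q} e g = begin
    pair p g                                   ≡⟨ solve 2 (λ a b → a := (a :+ con (- 1ℚ) :* b) :+ b) refl (pair p g) (pair q g) ⟩
    (pair p g +ℚ (- 1ℚ) *ℚ pair q g) +ℚ pair q g ≡⟨ cong (_+ℚ pair q g) (trans (sym (trans (pair-++ p ((- 1ℚ) · q) g)
        (cong (pair p g +ℚ_) (pair-· (- 1ℚ) q g)))) (pair-of-zero-coeffs (p ++ ((- 1ℚ) · q)) z g)) ⟩
    0ℚ +ℚ pair q g                              ≡⟨ QP.+-identityˡ _ ⟩
    pair q g ∎
  where
  open ≡-Reasoning
  z : ∀ w → coeff (p ++ ((- 1ℚ) · q)) w ≡ 0ℚ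
  z w = trans (coeff-++ p _ w) (trans (cong₂ _+ℚ_ (e w) (coeff-· (- 1ℚ) q w))
          (solve 1 (λ a → a :+ con (- 1ℚ) :* a := con 0ℚ) refl (coeff q w)))

pair≡⇒≈ : ∀ {r} {p q : Poly r} → (∀ g → pair p g ≡ pair q g) → p ≈ q
pair≡⇒≈ {p = p} {q} h w = trans (coeff≡pair-δ p w) (trans (h _) (sym (coeff≡pair-δ q w)))

Σℚ : ∀ {A : Set} → List A → (A → ℚ) → ℚ
Σℚ [] h = 0ℚ
Σℚ (x ∷ xs) h = h x +ℚ Σℚ xs h

pair-congʳ : ∀ {r} (p : Poly r) {g h : Word r → ℚ} → (∀ w → g w ≡ h w) → pair p g ≡ pair p h
pair-congʳ [] e = refl
pair-congʳ ((c , w) ∷ p) e = cong₂ _+ℚ_ (cong (c *ℚ_) (e w)) (pair-congʳ p e)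

Σℚ-cong : ∀ {A : Set} (xs : List A) {g h : A → ℚ} → (∀ w → g w ≡ h w) → Σℚ xs g ≡ Σℚ xs h
Σℚ-cong [] e = refl
Σℚ-cong (x ∷ xs) e = cong₂ _+ℚ_ (e x) (Σℚ-cong xs e)

pair-map : ∀ {r r'} (f : ℚ × Word r → ℚ × Word r') c (h : Word r → Word r') →
  (∀ d x → f (d , x) ≡ (c *ℚ d , h x)) → ∀ q g → pair (map f q) g ≡ c *ℚ pair q (λ x → g (h x))
pair-map f c h e [] g = sym (QP.*-zeroʳ c)
pair-map f c h e ((d , x) ∷ q) g rewrite e d x =
  trans (cong ((c *ℚ d) *ℚ g (h x) +ℚ_) (pair-map f c h e q g))
  (solve 4 (λ c d gw s → (c :* d) :* gw :+ c :* s := c :* (d :* gw :+ s)) refl c d (g (h x)) (pair q (λ x → g (h x))))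

pair-⊛ : ∀ {r} (p q : Poly r) g → pair (p ⊛ q) g ≡ pair p (λ v → pair q (λ x → g (v ++ x)))
pair-⊛ [] q g = refl
pair-⊛ ((c , v) ∷ p) q g = trans (pair-++ (map (λ { (d , x) → (c *ℚ d , v ++ x) }) q) (p ⊛ q) g)
  (cong₂ _+ℚ_ (pair-map _ c (v ++_) (λ d x → refl) q g) (pair-⊛ p q g))

pair-ΣP : ∀ {r} {A : Set} (f : A → Poly r) (xs : List A) g → pair (ΣP (map f xs)) g ≡ Σℚ xs (λ x → pair (f x) g)
pair-ΣP f [] g = refl
pair-ΣP f (x ∷ xs) g = trans (pair-++ (f x) _ g) (cong (pair (f x) g +ℚ_) (pair-ΣP f xs g))

Σℚ≡pair : ∀ {r} (p : Poly r) (G : Word r → ℚ) → Σℚ p (λ x → proj₁ x *ℚ G (proj₂ x)) ≡ pair p G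
Σℚ≡pair [] G = refl
Σℚ≡pair ((c , w) ∷ p) G = cong (c *ℚ G w +ℚ_) (Σℚ≡pair p G)

pair-τ : ∀ {n} (p : Poly (suc n)) g → pair (τ p) g ≡ pair p (λ w → pair (τW w) g)
pair-τ p g = trans (pair-ΣP (λ x → proj₁ x · τW (proj₂ x)) p g) (trans (Σℚ-cong p (λ x → pair-· (proj₁ x) (τW (proj₂ x)) g)) (Σℚ≡pair p _))

pair-mono : ∀ {r} (w : Word r) g → pair ((1ℚ , w) ∷ []) g ≡ g w
pair-mono w g = trans (QP.+-identityʳ _) (QP.*-identityˡ _)


-- The algebra 𝒜_r

-- A record around _≈_, so that both sides can be recovered from the type.
infix 4 _≋_
record _≋_ {r : ℕ} (p q : Poly r) : Set where
  constructor ⟨_⟩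
  field un : p ≈ q
open _≋_ public

≋-refl : ∀ {r} {p : Poly r} → p ≋ p
≋-refl = ⟨ (λ w → refl) ⟩
≋-sym : ∀ {r} {p q : Poly r} → p ≋ q → q ≋ p
≋-sym e = ⟨ (λ w → sym (un e w)) ⟩
≋-trans : ∀ {r} {p q s : Poly r} → p ≋ q → q ≋ s → p ≋ s
≋-trans e f = ⟨ (λ w → trans (un e w) (un f w)) ⟩
≡→≋ : ∀ {r} {p q : Poly r} → p ≡ q → p ≋ q
≡→≋ refl = ≋-refl

pair≡⇒≋ : ∀ {r} {p q : Poly r} → (∀ g → pair p g ≡ pair q g) → p ≋ q
pair≡⇒≋ {p = p} {q} h = ⟨ pair≡⇒≈ {p = p} {q} h ⟩
≋⇒pair≡ : ∀ {r} {p q : Poly r} → p ≋ q → ∀ g → pair p g ≡ pair q g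
≋⇒pair≡ {p = p} {q} e = ≈⇒pair≡ {p = p} {q} (un e)

≋-setoid : ℕ → Setoid _ _
≋-setoid r = record { Carrier = Poly r ; _≈_ = _≋_ ; isEquivalence = record { refl = ≋-refl ; sym = ≋-sym ; trans = ≋-trans } }

module ≋-Reasoning {r : ℕ} = SetoidReasoning (≋-setoid r)

pair-+ʳ : ∀ {r} (p : Poly r) G H → pair p (λ w → G w +ℚ H w) ≡ pair p G +ℚ pair p H
pair-+ʳ [] G H = sym (QP.+-identityˡ 0ℚ)
pair-+ʳ ((c , w) ∷ p) G H = trans (cong (c *ℚ (G w +ℚ H w) +ℚ_) (pair-+ʳ p G H))
  (solve 5 (λ c a b s t → c :* (a :+ b) :+ (s :+ t) := (c :* a :+ s) :+ (c :* b :+ t)) refl c (G w) (H w) (pair p G) (pair p H))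

pair-*ʳ : ∀ {r} (p : Poly r) c G → pair p (λ w → c *ℚ G w) ≡ c *ℚ pair p G
pair-*ʳ [] c G = sym (QP.*-zeroʳ c)
pair-*ʳ ((d , w) ∷ p) c G = trans (cong (d *ℚ (c *ℚ G w) +ℚ_) (pair-*ʳ p c G))
  (solve 4 (λ d c a s → d :* (c :* a) :+ c :* s := c :* (d :* a :+ s)) refl d c (G w) (pair p G))

pair-0ʳ : ∀ {r} (p : Poly r) → pair p (λ _ → 0ℚ) ≡ 0ℚ
pair-0ʳ p = trans (pair-*ʳ p 0ℚ (λ _ → 0ℚ)) (QP.*-zeroˡ (pair p (λ _ → 0ℚ)))

pair-swap : ∀ {r} (p q : Poly r) (G : Word r → Word r → ℚ) →
  pair p (λ v → pair q (λ x → G v x)) ≡ pair q (λ x → pair p (λ v → G v x))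
pair-swap [] q G = sym (pair-0ʳ q)
pair-swap ((c , v) ∷ p) q G = trans (cong₂ _+ℚ_ (sym (pair-*ʳ q c (G v))) (pair-swap p q G))
  (sym (pair-+ʳ q (λ x → c *ℚ G v x) (λ x → pair p (λ v → G v x))))


module _ {r : ℕ} where

  ⊕-cong : {p p' q q' : Poly r} → p ≋ p' → q ≋ q' → p ⊕ q ≋ p' ⊕ q'
  ⊕-cong {p} {p'} {q} {q'} e f = pair≡⇒≋ λ g → trans (pair-++ p q g) (trans (cong₂ _+ℚ_ (≋⇒pair≡ e g) (≋⇒pair≡ f g)) (sym (pair-++ p' q' g)))

  ⊕-congʳ : (p : Poly r) {q q' : Poly r} → q ≋ q' → p ⊕ q ≋ p ⊕ q'
  ⊕-congʳ p e = ⊕-cong (≋-refl {p = p}) e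

  ⊕-congˡ : {p p' : Poly r} (q : Poly r) → p ≋ p' → p ⊕ q ≋ p' ⊕ q
  ⊕-congˡ q e = ⊕-cong e (≋-refl {p = q})

  ⊕-comm : (p q : Poly r) → p ⊕ q ≋ q ⊕ p
  ⊕-comm p q = pair≡⇒≋ λ g → trans (pair-++ p q g) (trans (QP.+-comm (pair p g) (pair q g)) (sym (pair-++ q p g)))

  ⊕-assoc : (p q s : Poly r) → (p ⊕ q) ⊕ s ≋ p ⊕ (q ⊕ s)
  ⊕-assoc p q s = ≡→≋ (LP.++-assoc p q s)

  ⊕-idʳ : (p : Poly r) → p ⊕ 𝟘 ≋ p
  ⊕-idʳ p = ≡→≋ (LP.++-identityʳ p)

  ·-cong : (c : ℚ) {p q : Poly r} → p ≋ q → c · p ≋ c · q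
  ·-cong c {p} {q} e = pair≡⇒≋ λ g → trans (pair-· c p g) (trans (cong (c *ℚ_) (≋⇒pair≡ e g)) (sym (pair-· c q g)))

  ·-⊕ : (c : ℚ) (p q : Poly r) → c · (p ⊕ q) ≋ c · p ⊕ c · q
  ·-⊕ c p q = ≡→≋ (LP.map-++ _ p q)

  +-distrib-· : (c d : ℚ) (p : Poly r) → (c +ℚ d) · p ≋ c · p ⊕ d · p
  +-distrib-· c d p = pair≡⇒≋ λ g → trans (pair-· (c +ℚ d) p g) (trans (QP.*-distribʳ-+ (pair p g) c d)
     (sym (trans (pair-++ (c · p) (d · p) g) (cong₂ _+ℚ_ (pair-· c p g) (pair-· d p g)))))

  ·-assoc : (c d : ℚ) (p : Poly r) → c · (d · p) ≋ (c *ℚ d) · p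
  ·-assoc c d p = pair≡⇒≋ λ g → trans (pair-· c (d · p) g) (trans (cong (c *ℚ_) (pair-· d p g))
     (trans (sym (QP.*-assoc c d (pair p g))) (sym (pair-· (c *ℚ d) p g))))

  ·-identityˡ : (p : Poly r) → 1ℚ · p ≋ p
  ·-identityˡ p = pair≡⇒≋ λ g → trans (pair-· 1ℚ p g) (QP.*-identityˡ (pair p g))

  ·-zeroˡ : (p : Poly r) → 0ℚ · p ≋ 𝟘
  ·-zeroˡ p = pair≡⇒≋ λ g → trans (pair-· 0ℚ p g) (QP.*-zeroˡ (pair p g))

  ⊛-cong : {p p' q q' : Poly r} → p ≋ p' → q ≋ q' → p ⊛ q ≋ p' ⊛ q'
  ⊛-cong {p} {p'} {q} {q'} e f = pair≡⇒≋ λ g → trans (pair-⊛ p q g) (trans (≋⇒pair≡ e _)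
     (trans (pair-congʳ p' (λ v → ≋⇒pair≡ f _)) (sym (pair-⊛ p' q' g))))

  ⊛-congʳ : (p : Poly r) {q q' : Poly r} → q ≋ q' → p ⊛ q ≋ p ⊛ q'
  ⊛-congʳ p e = ⊛-cong (≋-refl {p = p}) e

  ⊛-congˡ : {p p' : Poly r} (q : Poly r) → p ≋ p' → p ⊛ q ≋ p' ⊛ q
  ⊛-congˡ q e = ⊛-cong e (≋-refl {p = q})

  ⊛-assoc : (p q s : Poly r) → (p ⊛ q) ⊛ s ≋ p ⊛ (q ⊛ s)
  ⊛-assoc p q s = pair≡⇒≋ λ g → trans (pair-⊛ (p ⊛ q) s g) (trans (pair-⊛ p q _)
     (trans (pair-congʳ p (λ v → pair-congʳ q (λ y → pair-congʳ s (λ x → cong g (LP.++-assoc v y x)))))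
     (sym (trans (pair-⊛ p (q ⊛ s) g) (pair-congʳ p (λ v → pair-⊛ q s _))))))

  ⊛-⊕ˡ : (p q s : Poly r) → (p ⊕ q) ⊛ s ≋ p ⊛ s ⊕ q ⊛ s
  ⊛-⊕ˡ p q s = pair≡⇒≋ λ g → trans (pair-⊛ (p ⊕ q) s g) (trans (pair-++ p q _)
     (sym (trans (pair-++ (p ⊛ s) (q ⊛ s) g) (cong₂ _+ℚ_ (pair-⊛ p s g) (pair-⊛ q s g)))))

  ⊛-⊕ʳ : (p q s : Poly r) → p ⊛ (q ⊕ s) ≋ p ⊛ q ⊕ p ⊛ s
  ⊛-⊕ʳ p q s = pair≡⇒≋ λ g → trans (pair-⊛ p (q ⊕ s) g) (trans (pair-congʳ p (λ v → pair-++ q s _))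
     (trans (pair-+ʳ p _ _)
     (sym (trans (pair-++ (p ⊛ q) (p ⊛ s) g) (cong₂ _+ℚ_ (pair-⊛ p q g) (pair-⊛ p s g))))))

  ⊛-·ˡ : (c : ℚ) (p q : Poly r) → (c · p) ⊛ q ≋ c · (p ⊛ q)
  ⊛-·ˡ c p q = pair≡⇒≋ λ g → trans (pair-⊛ (c · p) q g) (trans (pair-· c p _)
     (sym (trans (pair-· c (p ⊛ q) g) (cong (c *ℚ_) (pair-⊛ p q g)))))

  ⊛-·ʳ : (c : ℚ) (p q : Poly r) → p ⊛ (c · q) ≋ c · (p ⊛ q)
  ⊛-·ʳ c p q = pair≡⇒≋ λ g → trans (pair-⊛ p (c · q) g) (trans (pair-congʳ p (λ v → pair-· c q _))
     (trans (pair-*ʳ p c _) (sym (trans (pair-· c (p ⊛ q) g) (cong (c *ℚ_) (pair-⊛ p q g))))))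

  ⊛-identityˡ : (p : Poly r) → 𝟙 ⊛ p ≋ p
  ⊛-identityˡ p = pair≡⇒≋ λ g → trans (pair-⊛ 𝟙 p g) (pair-mono [] (λ v → pair p (λ x → g (v ++ x))))

  ⊛-identityʳ : (p : Poly r) → p ⊛ 𝟙 ≋ p
  ⊛-identityʳ p = pair≡⇒≋ λ g → trans (pair-⊛ p 𝟙 g) (pair-congʳ p (λ v → trans (pair-mono [] (λ x → g (v ++ x))) (cong g (LP.++-identityʳ v))))

  ⊛-zeroʳ : (p : Poly r) → p ⊛ 𝟘 ≋ 𝟘
  ⊛-zeroʳ p = pair≡⇒≋ λ g → trans (pair-⊛ p 𝟘 g) (pair-0ʳ p)

  ⊖-inverseʳ : (p : Poly r) → p ⊖ p ≋ 𝟘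
  ⊖-inverseʳ p = pair≡⇒≋ λ g → trans (pair-++ p (⊝ p) g) (trans (cong (pair p g +ℚ_) (pair-· (- 1ℚ) p g))
     (solve 1 (λ a → a :+ con (- 1ℚ) :* a := con 0ℚ) refl (pair p g)))

  ⊖≋𝟘⇒≋ : {p q : Poly r} → p ⊖ q ≋ 𝟘 → p ≋ q
  ⊖≋𝟘⇒≋ {p} {q} e = pair≡⇒≋ λ g → trans (solve 2 (λ a b → a := (a :+ con (- 1ℚ) :* b) :+ b) refl (pair p g) (pair q g))
     (trans (cong (_+ℚ pair q g) (trans (sym (trans (pair-++ p (⊝ q) g) (cong (pair p g +ℚ_) (pair-· (- 1ℚ) q g)))) (≋⇒pair≡ e g)))
       (QP.+-identityˡ (pair q g)))

  ≋⇒⊖≋𝟘 : {p q : Poly r} → p ≋ q → p ⊖ q ≋ 𝟘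
  ≋⇒⊖≋𝟘 {p} {q} e = ≋-trans (⊕-cong e ≋-refl) (⊖-inverseʳ q)

mono : ∀ {r} → Word r → Poly r
mono w = (1ℚ , w) ∷ []

pair-⊖ : ∀ {r} (p q : Poly r) g → pair (p ⊖ q) g ≡ pair p g +ℚ (- 1ℚ) *ℚ pair q g
pair-⊖ p q g = trans (pair-++ p (⊝ q) g) (cong (pair p g +ℚ_) (pair-· (- 1ℚ) q g))

module _ {r : ℕ} where
  ⊝-cong : {p q : Poly r} → p ≋ q → ⊝ p ≋ ⊝ q
  ⊝-cong = ·-cong (- 1ℚ)

  ⊖-cong : {p p' q q' : Poly r} → p ≋ p' → q ≋ q' → p ⊖ q ≋ p' ⊖ q'
  ⊖-cong e f = ⊕-cong e (⊝-cong f)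

  ⊖-identityʳ : (p : Poly r) → p ⊖ 𝟘 ≋ p
  ⊖-identityʳ p = ⊕-idʳ p

  ⊛-⊖ʳ : (p q s : Poly r) → p ⊛ (q ⊖ s) ≋ p ⊛ q ⊖ p ⊛ s
  ⊛-⊖ʳ p q s = ≋-trans (⊛-⊕ʳ p q (⊝ s)) (⊕-cong ≋-refl (⊛-·ʳ (- 1ℚ) p s))

  ⊛-⊖ˡ : (p q s : Poly r) → (p ⊖ q) ⊛ s ≋ p ⊛ s ⊖ q ⊛ s
  ⊛-⊖ˡ p q s = ≋-trans (⊛-⊕ˡ p (⊝ q) s) (⊕-cong ≋-refl (⊛-·ˡ (- 1ℚ) q s))

  ⊝-inverseˡ : (A : Poly r) → ⊝ A ⊕ A ≋ 𝟘
  ⊝-inverseˡ A = ≋-trans (⊕-comm (⊝ A) A) (⊖-inverseʳ A)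

  ⊕-⊝-⊖-cancel : (A B : Poly r) → (A ⊕ B) ⊕ (⊝ A ⊖ B) ≋ 𝟘
  ⊕-⊝-⊖-cancel A B = pair≡⇒≋ λ g → trans (pair-++ (A ⊕ B) (⊝ A ⊖ B) g) (trans (cong₂ _+ℚ_ (pair-++ A B g)
    (trans (pair-⊖ (⊝ A) B g) (cong (_+ℚ (- 1ℚ) *ℚ pair B g) (pair-· (- 1ℚ) A g))))
    (solve 2 (λ a b → (a :+ b) :+ (con (- 1ℚ) :* a :+ con (- 1ℚ) :* b) := con 0ℚ) refl (pair A g) (pair B g)))

  ⊕≋𝟘⇒≋⊝ : (A B : Poly r) → A ⊕ B ≋ 𝟘 → A ≋ ⊝ B
  ⊕≋𝟘⇒≋⊝ A B e = ⊖≋𝟘⇒≋ (pair≡⇒≋ λ g → trans (pair-⊖ A (⊝ B) g) (trans (cong (λ x → pair A g +ℚ (- 1ℚ) *ℚ x) (pair-· (- 1ℚ) B g))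
    (trans (solve 2 (λ a b → a :+ con (- 1ℚ) :* (con (- 1ℚ) :* b) := a :+ b) refl (pair A g) (pair B g)) (trans (sym (pair-++ A B g)) (≋⇒pair≡ e g)))))

  ·-⊛-· : ∀ c d (p q : Poly r) → (c · p) ⊛ (d · q) ≋ (c *ℚ d) · (p ⊛ q)
  ·-⊛-· c d p q = ≋-trans (⊛-·ˡ c p (d · q)) (≋-trans (·-cong c (⊛-·ʳ d p q)) (·-assoc c d (p ⊛ q)))

  -- The hypothesis says that v contains the one-letter word l0 with coefficient 1 and no other
  -- word ending in l0, so the coefficient of p ⊛ v at w ++ l0 is that of p at w.
  cancelʳ-by-letter : (v : Poly r) (l0 : Letter r) → (∀ a w → pair v (λ x → δword (a ++ x) (w ++ (l0 ∷ []))) ≡ δword a w) →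
            ∀ (p : Poly r) → p ⊛ v ≋ 𝟘 → p ≋ 𝟘
  cancelʳ-by-letter v l0 hv p e = ⟨ (λ w → trans (coeff≡pair-δ p w) (trans (pair-congʳ p (λ a → sym (hv a w)))
     (trans (sym (pair-⊛ p v _)) (trans (sym (coeff≡pair-δ (p ⊛ v) (w ++ (l0 ∷ [])))) (un e (w ++ (l0 ∷ []))))))) ⟩

  cancelˡ-by-letter : (u : Poly r) (l0 : Letter r) → (∀ a w → pair u (λ x → δword (x ++ a) (l0 ∷ w)) ≡ δword a w) →
            ∀ (p : Poly r) → u ⊛ p ≋ 𝟘 → p ≋ 𝟘
  cancelˡ-by-letter u l0 hu p e = ⟨ (λ w → trans (coeff≡pair-δ p w) (trans (pair-congʳ p (λ a → sym (hu a w)))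
     (trans (sym (pair-swap u p (λ x a → δword (x ++ a) (l0 ∷ w))))
     (trans (sym (pair-⊛ u p _)) (trans (sym (coeff≡pair-δ (u ⊛ p) (l0 ∷ w))) (un e (l0 ∷ w))))))) ⟩

  δword-∷ʳ-≡ : (a w : Word r) (l : Letter r) → δword (a ++ l ∷ []) (w ++ l ∷ []) ≡ δword a w
  δword-∷ʳ-≡ a w l with (a ++ l ∷ []) ≟W (w ++ l ∷ []) | a ≟W w
  ... | yes e    | yes _ = refl
  ... | yes e    | no ne = ⊥-elim (ne (proj₁ (LP.∷ʳ-injective a w e)))
  ... | no ne    | yes refl = ⊥-elim (ne refl)
  ... | no _     | no _ = refl

  δword-∷ʳ-≢ : (a w : Word r) {l l0 : Letter r} → ¬ l ≡ l0 → δword (a ++ l ∷ []) (w ++ l0 ∷ []) ≡ 0ℚ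
  δword-∷ʳ-≢ a w {l} {l0} ne with (a ++ l ∷ []) ≟W (w ++ l0 ∷ [])
  ... | yes e = ⊥-elim (ne (proj₂ (LP.∷ʳ-injective a w e)))
  ... | no _ = refl

  δword-∷-≡ : (a w : Word r) (l : Letter r) → δword (l ∷ a) (l ∷ w) ≡ δword a w
  δword-∷-≡ a w l with (l ∷ a) ≟W (l ∷ w) | l ≟L l | a ≟W w
  ... | _     | no ne | _ = ⊥-elim (ne refl)
  ... | yes _ | yes _ | yes _ = refl
  ... | yes e | yes _ | no ne = ⊥-elim (ne (proj₂ (LP.∷-injective e)))
  ... | no ne | yes _ | yes refl = ⊥-elim (ne refl)
  ... | no _  | yes _ | no _ = refl

  δword-∷-≢ : (a w : Word r) {l l0 : Letter r} → ¬ l ≡ l0 → δword (l ∷ a) (l0 ∷ w) ≡ 0ℚ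
  δword-∷-≢ a w {l} {l0} ne with l ≟L l0
  ... | yes e = ⊥-elim (ne e)
  ... | no _ = refl

-- Generators and the anti-automorphism τ

module Generators {n : ℕ} where
  P : Set
  P = Poly (suc n)
  L : Set
  L = Letter (suc n)

  pair-letter : (l : L) (h : Word (suc n) → ℚ) → pair (mono (l ∷ [])) h ≡ h (l ∷ [])
  pair-letter l h = pair-mono (l ∷ []) h

  pair-z : ∀ h → pair (zP {n}) h ≡ h (𝕩 ∷ []) +ℚ h (𝕪 zero ∷ [])
  pair-z h = trans (pair-++ xP (yP zero) h) (cong₂ _+ℚ_ (pair-letter 𝕩 h) (pair-letter (𝕪 zero) h))

  pair-zδ-zero : ∀ h → pair (zδ {n} zero) h ≡ h (𝕩 ∷ [])
  pair-zδ-zero h = trans (pair-++ xP (0ℚ · yP zero) h) (trans (cong₂ _+ℚ_ (pair-letter 𝕩 h) (trans (pair-· 0ℚ (yP zero) h) (QP.*-zeroˡ (pair (yP zero) h))))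
     (QP.+-identityʳ (h (𝕩 ∷ []))))

  pair-zδ-suc : ∀ s h → pair (zδ {n} (suc s)) h ≡ h (𝕩 ∷ []) +ℚ h (𝕪 (suc s) ∷ [])
  pair-zδ-suc s h = trans (pair-++ xP (1ℚ · yP (suc s)) h) (cong₂ _+ℚ_ (pair-letter 𝕩 h) (trans (pair-· 1ℚ (yP (suc s)) h)
      (trans (QP.*-identityˡ (pair (yP (suc s)) h)) (pair-letter (𝕪 (suc s)) h))))

  vδ : Fin (suc n) → P
  vδ s = zP ⊖ zδ s

  pair-vδ-zero : ∀ h → pair (vδ zero) h ≡ h (𝕪 zero ∷ [])
  pair-vδ-zero h = trans (pair-⊖ zP (zδ zero) h) (trans (cong₂ (λ a b → a +ℚ (- 1ℚ) *ℚ b) (pair-z h) (pair-zδ-zero h))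
     (solve 2 (λ a b → (a :+ b) :+ con (- 1ℚ) :* a := b) refl (h (𝕩 ∷ [])) (h (𝕪 zero ∷ []))))

  pair-vδ-suc : ∀ s h → pair (vδ (suc s)) h ≡ h (𝕪 zero ∷ []) +ℚ (- 1ℚ) *ℚ h (𝕪 (suc s) ∷ [])
  pair-vδ-suc s h = trans (pair-⊖ zP (zδ (suc s)) h) (trans (cong₂ (λ a b → a +ℚ (- 1ℚ) *ℚ b) (pair-z h) (pair-zδ-suc s h))
     (solve 3 (λ a b c → (a :+ b) :+ con (- 1ℚ) :* (a :+ c) := b :+ con (- 1ℚ) :* c) refl (h (𝕩 ∷ [])) (h (𝕪 zero ∷ [])) (h (𝕪 (suc s) ∷ []))))

  ⊛vδ≋𝟘⇒≋𝟘 : ∀ s (p : P) → p ⊛ vδ s ≋ 𝟘 → p ≋ 𝟘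
  ⊛vδ≋𝟘⇒≋𝟘 zero = cancelʳ-by-letter (vδ zero) (𝕪 zero) λ a w →
    trans (pair-vδ-zero (λ x → δword (a ++ x) (w ++ 𝕪 zero ∷ []))) (δword-∷ʳ-≡ a w (𝕪 zero))
  ⊛vδ≋𝟘⇒≋𝟘 (suc s) = cancelʳ-by-letter (vδ (suc s)) (𝕪 zero) λ a w →
    trans (pair-vδ-suc s (λ x → δword (a ++ x) (w ++ 𝕪 zero ∷ [])))
      (trans (cong₂ (λ x y → x +ℚ (- 1ℚ) *ℚ y) (δword-∷ʳ-≡ a w (𝕪 zero)) (δword-∷ʳ-≢ a w λ ()))
        (solve 1 (λ x → x :+ con (- 1ℚ) :* con 0ℚ := x) refl (δword a w)))

  ⊛z≋𝟘⇒≋𝟘 : (p : P) → p ⊛ zP ≋ 𝟘 → p ≋ 𝟘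
  ⊛z≋𝟘⇒≋𝟘 = cancelʳ-by-letter zP 𝕩 λ a w →
    trans (pair-z (λ x → δword (a ++ x) (w ++ 𝕩 ∷ []))) (trans (cong₂ _+ℚ_ (δword-∷ʳ-≡ a w 𝕩) (δword-∷ʳ-≢ a w {𝕪 zero} {𝕩} λ ())) (QP.+-identityʳ (δword a w)))

  zδ⊛≋𝟘⇒≋𝟘 : ∀ s (p : P) → zδ s ⊛ p ≋ 𝟘 → p ≋ 𝟘
  zδ⊛≋𝟘⇒≋𝟘 zero = cancelˡ-by-letter (zδ zero) 𝕩 λ a w →
    trans (pair-zδ-zero (λ x → δword (x ++ a) (𝕩 ∷ w))) (δword-∷-≡ a w 𝕩)
  zδ⊛≋𝟘⇒≋𝟘 (suc s) = cancelˡ-by-letter (zδ (suc s)) 𝕩 λ a w →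
    trans (pair-zδ-suc s (λ x → δword (x ++ a) (𝕩 ∷ w))) (trans (cong₂ _+ℚ_ (δword-∷-≡ a w 𝕩) (δword-∷-≢ a w {𝕪 (suc s)} {𝕩} λ ())) (QP.+-identityʳ (δword a w)))

  x≋zδ-zero : mono (𝕩 ∷ []) ≋ zδ {n} zero
  x≋zδ-zero = pair≡⇒≋ λ h → trans (pair-letter 𝕩 h) (sym (pair-zδ-zero h))

  y-zero≋vδ-zero : mono (𝕪 zero ∷ []) ≋ zP ⊖ zδ {n} zero
  y-zero≋vδ-zero = pair≡⇒≋ λ h → trans (pair-letter (𝕪 zero) h) (sym (pair-vδ-zero h))

  y-suc≋zδ⊖zδ : ∀ s → mono (𝕪 (suc s) ∷ []) ≋ zδ {n} (suc s) ⊖ zδ zero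
  y-suc≋zδ⊖zδ s = pair≡⇒≋ λ h → trans (pair-letter (𝕪 (suc s)) h) (sym (trans (pair-⊖ (zδ (suc s)) (zδ zero) h)
     (trans (cong₂ (λ a b → a +ℚ (- 1ℚ) *ℚ b) (pair-zδ-suc s h) (pair-zδ-zero h))
     (solve 2 (λ a b → (a :+ b) :+ con (- 1ℚ) :* a := b) refl (h (𝕩 ∷ [])) (h (𝕪 (suc s) ∷ []))))))

  τ-cong : {p q : P} → p ≋ q → τ p ≋ τ q
  τ-cong {p} {q} e = pair≡⇒≋ λ g → trans (pair-τ p g) (trans (≋⇒pair≡ e (λ w → pair (τW w) g)) (sym (pair-τ q g)))

  τ-⊕ : (p q : P) → τ (p ⊕ q) ≋ τ p ⊕ τ q
  τ-⊕ p q = pair≡⇒≋ λ g → trans (pair-τ (p ⊕ q) g) (trans (pair-++ p q _)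
     (sym (trans (pair-++ (τ p) (τ q) g) (cong₂ _+ℚ_ (pair-τ p g) (pair-τ q g)))))

  τ-· : (c : ℚ) (p : P) → τ (c · p) ≋ c · τ p
  τ-· c p = pair≡⇒≋ λ g → trans (pair-τ (c · p) g) (trans (pair-· c p _) (sym (trans (pair-· c (τ p) g) (cong (c *ℚ_) (pair-τ p g)))))

  τW-++ : (v w : Word (suc n)) → τW (v ++ w) ≋ τW w ⊛ τW v
  τW-++ [] w = ≋-sym (⊛-identityʳ (τW w))
  τW-++ (l ∷ v) w = ≋-trans (⊛-cong (τW-++ v w) ≋-refl) (⊛-assoc (τW w) (τW v) (τL l))

  τ-⊛ : (p q : P) → τ (p ⊛ q) ≋ τ q ⊛ τ p
  τ-⊛ p q = pair≡⇒≋ λ g → begin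
      pair (τ (p ⊛ q)) g ≡⟨ pair-τ (p ⊛ q) g ⟩
      pair (p ⊛ q) (λ y → pair (τW y) g) ≡⟨ pair-⊛ p q _ ⟩
      pair p (λ v → pair q (λ x → pair (τW (v ++ x)) g)) ≡⟨ pair-congʳ p (λ v → pair-congʳ q (λ x → trans (≋⇒pair≡ (τW-++ v x) g) (pair-⊛ (τW x) (τW v) g))) ⟩
      pair p (λ v → pair q (λ x → pair (τW x) (λ a → pair (τW v) (λ b → g (a ++ b))))) ≡⟨ pair-swap p q _ ⟩
      pair q (λ x → pair p (λ v → pair (τW x) (λ a → pair (τW v) (λ b → g (a ++ b))))) ≡⟨ pair-congʳ q (λ x → pair-swap p (τW x) _) ⟩
      pair q (λ x → pair (τW x) (λ a → pair p (λ v → pair (τW v) (λ b → g (a ++ b))))) ≡⟨ sym (pair-congʳ q (λ x → pair-congʳ (τW x) (λ a → pair-τ p _))) ⟩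
      pair q (λ x → pair (τW x) (λ a → pair (τ p) (λ b → g (a ++ b)))) ≡⟨ sym (pair-τ q _) ⟩
      pair (τ q) (λ a → pair (τ p) (λ b → g (a ++ b))) ≡⟨ sym (pair-⊛ (τ q) (τ p) g) ⟩
      pair (τ q ⊛ τ p) g ∎
    where open ≡-Reasoning

  τW-letter : (l : L) → τW (l ∷ []) ≋ τL l
  τW-letter l = ⊛-identityˡ (τL l)

  τ-mono : (w : Word (suc n)) → τ (mono w) ≋ τW w
  τ-mono w = ≋-trans (⊕-idʳ (1ℚ · τW w)) (·-identityˡ (τW w))

  pair-τW-letter : (l : L) → ∀ g → pair (τW (l ∷ [])) g ≡ pair (τL l) g
  pair-τW-letter l = ≋⇒pair≡ (τW-letter l)

  τ-τL : (l : L) → τ (τL l) ≋ mono (l ∷ [])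
  τ-τL 𝕩 = pair≡⇒≋ λ g → trans (pair-τ (yP zero) g) (trans (pair-mono (𝕪 zero ∷ []) (λ w → pair (τW w) g))
     (trans (pair-τW-letter (𝕪 zero) g) (trans (pair-mono (𝕩 ∷ []) g) (sym (pair-mono (𝕩 ∷ []) g)))))
  τ-τL (𝕪 zero) = pair≡⇒≋ λ g → trans (pair-τ xP g) (trans (pair-mono (𝕩 ∷ []) (λ w → pair (τW w) g))
     (trans (pair-τW-letter 𝕩 g) (trans (pair-mono (𝕪 zero ∷ []) g) (sym (pair-mono (𝕪 zero ∷ []) g)))))
  τ-τL (𝕪 (suc s)) = pair≡⇒≋ λ g → trans (pair-τ (⊝ yP (suc s)) g) (trans (pair-· (- 1ℚ) (yP (suc s)) (λ w → pair (τW w) g))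
     (trans (cong ((- 1ℚ) *ℚ_) (trans (pair-mono (𝕪 (suc s) ∷ []) (λ w → pair (τW w) g)) (trans (pair-τW-letter (𝕪 (suc s)) g)
        (trans (pair-· (- 1ℚ) (yP (suc s)) g) (cong ((- 1ℚ) *ℚ_) (pair-mono (𝕪 (suc s) ∷ []) g))))))
     (trans (solve 1 (λ a → con (- 1ℚ) :* (con (- 1ℚ) :* a) := a) refl (g (𝕪 (suc s) ∷ []))) (sym (pair-mono (𝕪 (suc s) ∷ []) g)))))

  mono-⊛ : (v w : Word (suc n)) → mono v ⊛ mono w ≋ mono (v ++ w)
  mono-⊛ v w = pair≡⇒≋ λ g → trans (pair-⊛ (mono v) (mono w) g) (trans (pair-mono v (λ a → pair (mono w) (λ x → g (a ++ x))))
      (trans (pair-mono w (λ x → g (v ++ x))) (sym (pair-mono (v ++ w) g))))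

  τ-τW : (w : Word (suc n)) → τ (τW w) ≋ mono w
  τ-τW [] = τ-mono []
  τ-τW (l ∷ w) = ≋-trans (τ-⊛ (τW w) (τL l)) (≋-trans (⊛-cong (τ-τL l) (τ-τW w)) (mono-⊛ (l ∷ []) w))

  τ-involutive : (p : P) → τ (τ p) ≋ p
  τ-involutive p = pair≡⇒≋ λ g → trans (pair-τ (τ p) g) (trans (pair-τ p (λ w → pair (τW w) g))
     (trans (pair-congʳ p (λ v → trans (sym (pair-τ (τW v) g)) (trans (≋⇒pair≡ (τ-τW v) g) (pair-mono v g)))) refl))

  pair-τW-x : ∀ g → pair (τW {n} (𝕩 ∷ [])) g ≡ g (𝕪 zero ∷ [])
  pair-τW-x g = trans (pair-τW-letter 𝕩 g) (pair-mono (𝕪 zero ∷ []) g)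
  pair-τW-y-zero : ∀ g → pair (τW {n} (𝕪 zero ∷ [])) g ≡ g (𝕩 ∷ [])
  pair-τW-y-zero g = trans (pair-τW-letter (𝕪 zero) g) (pair-mono (𝕩 ∷ []) g)
  pair-τW-y-suc : ∀ s g → pair (τW {n} (𝕪 (suc s) ∷ [])) g ≡ (- 1ℚ) *ℚ g (𝕪 (suc s) ∷ [])
  pair-τW-y-suc s g = trans (pair-τW-letter (𝕪 (suc s)) g) (trans (pair-· (- 1ℚ) (yP (suc s)) g) (cong ((- 1ℚ) *ℚ_) (pair-mono (𝕪 (suc s) ∷ []) g)))

  τ-z : τ zP ≋ zP
  τ-z = pair≡⇒≋ λ g → trans (pair-τ zP g) (trans (pair-z (λ w → pair (τW w) g)) (trans (cong₂ _+ℚ_ (pair-τW-x g) (pair-τW-y-zero g))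
     (trans (QP.+-comm (g (𝕪 zero ∷ [])) (g (𝕩 ∷ []))) (sym (pair-z g)))))

  τ-zδ≋vδ : ∀ s → τ (zδ s) ≋ vδ s
  τ-zδ≋vδ zero = pair≡⇒≋ λ g → trans (pair-τ (zδ zero) g) (trans (pair-zδ-zero (λ w → pair (τW w) g)) (trans (pair-τW-x g) (sym (pair-vδ-zero g))))
  τ-zδ≋vδ (suc s) = pair≡⇒≋ λ g → trans (pair-τ (zδ (suc s)) g) (trans (pair-zδ-suc s (λ w → pair (τW w) g))
      (trans (cong₂ _+ℚ_ (pair-τW-x g) (pair-τW-y-suc s g)) (sym (pair-vδ-suc s g))))

  τ-vδ≋zδ : ∀ s → τ (vδ s) ≋ zδ s
  τ-vδ≋zδ s = ≋-trans (τ-cong (≋-sym (τ-zδ≋vδ s))) (τ-involutive (zδ s))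

  τ-𝟙 : τ 𝟙 ≋ 𝟙
  τ-𝟙 = τ-mono []

-- Finite sums and sums over coproducts

sumL : ∀ {r} {A : Set} → List A → (A → Poly r) → Poly r
sumL xs f = ΣP (map f xs)

Σℚ-+ : ∀ {A : Set} (xs : List A) G H → Σℚ xs (λ w → G w +ℚ H w) ≡ Σℚ xs G +ℚ Σℚ xs H
Σℚ-+ [] G H = sym (QP.+-identityˡ 0ℚ)
Σℚ-+ (x ∷ xs) G H = trans (cong (G x +ℚ H x +ℚ_) (Σℚ-+ xs G H))
  (solve 4 (λ a b s t → (a :+ b) :+ (s :+ t) := (a :+ s) :+ (b :+ t)) refl (G x) (H x) (Σℚ xs G) (Σℚ xs H))

Σℚ-* : ∀ {A : Set} (xs : List A) c G → Σℚ xs (λ w → c *ℚ G w) ≡ c *ℚ Σℚ xs G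
Σℚ-* [] c G = sym (QP.*-zeroʳ c)
Σℚ-* (x ∷ xs) c G = trans (cong (c *ℚ G x +ℚ_) (Σℚ-* xs c G)) (sym (QP.*-distribˡ-+ c (G x) (Σℚ xs G)))

Σℚ-0 : ∀ {A : Set} (xs : List A) → Σℚ xs (λ _ → 0ℚ) ≡ 0ℚ
Σℚ-0 xs = trans (Σℚ-* xs 0ℚ (λ _ → 0ℚ)) (QP.*-zeroˡ (Σℚ xs (λ _ → 0ℚ)))

Σℚ-swap : ∀ {A B : Set} (xs : List A) (ys : List B) (G : A → B → ℚ) →
  Σℚ xs (λ x → Σℚ ys (λ y → G x y)) ≡ Σℚ ys (λ y → Σℚ xs (λ x → G x y))
Σℚ-swap [] ys G = sym (Σℚ-0 ys)
Σℚ-swap (x ∷ xs) ys G = trans (cong (Σℚ ys (G x) +ℚ_) (Σℚ-swap xs ys G)) (sym (Σℚ-+ ys (G x) (λ y → Σℚ xs (λ x → G x y))))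

Σℚ-++ : ∀ {A : Set} (xs ys : List A) G → Σℚ (xs ++ ys) G ≡ Σℚ xs G +ℚ Σℚ ys G
Σℚ-++ [] ys G = sym (QP.+-identityˡ _)
Σℚ-++ (x ∷ xs) ys G = trans (cong (G x +ℚ_) (Σℚ-++ xs ys G)) (sym (QP.+-assoc (G x) (Σℚ xs G) (Σℚ ys G)))

Σℚ-concatMap : ∀ {A B : Set} (f : A → List B) (xs : List A) G → Σℚ (concatMap f xs) G ≡ Σℚ xs (λ x → Σℚ (f x) G)
Σℚ-concatMap f [] G = refl
Σℚ-concatMap f (x ∷ xs) G = trans (Σℚ-++ (f x) (concatMap f xs) G) (cong (Σℚ (f x) G +ℚ_) (Σℚ-concatMap f xs G))


module _ {r : ℕ} {A : Set} where
  pair-sumL : (xs : List A) (f : A → Poly r) (g : Word r → ℚ) → pair (sumL xs f) g ≡ Σℚ xs (λ x → pair (f x) g)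
  pair-sumL xs f g = pair-ΣP f xs g

  sumL-cong : (xs : List A) {f f' : A → Poly r} → (∀ x → f x ≋ f' x) → sumL xs f ≋ sumL xs f'
  sumL-cong xs {f} {f'} e = pair≡⇒≋ λ g → trans (pair-sumL xs f g) (trans (Σℚ-cong xs (λ x → ≋⇒pair≡ (e x) g)) (sym (pair-sumL xs f' g)))

  sumL-cong-All : (xs : List A) {f f' : A → Poly r} → All (λ x → f x ≋ f' x) xs → sumL xs f ≋ sumL xs f'
  sumL-cong-All [] [] = ≋-refl
  sumL-cong-All (x ∷ xs) (e ∷ es) = ⊕-cong e (sumL-cong-All xs es)

  sumL-⊕ : (xs : List A) (f f' : A → Poly r) → sumL xs (λ x → f x ⊕ f' x) ≋ sumL xs f ⊕ sumL xs f'
  sumL-⊕ xs f f' = pair≡⇒≋ λ g → trans (pair-sumL xs _ g) (trans (Σℚ-cong xs (λ x → pair-++ (f x) (f' x) g))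
    (trans (Σℚ-+ xs _ _) (sym (trans (pair-++ (sumL xs f) (sumL xs f') g) (cong₂ _+ℚ_ (pair-sumL xs f g) (pair-sumL xs f' g))))))

  sumL-· : (xs : List A) (c : ℚ) (f : A → Poly r) → sumL xs (λ x → c · f x) ≋ c · sumL xs f
  sumL-· xs c f = pair≡⇒≋ λ g → trans (pair-sumL xs _ g) (trans (Σℚ-cong xs (λ x → pair-· c (f x) g))
    (trans (Σℚ-* xs c _) (sym (trans (pair-· c (sumL xs f) g) (cong (c *ℚ_) (pair-sumL xs f g))))))

  sumL-𝟘 : (xs : List A) (f : A → Poly r) → (∀ x → f x ≋ 𝟘) → sumL xs f ≋ 𝟘
  sumL-𝟘 xs f e = pair≡⇒≋ λ g → trans (pair-sumL xs f g) (trans (Σℚ-cong xs (λ x → ≋⇒pair≡ (e x) g)) (Σℚ-0 xs))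

  sumL-𝟘-All : (xs : List A) (f : A → Poly r) → All (λ x → f x ≋ 𝟘) xs → sumL xs f ≋ 𝟘
  sumL-𝟘-All xs f e = ≋-trans (sumL-cong-All xs e) (sumL-𝟘 xs (λ _ → 𝟘) (λ _ → ≋-refl))

  sumL-++ : (xs ys : List A) (f : A → Poly r) → sumL (xs ++ ys) f ≋ sumL xs f ⊕ sumL ys f
  sumL-++ xs ys f = pair≡⇒≋ λ g → trans (pair-sumL (xs ++ ys) f g) (trans (Σℚ-++ xs ys _)
    (sym (trans (pair-++ (sumL xs f) (sumL ys f) g) (cong₂ _+ℚ_ (pair-sumL xs f g) (pair-sumL ys f g)))))

  ⊛-sumLˡ : (xs : List A) (f : A → Poly r) (p : Poly r) → sumL xs f ⊛ p ≋ sumL xs (λ x → f x ⊛ p)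
  ⊛-sumLˡ xs f p = pair≡⇒≋ λ g → trans (pair-⊛ (sumL xs f) p g) (trans (pair-sumL xs f _)
    (trans (Σℚ-cong xs (λ x → sym (pair-⊛ (f x) p g))) (sym (pair-sumL xs _ g))))

  ⊛-sumLʳ : (xs : List A) (f : A → Poly r) (p : Poly r) → p ⊛ sumL xs f ≋ sumL xs (λ x → p ⊛ f x)
  ⊛-sumLʳ xs f p = pair≡⇒≋ λ g → trans (pair-⊛ p (sumL xs f) g) (trans (pair-congʳ p (λ v → pair-sumL xs f _))
    (trans (pair-Σℚ-swap g p) (trans (Σℚ-cong xs (λ x → sym (pair-⊛ p (f x) g))) (sym (pair-sumL xs _ g)))))
    where
    pair-Σℚ-swap : ∀ (g : Word r → ℚ) (p : Poly r) → pair p (λ v → Σℚ xs (λ x → pair (f x) (λ y → g (v ++ y)))) ≡ Σℚ xs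
        (λ x → pair p (λ v → pair (f x) (λ y → g (v ++ y))))
    pair-Σℚ-swap g [] = sym (Σℚ-0 xs)
    pair-Σℚ-swap g ((c , v) ∷ p) = trans (cong₂ _+ℚ_ (sym (Σℚ-* xs c (λ x → pair (f x) (λ y → g (v ++ y))))) (pair-Σℚ-swap g p))
      (sym (Σℚ-+ xs (λ x → c *ℚ pair (f x) (λ y → g (v ++ y))) (λ x → pair p (λ v → pair (f x) (λ y → g (v ++ y))))))

  sumL-⊖ : (xs : List A) (f f' : A → Poly r) → sumL xs (λ x → f x ⊖ f' x) ≋ sumL xs f ⊖ sumL xs f'
  sumL-⊖ xs f f' = ≋-trans (sumL-⊕ xs f (λ x → ⊝ f' x)) (⊕-congʳ (sumL xs f) (sumL-· xs (- 1ℚ) f'))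

sumL-swap : ∀ {r} {A B : Set} (xs : List A) (ys : List B) (f : A → B → Poly r) →
  sumL xs (λ x → sumL ys (λ y → f x y)) ≋ sumL ys (λ y → sumL xs (λ x → f x y))
sumL-swap xs ys f = pair≡⇒≋ λ g → trans (pair-sumL xs _ g) (trans (Σℚ-cong xs (λ x → pair-sumL ys (f x) g))
  (trans (Σℚ-swap xs ys _) (sym (trans (pair-sumL ys _ g) (Σℚ-cong ys (λ y → pair-sumL xs (λ x → f x y) g))))))

sumL-map : ∀ {r} {A B : Set} (h : A → B) (xs : List A) (f : B → Poly r) → sumL (map h xs) f ≋ sumL xs (λ x → f (h x))
sumL-map h xs f = ≡→≋ (cong ΣP (sym (LP.map-∘ xs)))

sumL-concatMap : ∀ {r} {A B : Set} (h : A → List B) (xs : List A) (f : B → Poly r) → sumL (concatMap h xs) f ≋ sumL xs (λ x → sumL (h x) f)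
sumL-concatMap h xs f = pair≡⇒≋ λ g → trans (pair-sumL (concatMap h xs) f g) (trans (Σℚ-concatMap h xs _)
  (sym (trans (pair-sumL xs _ g) (Σℚ-cong xs (λ x → pair-sumL (h x) f g)))))

ε : Forest → ℚ
ε [] = 1ℚ
ε (_ ∷ _) = 0ℚ

ε-++ : (a b : Forest) → ε (a ++ b) ≡ ε a *ℚ ε b
ε-++ [] b = sym (QP.*-identityˡ (ε b))
ε-++ (x ∷ a) b = sym (QP.*-zeroˡ (ε b))

module _ {r : ℕ} where
  sumΔ : Forest → (Forest → Forest → Poly r) → Poly r
  sumΔ x h = sumL (ΔF x) (λ ab → h (proj₁ ab) (proj₂ ab))

  sumΔT : Tree → (Forest → Forest → Poly r) → Poly r
  sumΔT t h = sumL (ΔT t) (λ ab → h (proj₁ ab) (proj₂ ab))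

  sumL-mulT : (X Y : List (Forest × Forest)) (f : Forest × Forest → Poly r) →
    sumL (mulT X Y) f ≋ sumL X (λ ab → sumL Y (λ cd → f (proj₁ ab ++ proj₁ cd , proj₂ ab ++ proj₂ cd)))
  sumL-mulT X Y f = ≋-trans (sumL-concatMap _ X f) (sumL-cong X (λ ab → sumL-map _ Y f))

  sumΔ-cons : (t : Tree) (ts : Forest) (h : Forest → Forest → Poly r) →
    sumΔ (t ∷ ts) h ≋ sumΔT t (λ a b → sumΔ ts (λ c d → h (a ++ c) (b ++ d)))
  sumΔ-cons t ts h = sumL-mulT (ΔT t) (ΔF ts) _

  sumΔT-B : (fs : Forest) (h : Forest → Forest → Poly r) →
    sumΔT (B₊ fs) h ≋ h (B₊ fs ∷ []) [] ⊕ sumΔ fs (λ a b → h a (B₊ b ∷ []))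
  sumΔT-B fs h = ⊕-cong ≋-refl (sumL-map _ (ΔF fs) _)

  sumΔ-[] : (h : Forest → Forest → Poly r) → sumΔ [] h ≋ h [] []
  sumΔ-[] h = ⊕-idʳ (h [] [])

  sumΔ-single : (t : Tree) (h : Forest → Forest → Poly r) → sumΔ (t ∷ []) h ≋ sumΔT t h
  sumΔ-single t h = ≋-trans (sumΔ-cons t [] h) (sumL-cong (ΔT t) (λ ab → ≋-trans (sumΔ-[] (λ c d → h (proj₁ ab ++ c) (proj₂ ab ++ d)))
     (≡→≋ (cong₂ h (LP.++-identityʳ (proj₁ ab)) (LP.++-identityʳ (proj₂ ab))))))

  sumΔ-cong : (x : Forest) {h h' : Forest → Forest → Poly r} → (∀ a b → h a b ≋ h' a b) → sumΔ x h ≋ sumΔ x h'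
  sumΔ-cong x e = sumL-cong (ΔF x) (λ ab → e (proj₁ ab) (proj₂ ab))

  sumΔT-cong : (t : Tree) {h h' : Forest → Forest → Poly r} → (∀ a b → h a b ≋ h' a b) → sumΔT t h ≋ sumΔT t h'
  sumΔT-cong t e = sumL-cong (ΔT t) (λ ab → e (proj₁ ab) (proj₂ ab))

  mutual
    sumΔT-counitˡ : (t : Tree) (h : Forest → Forest → Poly r) → sumΔT t (λ a b → ε a · h a b) ≋ h [] (t ∷ [])
    sumΔT-counitˡ (B₊ fs) h = ≋-trans (sumΔT-B fs (λ a b → ε a · h a b)) (⊕-cong (·-zeroˡ (h (B₊ fs ∷ []) [])) (sumΔ-counitˡ fs (λ a b → h a (B₊ b ∷ []))))

    sumΔ-counitˡ : (x : Forest) (h : Forest → Forest → Poly r) → sumΔ x (λ a b → ε a · h a b) ≋ h [] x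
    sumΔ-counitˡ [] h = ≋-trans (sumΔ-[] (λ a b → ε a · h a b)) (·-identityˡ (h [] []))
    sumΔ-counitˡ (t ∷ ts) h = ≋-trans (sumΔ-cons t ts (λ a b → ε a · h a b)) (≋-trans (sumΔT-cong t (λ a b →
         ≋-trans (sumΔ-cong ts (λ c d → ≋-trans (≡→≋ (cong (_· h (a ++ c) (b ++ d)) (ε-++ a c))) (≋-sym (·-assoc (ε a) (ε c) (h (a ++ c) (b ++ d))))))
         (≋-trans (sumL-· (ΔF ts) (ε a) (λ cd → ε (proj₁ cd) · h (a ++ proj₁ cd) (b ++ proj₂ cd))) (·-cong (ε a) (sumΔ-counitˡ ts (λ c d → h (a ++ c) (b ++ d)))))))
       (sumΔT-counitˡ t (λ a b → h (a ++ []) (b ++ ts))))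

  sumΔT-counitʳ : (t : Tree) (h : Forest → Forest → Poly r) → sumΔT t (λ a b → ε b · h a b) ≋ h (t ∷ []) []
  sumΔT-counitʳ (B₊ fs) h = ≋-trans (sumΔT-B fs (λ a b → ε b · h a b)) (≋-trans (⊕-cong (·-identityˡ (h (B₊ fs ∷ []) []))
     (sumL-𝟘 (ΔF fs) (λ ab → ε (B₊ (proj₂ ab) ∷ []) · h (proj₁ ab) (B₊ (proj₂ ab) ∷ [])) (λ ab → ·-zeroˡ (h (proj₁ ab) (B₊ (proj₂ ab) ∷ [])))))
         (⊕-idʳ (h (B₊ fs ∷ []) [])))

  sumΔ-counitʳ : (x : Forest) (h : Forest → Forest → Poly r) → sumΔ x (λ a b → ε b · h a b) ≋ h x []
  sumΔ-counitʳ [] h = ≋-trans (sumΔ-[] (λ a b → ε b · h a b)) (·-identityˡ (h [] []))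
  sumΔ-counitʳ (t ∷ ts) h = ≋-trans (sumΔ-cons t ts (λ a b → ε b · h a b)) (≋-trans (sumΔT-cong t (λ a b →
       ≋-trans (sumΔ-cong ts (λ c d → ≋-trans (≡→≋ (cong (_· h (a ++ c) (b ++ d)) (ε-++ b d))) (≋-sym (·-assoc (ε b) (ε d) (h (a ++ c) (b ++ d))))))
       (≋-trans (sumL-· (ΔF ts) (ε b) (λ cd → ε (proj₂ cd) · h (a ++ proj₁ cd) (b ++ proj₂ cd))) (·-cong (ε b) (sumΔ-counitʳ ts (λ c d → h (a ++ c) (b ++ d)))))))
     (sumΔT-counitʳ t (λ a b → h (a ++ ts) (b ++ []))))

  sumΔ-swap : (x y : Forest) (F : Forest → Forest → Forest → Forest → Poly r) →
    sumΔ x (λ a b → sumΔ y (λ c d → F a b c d)) ≋ sumΔ y (λ c d → sumΔ x (λ a b → F a b c d))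
  sumΔ-swap x y F = sumL-swap (ΔF x) (ΔF y) (λ ab cd → F (proj₁ ab) (proj₂ ab) (proj₁ cd) (proj₂ cd))

  sumΔ-++ : (g h : Forest) (k : Forest → Forest → Poly r) →
    sumΔ (g ++ h) k ≋ sumΔ g (λ a b → sumΔ h (λ c d → k (a ++ c) (b ++ d)))
  sumΔ-++ [] h k = ≋-sym (sumΔ-[] (λ a b → sumΔ h (λ c d → k (a ++ c) (b ++ d))))
  sumΔ-++ (t ∷ g) h k = ≋-trans (sumΔ-cons t (g ++ h) k) (≋-trans (sumΔT-cong t (λ a b →
      ≋-trans (sumΔ-++ g h (λ c d → k (a ++ c) (b ++ d)))
      (sumΔ-cong g (λ c d → sumΔ-cong h (λ e f → ≡→≋ (cong₂ k (sym (LP.++-assoc a c e)) (sym (LP.++-assoc b d f))))))))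
    (≋-sym (sumΔ-cons t g (λ a b → sumΔ h (λ c d → k (a ++ c) (b ++ d))))))

  mutual
    sumΔT-coassoc : (t : Tree) (H : Forest → Forest → Forest → Poly r) →
      sumΔT t (λ a b → sumΔ a (λ a1 a2 → H a1 a2 b)) ≋ sumΔT t (λ a b → sumΔ b (λ b1 b2 → H a b1 b2))
    sumΔT-coassoc (B₊ fs) H = begin
        sumΔT t (λ a b → sumΔ a (λ a1 a2 → H a1 a2 b))
          ≈⟨ sumΔT-B fs (λ a b → sumΔ a (λ a1 a2 → H a1 a2 b)) ⟩
        sumΔ (t ∷ []) (λ a1 a2 → H a1 a2 []) ⊕ X
          ≈⟨ ⊕-congˡ X (≋-trans (sumΔ-single t (λ a1 a2 → H a1 a2 [])) (sumΔT-B fs (λ a1 a2 → H a1 a2 []))) ⟩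
        (H (t ∷ []) [] [] ⊕ Y) ⊕ X
          ≈⟨ ⊕-assoc (H (t ∷ []) [] []) Y X ⟩
        H (t ∷ []) [] [] ⊕ (Y ⊕ X)
          ≈⟨ ⊕-congʳ (H (t ∷ []) [] []) (⊕-congʳ Y (sumΔ-coassoc fs (λ a1 a2 b → H a1 a2 (B₊ b ∷ [])))) ⟩
        H (t ∷ []) [] [] ⊕ (Y ⊕ Z)
          ≈⟨ ⊕-congʳ (H (t ∷ []) [] []) (≋-sym (sumL-⊕ (ΔF fs) (λ ab → H (proj₁ ab) (B₊ (proj₂ ab) ∷ []) [])
              (λ ab → sumΔ (proj₂ ab) (λ c d → H (proj₁ ab) c (B₊ d ∷ []))))) ⟩
        H (t ∷ []) [] [] ⊕ sumΔ fs (λ a b → H a (B₊ b ∷ []) [] ⊕ sumΔ b (λ c d → H a c (B₊ d ∷ [])))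
          ≈⟨ ⊕-cong (≋-sym (sumΔ-[] (λ b1 b2 → H (t ∷ []) b1 b2))) (sumΔ-cong fs (λ a b → ≋-sym
              (≋-trans (sumΔ-single (B₊ b) (λ b1 b2 → H a b1 b2)) (sumΔT-B b (λ b1 b2 → H a b1 b2))))) ⟩
        sumΔ [] (λ b1 b2 → H (t ∷ []) b1 b2) ⊕ sumΔ fs (λ a b → sumΔ (B₊ b ∷ []) (λ b1 b2 → H a b1 b2))
          ≈⟨ ≋-sym (sumΔT-B fs (λ a b → sumΔ b (λ b1 b2 → H a b1 b2))) ⟩
        sumΔT t (λ a b → sumΔ b (λ b1 b2 → H a b1 b2)) ∎
      where
      open ≋-Reasoning {r}
      t = B₊ fs
      X = sumΔ fs (λ a b → sumΔ a (λ a1 a2 → H a1 a2 (B₊ b ∷ [])))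
      Y = sumΔ fs (λ a b → H a (B₊ b ∷ []) [])
      Z = sumΔ fs (λ a b → sumΔ b (λ c d → H a c (B₊ d ∷ [])))

    sumΔ-coassoc : (x : Forest) (H : Forest → Forest → Forest → Poly r) →
      sumΔ x (λ a b → sumΔ a (λ a1 a2 → H a1 a2 b)) ≋ sumΔ x (λ a b → sumΔ b (λ b1 b2 → H a b1 b2))
    sumΔ-coassoc [] H = ≋-trans (sumΔ-[] (λ a b → sumΔ a (λ a1 a2 → H a1 a2 b))) (≋-trans (sumΔ-[] (λ a1 a2 → H a1 a2 []))
       (≋-sym (≋-trans (sumΔ-[] (λ a b → sumΔ b (λ b1 b2 → H a b1 b2))) (sumΔ-[] (λ b1 b2 → H [] b1 b2)))))
    sumΔ-coassoc (t ∷ ts) H = begin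
        sumΔ (t ∷ ts) (λ a b → sumΔ a (λ a1 a2 → H a1 a2 b))
          ≈⟨ sumΔ-cons t ts (λ a b → sumΔ a (λ a1 a2 → H a1 a2 b)) ⟩
        sumΔT t (λ a b → sumΔ ts (λ c d → sumΔ (a ++ c) (λ e1 e2 → H e1 e2 (b ++ d))))
          ≈⟨ sumΔT-cong t (λ a b → sumΔ-cong ts (λ c d → sumΔ-++ a c (λ e1 e2 → H e1 e2 (b ++ d)))) ⟩
        sumΔT t (λ a b → sumΔ ts (λ c d → sumΔ a (λ a1 a2 → sumΔ c (λ c1 c2 → H (a1 ++ c1) (a2 ++ c2) (b ++ d)))))
          ≈⟨ sumΔT-cong t (λ a b → sumΔ-swap ts a (λ c d a1 a2 → sumΔ c (λ c1 c2 → H (a1 ++ c1) (a2 ++ c2) (b ++ d)))) ⟩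
        sumΔT t (λ a b → sumΔ a (λ a1 a2 → sumΔ ts (λ c d → sumΔ c (λ c1 c2 → H (a1 ++ c1) (a2 ++ c2) (b ++ d)))))
          ≈⟨ sumΔT-coassoc t (λ a1 a2 b → sumΔ ts (λ c d → sumΔ c (λ c1 c2 → H (a1 ++ c1) (a2 ++ c2) (b ++ d)))) ⟩
        sumΔT t (λ a b → sumΔ b (λ b1 b2 → sumΔ ts (λ c d → sumΔ c (λ c1 c2 → H (a ++ c1) (b1 ++ c2) (b2 ++ d)))))
          ≈⟨ sumΔT-cong t (λ a b → sumΔ-cong b (λ b1 b2 → sumΔ-coassoc ts (λ c1 c2 d → H (a ++ c1) (b1 ++ c2) (b2 ++ d)))) ⟩
        sumΔT t (λ a b → sumΔ b (λ b1 b2 → sumΔ ts (λ c d → sumΔ d (λ d1 d2 → H (a ++ c) (b1 ++ d1) (b2 ++ d2)))))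
          ≈⟨ sumΔT-cong t (λ a b → sumΔ-swap b ts (λ b1 b2 c d → sumΔ d (λ d1 d2 → H (a ++ c) (b1 ++ d1) (b2 ++ d2)))) ⟩
        sumΔT t (λ a b → sumΔ ts (λ c d → sumΔ b (λ b1 b2 → sumΔ d (λ d1 d2 → H (a ++ c) (b1 ++ d1) (b2 ++ d2)))))
          ≈⟨ ≋-sym (sumΔT-cong t (λ a b → sumΔ-cong ts (λ c d → sumΔ-++ b d (λ f1 f2 → H (a ++ c) f1 f2)))) ⟩
        sumΔT t (λ a b → sumΔ ts (λ c d → sumΔ (b ++ d) (λ f1 f2 → H (a ++ c) f1 f2)))
          ≈⟨ ≋-sym (sumΔ-cons t ts (λ a b → sumΔ b (λ b1 b2 → H a b1 b2))) ⟩
        sumΔ (t ∷ ts) (λ a b → sumΔ b (λ b1 b2 → H a b1 b2)) ∎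
      where open ≋-Reasoning {r}



sizeF-++ : (a b : Forest) → sizeF (a ++ b) ≡ sizeF a +ℕ sizeF b
sizeF-++ [] b = refl
sizeF-++ (t ∷ a) b = trans (cong (size t +ℕ_) (sizeF-++ a b)) (sym (NP.+-assoc (size t) (sizeF a) (sizeF b)))

IsΔTerm : Forest → Forest × Forest → Set
IsΔTerm x ab = (sizeF (proj₁ ab) +ℕ sizeF (proj₂ ab) ≡ sizeF x) × ((proj₂ ab ≡ [] → proj₁ ab ≡ x) × (proj₁ ab ≡ [] → proj₂ ab ≡ x))

All-mulT : ∀ {P Q R : Forest × Forest → Set} {X Y : List (Forest × Forest)} → All P X → All Q Y →
  (∀ {a b c d} → P (a , b) → Q (c , d) → R (a ++ c , b ++ d)) → All R (mulT X Y)
All-mulT [] qs g = []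
All-mulT {Y = Y} (p ∷ ps) qs g = All.++⁺ (All.map⁺ (All.map (λ q → g p q) qs)) (All-mulT ps qs g)

mutual
  all-IsΔTermT : (t : Tree) → All (IsΔTerm (t ∷ [])) (ΔT t)
  all-IsΔTermT (B₊ fs) = (NP.+-identityʳ _ , (λ _ → refl) , (λ ())) ∷ All.map⁺ (All.map aux (all-IsΔTerm fs))
    where
    size-B₊ : ∀ {a b} → sizeF a +ℕ sizeF b ≡ sizeF fs → sizeF a +ℕ sizeF (B₊ b ∷ []) ≡ sizeF (B₊ fs ∷ [])
    size-B₊ {a} {b} s = begin
      sizeF a +ℕ (suc (sizeF b) +ℕ 0) ≡⟨ cong (sizeF a +ℕ_) (NP.+-identityʳ _) ⟩
      sizeF a +ℕ suc (sizeF b)        ≡⟨ NP.+-suc (sizeF a) (sizeF b) ⟩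
      suc (sizeF a +ℕ sizeF b)        ≡⟨ cong suc s ⟩
      suc (sizeF fs)                  ≡⟨ NP.+-identityʳ _ ⟨
      suc (sizeF fs) +ℕ 0             ∎
      where open ≡-Reasoning
    aux : ∀ {ab} → IsΔTerm fs ab → IsΔTerm (B₊ fs ∷ []) (proj₁ ab , B₊ (proj₂ ab) ∷ [])
    aux {a , b} (s , _ , e2) = size-B₊ {a} {b} s , (λ ()) , (λ ea → cong (λ y → B₊ y ∷ []) (e2 ea))

  all-IsΔTerm : (x : Forest) → All (IsΔTerm x) (ΔF x)
  all-IsΔTerm [] = (refl , (λ _ → refl) , (λ _ → refl)) ∷ []
  all-IsΔTerm (t ∷ ts) = All-mulT (all-IsΔTermT t) (all-IsΔTerm ts) aux
    where
    aux : ∀ {a b c d} → IsΔTerm (t ∷ []) (a , b) → IsΔTerm ts (c , d) → IsΔTerm (t ∷ ts) (a ++ c , b ++ d)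
    aux {a} {b} {c} {d} (s1 , r1 , l1) (s2 , r2 , l2) =
      trans (cong₂ _+ℕ_ (sizeF-++ a c) (sizeF-++ b d)) (trans (interchange (sizeF a) (sizeF c) (sizeF b) (sizeF d))
        (trans (cong₂ _+ℕ_ s1 s2) (cong (_+ℕ sizeF ts) (NP.+-identityʳ (size t))))) ,
      (λ e → cong₂ _++_ (r1 (LP.++-conicalˡ b d e)) (r2 (LP.++-conicalʳ b d e))) ,
      (λ e → cong₂ _++_ (l1 (LP.++-conicalˡ a c e)) (l2 (LP.++-conicalʳ a c e)))

size-pos : (t : Tree) → 1 ≤ℕ size t
size-pos (B₊ fs) = s≤s z≤n

IsΔTerm-left : ∀ x a b → IsΔTerm x (a , b) → (a ≡ x × b ≡ []) ⊎ (sizeF a <ℕ sizeF x)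
IsΔTerm-left x a [] (s , r , l) = inj₁ (r refl , refl)
IsΔTerm-left x a (t ∷ b) (s , r , l) = inj₂ (subst (sizeF a <ℕ_) s
  (subst (_≤ℕ sizeF a +ℕ (size t +ℕ sizeF b)) (NP.+-comm (sizeF a) 1) (NP.+-monoʳ-≤ (sizeF a) (≤-trans (size-pos t) (NP.m≤m+n (size t) (sizeF b))))))

IsΔTerm-right : ∀ x a b → IsΔTerm x (a , b) → (b ≡ x × a ≡ []) ⊎ (sizeF b <ℕ sizeF x)
IsΔTerm-right x [] b (s , r , l) = inj₁ (l refl , refl)
IsΔTerm-right x (t ∷ a) b (s , r , l) = inj₂ (subst (sizeF b <ℕ_) (trans (NP.+-comm (sizeF b) _) s)
  (subst (_≤ℕ sizeF b +ℕ (size t +ℕ sizeF a)) (NP.+-comm (sizeF b) 1) (NP.+-monoʳ-≤ (sizeF b) (≤-trans (size-pos t) (NP.m≤m+n (size t) (sizeF a))))))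

IsΔTerm-left-≤ : ∀ x a b → IsΔTerm x (a , b) → sizeF a ≤ℕ sizeF x
IsΔTerm-left-≤ x a b (s , _) = subst (sizeF a ≤ℕ_) s (NP.m≤m+n (sizeF a) (sizeF b))

IsΔTerm-right-≤ : ∀ x a b → IsΔTerm x (a , b) → sizeF b ≤ℕ sizeF x
IsΔTerm-right-≤ x a b (s , _) = subst (sizeF b ≤ℕ_) s (NP.m≤n+m (sizeF b) (sizeF a))

split-by-scalar : ∀ {r} e (p : Poly r) → p ≋ e · p ⊕ (1ℚ +ℚ (- e)) · p
split-by-scalar e p = ≋-trans (≋-sym (·-identityˡ p)) (≋-trans (≡→≋ (cong (_· p) (solve 1 (λ e → con 1ℚ := e :+ (con 1ℚ :+ :- e)) refl e)))
    (+-distrib-· e (1ℚ +ℚ (- e)) p))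

sumΔ-isolateˡ : ∀ {r} x (k : Forest → Forest → Poly r) → (∀ a b → sizeF a <ℕ sizeF x → k a b ≋ 𝟘) → sumΔ x k ≋ k x []
sumΔ-isolateˡ x k z = ≋-trans (sumΔ-cong x (λ a b → split-by-scalar (ε b) (k a b))) (≋-trans (sumL-⊕ (ΔF x) _ _)
  (≋-trans (⊕-cong (sumΔ-counitʳ x k) (sumL-𝟘-All (ΔF x) _ (All.map (λ {ab} A → aux (proj₁ ab) (proj₂ ab) A) (all-IsΔTerm x)))) (⊕-idʳ (k x []))))
  where
  aux : ∀ a b → IsΔTerm x (a , b) → (1ℚ +ℚ (- ε b)) · k a b ≋ 𝟘
  aux a b A with IsΔTerm-left x a b A
  ... | inj₁ (_ , refl) = ≋-trans (≡→≋ (cong (_· k a []) (solve 0 (con 1ℚ :+ :- con 1ℚ := con 0ℚ) refl))) (·-zeroˡ (k a []))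
  ... | inj₂ lt = ·-cong (1ℚ +ℚ (- ε b)) (z a b lt)

sumΔ-isolateʳ : ∀ {r} x (k : Forest → Forest → Poly r) → (∀ a b → sizeF b <ℕ sizeF x → k a b ≋ 𝟘) → sumΔ x k ≋ k [] x
sumΔ-isolateʳ x k z = ≋-trans (sumΔ-cong x (λ a b → split-by-scalar (ε a) (k a b))) (≋-trans (sumL-⊕ (ΔF x) _ _)
  (≋-trans (⊕-cong (sumΔ-counitˡ x k) (sumL-𝟘-All (ΔF x) _ (All.map (λ {ab} A → aux (proj₁ ab) (proj₂ ab) A) (all-IsΔTerm x)))) (⊕-idʳ (k [] x))))
  where
  aux : ∀ a b → IsΔTerm x (a , b) → (1ℚ +ℚ (- ε a)) · k a b ≋ 𝟘
  aux a b A with IsΔTerm-right x a b A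
  ... | inj₁ (_ , refl) = ≋-trans (≡→≋ (cong (_· k [] b) (solve 0 (con 1ℚ :+ :- con 1ℚ := con 0ℚ) refl))) (·-zeroˡ (k [] b))
  ... | inj₂ lt = ·-cong (1ℚ +ℚ (- ε a)) (z a b lt)


snoc-ind : ∀ {A : Set} (Q : List A → Set) → Q [] → (∀ w l → Q w → Q (w ++ (l ∷ []))) → ∀ w → Q w
snoc-ind {A} Q b s w = go (reverseView w)
  where
  go : ∀ {xs} → Reverse xs → Q xs
  go [] = b
  go (xs ∶ rs ∶ʳ x) = s xs x (go rs)

-- Linear maps

record IsLinear {r : ℕ} (φ : Poly r → Poly r) : Set where
  field
    resp≋ : ∀ {p q} → p ≋ q → φ p ≋ φ q
    hom-⊕ : ∀ p q → φ (p ⊕ q) ≋ φ p ⊕ φ q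
    hom-· : ∀ c p → φ (c · p) ≋ c · φ p
  hom-𝟘 : φ 𝟘 ≋ 𝟘
  hom-𝟘 = ≋-trans (hom-· 0ℚ 𝟘) (·-zeroˡ (φ 𝟘))
  hom-⊖ : ∀ p q → φ (p ⊖ q) ≋ φ p ⊖ φ q
  hom-⊖ p q = ≋-trans (hom-⊕ p (⊝ q)) (⊕-congʳ (φ p) (hom-· (- 1ℚ) q))
  hom-sumL : ∀ {A : Set} (xs : List A) (f : A → Poly r) → φ (sumL xs f) ≋ sumL xs (λ x → φ (f x))
  hom-sumL [] f = hom-𝟘
  hom-sumL (x ∷ xs) f = ≋-trans (hom-⊕ (f x) (sumL xs f)) (⊕-congʳ (φ (f x)) (hom-sumL xs f))
  hom-sumΔ : ∀ (x : Forest) (h : Forest → Forest → Poly r) → φ (sumΔ x h) ≋ sumΔ x (λ a b → φ (h a b))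
  hom-sumΔ x h = hom-sumL (ΔF x) (λ ab → h (proj₁ ab) (proj₂ ab))
open IsLinear public

module _ {r : ℕ} where
  ≋-sum-of-monomials : (p : Poly r) → p ≋ sumL p (λ cw → proj₁ cw · mono (proj₂ cw))
  ≋-sum-of-monomials [] = ≋-refl
  ≋-sum-of-monomials ((c , w) ∷ p) = pair≡⇒≋ λ g → trans (cong (c *ℚ g w +ℚ_) (≋⇒pair≡ (≋-sum-of-monomials p) g))
    (sym (trans (pair-++ (c · mono w) (sumL p (λ cw → proj₁ cw · mono (proj₂ cw))) g)
      (cong (_+ℚ pair (sumL p (λ cw → proj₁ cw · mono (proj₂ cw))) g) (trans (pair-· c (mono w) g) (cong (c *ℚ_) (pair-mono w g))))))

  linear-unique : {φ ψ : Poly r → Poly r} → IsLinear φ → IsLinear ψ → (∀ w → φ (mono w) ≋ ψ (mono w)) → ∀ p → φ p ≋ ψ p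
  linear-unique {φ} {ψ} Lφ Lψ e p = ≋-trans (resp≋ Lφ (≋-sum-of-monomials p)) (≋-trans (hom-sumL Lφ p _)
    (≋-trans (sumL-cong p (λ cw → ≋-trans (hom-· Lφ (proj₁ cw) (mono (proj₂ cw))) (≋-trans (·-cong (proj₁ cw) (e (proj₂ cw)))
        (≋-sym (hom-· Lψ (proj₁ cw) (mono (proj₂ cw)))))))
    (≋-trans (≋-sym (hom-sumL Lψ p _)) (resp≋ Lψ (≋-sym (≋-sum-of-monomials p))))))

  linear-∘ : {φ ψ : Poly r → Poly r} → IsLinear φ → IsLinear ψ → IsLinear (λ p → φ (ψ p))
  linear-∘ {φ} {ψ} Lφ Lψ = record
    { resp≋ = λ e → resp≋ Lφ (resp≋ Lψ e)
    ; hom-⊕ = λ p q → ≋-trans (resp≋ Lφ (hom-⊕ Lψ p q)) (hom-⊕ Lφ (ψ p) (ψ q))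
    ; hom-· = λ c p → ≋-trans (resp≋ Lφ (hom-· Lψ c p)) (hom-· Lφ c (ψ p)) }

  linear-⊛ˡ : (a : Poly r) → IsLinear (λ p → a ⊛ p)
  linear-⊛ˡ a = record { resp≋ = ⊛-congʳ a ; hom-⊕ = ⊛-⊕ʳ a ; hom-· = λ c p → ⊛-·ʳ c a p }

  linear-· : (c : ℚ) → IsLinear {r} (λ p → c · p)
  linear-· c = record { resp≋ = ·-cong c ; hom-⊕ = ·-⊕ c
    ; hom-· = λ d p → ≋-trans (·-assoc c d p) (≋-trans (≡→≋ (cong (_· p) (QP.*-comm c d))) (≋-sym (·-assoc d c p))) }

  linear-⊕ : {φ ψ : Poly r → Poly r} → IsLinear φ → IsLinear ψ → IsLinear (λ p → φ p ⊕ ψ p)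
  linear-⊕ {φ} {ψ} Lφ Lψ = record
    { resp≋ = λ e → ⊕-cong (resp≋ Lφ e) (resp≋ Lψ e)
    ; hom-⊕ = λ p q → pair≡⇒≋ λ g → trans (pair-++ (φ (p ⊕ q)) (ψ (p ⊕ q)) g)
        (trans (cong₂ _+ℚ_ (trans (≋⇒pair≡ (hom-⊕ Lφ p q) g) (pair-++ (φ p) (φ q) g)) (trans (≋⇒pair≡ (hom-⊕ Lψ p q) g) (pair-++ (ψ p) (ψ q) g)))
        (trans (solve 4 (λ a b c d → (a :+ b) :+ (c :+ d) := (a :+ c) :+ (b :+ d)) refl (pair (φ p) g) (pair (φ q) g) (pair (ψ p) g) (pair (ψ q) g))
        (sym (trans (pair-++ (φ p ⊕ ψ p) (φ q ⊕ ψ q) g) (cong₂ _+ℚ_ (pair-++ (φ p) (ψ p) g) (pair-++ (φ q) (ψ q) g))))))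
    ; hom-· = λ c p → ≋-trans (⊕-cong (hom-· Lφ c p) (hom-· Lψ c p)) (≋-sym (·-⊕ c (φ p) (ψ p))) }

  linear-sumL : {A : Set} (xs : List A) {φ : A → Poly r → Poly r} → (∀ x → IsLinear (φ x)) → IsLinear (λ p → sumL xs (λ x → φ x p))
  linear-sumL [] L = record { resp≋ = λ _ → ≋-refl ; hom-⊕ = λ p q → ≋-refl ; hom-· = λ c p → ≋-refl }
  linear-sumL (x ∷ xs) L = linear-⊕ (L x) (linear-sumL xs L)

  linear-sumΔ : (x : Forest) {φ : Forest → Forest → Poly r → Poly r} → (∀ a b → IsLinear (φ a b)) → IsLinear (λ p → sumΔ x (λ a b → φ a b p))
  linear-sumΔ x L = linear-sumL (ΔF x) (λ ab → L (proj₁ ab) (proj₂ ab))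

-- Rooted tree maps

module RootedTreeMaps {n : ℕ} (F : Forest → Poly (suc n) → Poly (suc n)) (R : IsRootedTreeMaps F) where
  open Generators {n} public
  module RR = IsRootedTreeMaps R

  F-linear : ∀ f → IsLinear (F f)
  F-linear f = record { resp≋ = λ e → ⟨ RR.resp f (un e) ⟩ ; hom-⊕ = λ p q → ⟨ RR.additive f p q ⟩ ; hom-· = λ c p → ⟨ RR.homog f c p ⟩ }

  F-cong : ∀ f {p q} → p ≋ q → F f p ≋ F f q
  F-cong f = resp≋ (F-linear f)

  F-[] : ∀ p → F [] p ≋ p
  F-[] p = ⟨ RR.empty p ⟩

  F-++-gen : ∀ g h u → Gen u → F (g ++ h) u ≋ F g (F h u)
  F-++-gen g h u gu = ⟨ RR.III g h u gu ⟩

  F-⊛-gen : ∀ f w u → Gen u → F f (w ⊛ u) ≋ sumΔ f (λ a b → F a w ⊛ F b u)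
  F-⊛-gen f w u gu = ⟨ RR.IV f w u gu ⟩

  open ≋-Reasoning {suc n}

  F-z : ∀ f → F f zP ≋ ε f · zP
  F-z [] = ≋-trans (F-[] zP) (≋-sym (·-identityˡ zP))
  F-z (t ∷ ts) = begin
      F ((t ∷ []) ++ ts) zP ≈⟨ F-++-gen (t ∷ []) ts zP gen-z ⟩
      F (t ∷ []) (F ts zP) ≈⟨ F-cong (t ∷ []) (F-z ts) ⟩
      F (t ∷ []) (ε ts · zP) ≈⟨ hom-· (F-linear (t ∷ [])) (ε ts) zP ⟩
      ε ts · F (t ∷ []) zP ≈⟨ ·-cong (ε ts) ⟨ RR.tree-z t ⟩ ⟩
      ε ts · 𝟘 ≈⟨ ≋-sym (·-zeroˡ zP) ⟩
      0ℚ · zP ∎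

  -- (IV) with w = 𝟙 and u = z gives F f 𝟙 ⊛ z = ε(f) z, and z can be cancelled on the right.
  F-𝟙 : ∀ f → F f 𝟙 ≋ ε f · 𝟙
  F-𝟙 f = ⊖≋𝟘⇒≋ (⊛z≋𝟘⇒≋𝟘 (F f 𝟙 ⊖ ε f · 𝟙) (≋-trans (⊛-⊖ˡ (F f 𝟙) (ε f · 𝟙) zP) (≋⇒⊖≋𝟘 key)))
    where
    key : F f 𝟙 ⊛ zP ≋ (ε f · 𝟙) ⊛ zP
    key = begin
      F f 𝟙 ⊛ zP ≈⟨ ≋-sym (sumΔ-counitʳ f (λ a b → F a 𝟙 ⊛ zP)) ⟩
      sumΔ f (λ a b → ε b · (F a 𝟙 ⊛ zP)) ≈⟨ sumΔ-cong f (λ a b → ≋-trans (≋-sym (⊛-·ʳ (ε b) (F a 𝟙) zP)) (⊛-congʳ (F a 𝟙) (≋-sym (F-z b)))) ⟩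
      sumΔ f (λ a b → F a 𝟙 ⊛ F b zP) ≈⟨ ≋-sym (F-⊛-gen f 𝟙 zP gen-z) ⟩
      F f (𝟙 ⊛ zP) ≈⟨ F-cong f (⊛-identityˡ zP) ⟩
      F f zP ≈⟨ F-z f ⟩
      ε f · zP ≈⟨ ·-cong (ε f) (≋-sym (⊛-identityˡ zP)) ⟩
      ε f · (𝟙 ⊛ zP) ≈⟨ ≋-sym (⊛-·ˡ (ε f) 𝟙 zP) ⟩
      (ε f · 𝟙) ⊛ zP ∎

  -- x = z_1^δ, y_1 = z − z_1^δ and y_s = z_s^δ − z_1^δ (s ≠ 1).
  agree-on-letters : {φ ψ : P → P} → IsLinear φ → IsLinear ψ → (∀ u → Gen u → φ u ≋ ψ u) → ∀ l → φ (mono (l ∷ [])) ≋ ψ (mono (l ∷ []))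
  agree-on-letters {φ} {ψ} Lφ Lψ e 𝕩 = ≋-trans (resp≋ Lφ x≋zδ-zero) (≋-trans (e _ (gen-zδ zero)) (resp≋ Lψ (≋-sym x≋zδ-zero)))
  agree-on-letters {φ} {ψ} Lφ Lψ e (𝕪 zero) = ≋-trans (resp≋ Lφ y-zero≋vδ-zero) (≋-trans (hom-⊖ Lφ zP (zδ zero))
     (≋-trans (⊖-cong (e _ gen-z) (e _ (gen-zδ zero))) (≋-trans (≋-sym (hom-⊖ Lψ zP (zδ zero))) (resp≋ Lψ (≋-sym y-zero≋vδ-zero)))))
  agree-on-letters {φ} {ψ} Lφ Lψ e (𝕪 (suc s)) = ≋-trans (resp≋ Lφ (y-suc≋zδ⊖zδ s)) (≋-trans (hom-⊖ Lφ (zδ (suc s)) (zδ zero))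
     (≋-trans (⊖-cong (e _ (gen-zδ (suc s))) (e _ (gen-zδ zero))) (≋-trans (≋-sym (hom-⊖ Lψ (zδ (suc s)) (zδ zero))) (resp≋ Lψ (≋-sym (y-suc≋zδ⊖zδ s))))))

  F-⊛-letter : ∀ f w l → F f (w ⊛ mono (l ∷ [])) ≋ sumΔ f (λ a b → F a w ⊛ F b (mono (l ∷ [])))
  F-⊛-letter f w = agree-on-letters (linear-∘ (F-linear f) (linear-⊛ˡ w)) (linear-sumΔ f (λ a b → linear-∘ (linear-⊛ˡ (F a w)) (F-linear b))) (λ u gu → F-⊛-gen f w u gu)

  F-++-letter : ∀ g h l → F (g ++ h) (mono (l ∷ [])) ≋ F g (F h (mono (l ∷ [])))
  F-++-letter g h = agree-on-letters (F-linear (g ++ h)) (linear-∘ (F-linear g) (F-linear h)) (λ u gu → F-++-gen g h u gu)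

  mono-∷ʳ : (w : Word (suc n)) (l : L) → mono (w ++ (l ∷ [])) ≋ mono w ⊛ mono (l ∷ [])
  mono-∷ʳ w l = ≋-sym (mono-⊛ w (l ∷ []))

  F-⊛-mono : ∀ w f p → F f (p ⊛ mono w) ≋ sumΔ f (λ a b → F a p ⊛ F b (mono w))
  F-⊛-mono = snoc-ind (λ w → ∀ f p → F f (p ⊛ mono w) ≋ sumΔ f (λ a b → F a p ⊛ F b (mono w))) base step
    where
    base : ∀ f p → F f (p ⊛ 𝟙) ≋ sumΔ f (λ a b → F a p ⊛ F b 𝟙)
    base f p = begin
      F f (p ⊛ 𝟙) ≈⟨ F-cong f (⊛-identityʳ p) ⟩
      F f p ≈⟨ ≋-sym (sumΔ-counitʳ f (λ a b → F a p)) ⟩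
      sumΔ f (λ a b → ε b · F a p) ≈⟨ sumΔ-cong f (λ a b → ≋-trans (·-cong (ε b) (≋-sym (⊛-identityʳ (F a p))))
          (≋-trans (≋-sym (⊛-·ʳ (ε b) (F a p) 𝟙)) (⊛-congʳ (F a p) (≋-sym (F-𝟙 b))))) ⟩
      sumΔ f (λ a b → F a p ⊛ F b 𝟙) ∎
    step : ∀ w l → (∀ f p → F f (p ⊛ mono w) ≋ sumΔ f (λ a b → F a p ⊛ F b (mono w))) →
           ∀ f p → F f (p ⊛ mono (w ++ (l ∷ []))) ≋ sumΔ f (λ a b → F a p ⊛ F b (mono (w ++ (l ∷ []))))
    step w l IH f p = begin
      F f (p ⊛ mono (w ++ (l ∷ []))) ≈⟨ F-cong f (≋-trans (⊛-congʳ p (mono-∷ʳ w l)) (≋-sym (⊛-assoc p (mono w) ℓ))) ⟩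
      F f ((p ⊛ mono w) ⊛ ℓ) ≈⟨ F-⊛-letter f (p ⊛ mono w) l ⟩
      sumΔ f (λ a b → F a (p ⊛ mono w) ⊛ F b ℓ) ≈⟨ sumΔ-cong f (λ a b → ≋-trans (⊛-congˡ (F b ℓ) (IH a p)) (⊛-sumLˡ (ΔF a) _ (F b ℓ))) ⟩
      sumΔ f (λ a b → sumΔ a (λ a1 a2 → (F a1 p ⊛ F a2 (mono w)) ⊛ F b ℓ)) ≈⟨ sumΔ-coassoc f (λ a1 a2 b → (F a1 p ⊛ F a2 (mono w)) ⊛ F b ℓ) ⟩
      sumΔ f (λ a b → sumΔ b (λ b1 b2 → (F a p ⊛ F b1 (mono w)) ⊛ F b2 ℓ)) ≈⟨ sumΔ-cong f (λ a b → ≋-trans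
          (sumΔ-cong b (λ b1 b2 → ⊛-assoc (F a p) (F b1 (mono w)) (F b2 ℓ))) (≋-sym (⊛-sumLʳ (ΔF b) _ (F a p)))) ⟩
      sumΔ f (λ a b → F a p ⊛ sumΔ b (λ b1 b2 → F b1 (mono w) ⊛ F b2 ℓ)) ≈⟨ sumΔ-cong f (λ a b → ⊛-congʳ (F a p)
          (≋-trans (≋-sym (F-⊛-letter b (mono w) l)) (F-cong b (≋-sym (mono-∷ʳ w l))))) ⟩
      sumΔ f (λ a b → F a p ⊛ F b (mono (w ++ (l ∷ [])))) ∎
      where ℓ = mono (l ∷ [])

  F-⊛ : ∀ f p q → F f (p ⊛ q) ≋ sumΔ f (λ a b → F a p ⊛ F b q)
  F-⊛ f p = linear-unique (linear-∘ (F-linear f) (linear-⊛ˡ p)) (linear-sumΔ f (λ a b → linear-∘ (linear-⊛ˡ (F a p)) (F-linear b))) (λ w → F-⊛-mono w f p)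

  F-++-mono : ∀ w g h → F (g ++ h) (mono w) ≋ F g (F h (mono w))
  F-++-mono = snoc-ind (λ w → ∀ g h → F (g ++ h) (mono w) ≋ F g (F h (mono w))) base step
    where
    base : ∀ g h → F (g ++ h) 𝟙 ≋ F g (F h 𝟙)
    base g h = begin
      F (g ++ h) 𝟙 ≈⟨ F-𝟙 (g ++ h) ⟩
      ε (g ++ h) · 𝟙 ≈⟨ ≡→≋ (cong (_· 𝟙) (trans (ε-++ g h) (QP.*-comm (ε g) (ε h)))) ⟩
      (ε h *ℚ ε g) · 𝟙 ≈⟨ ≋-sym (·-assoc (ε h) (ε g) 𝟙) ⟩
      ε h · (ε g · 𝟙) ≈⟨ ·-cong (ε h) (≋-sym (F-𝟙 g)) ⟩
      ε h · F g 𝟙 ≈⟨ ≋-sym (hom-· (F-linear g) (ε h) 𝟙) ⟩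
      F g (ε h · 𝟙) ≈⟨ F-cong g (≋-sym (F-𝟙 h)) ⟩
      F g (F h 𝟙) ∎
    step : ∀ w l → (∀ g h → F (g ++ h) (mono w) ≋ F g (F h (mono w))) →
           ∀ g h → F (g ++ h) (mono (w ++ (l ∷ []))) ≋ F g (F h (mono (w ++ (l ∷ []))))
    step w l IH g h = begin
      F (g ++ h) (mono (w ++ (l ∷ []))) ≈⟨ F-cong (g ++ h) (mono-∷ʳ w l) ⟩
      F (g ++ h) (W ⊛ ℓ) ≈⟨ F-⊛ (g ++ h) W ℓ ⟩
      sumΔ (g ++ h) (λ e e' → F e W ⊛ F e' ℓ) ≈⟨ sumΔ-++ g h (λ e e' → F e W ⊛ F e' ℓ) ⟩
      sumΔ g (λ a b → sumΔ h (λ c d → F (a ++ c) W ⊛ F (b ++ d) ℓ)) ≈⟨ sumΔ-cong g (λ a b → sumΔ-cong h (λ c d → ⊛-cong (IH a c) (F-++-letter b d l))) ⟩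
      sumΔ g (λ a b → sumΔ h (λ c d → F a (F c W) ⊛ F b (F d ℓ))) ≈⟨ sumΔ-swap g h (λ a b c d → F a (F c W) ⊛ F b (F d ℓ)) ⟩
      sumΔ h (λ c d → sumΔ g (λ a b → F a (F c W) ⊛ F b (F d ℓ))) ≈⟨ sumΔ-cong h (λ c d → ≋-sym (F-⊛ g (F c W) (F d ℓ))) ⟩
      sumΔ h (λ c d → F g (F c W ⊛ F d ℓ)) ≈⟨ ≋-sym (hom-sumΔ (F-linear g) h (λ c d → F c W ⊛ F d ℓ)) ⟩
      F g (sumΔ h (λ c d → F c W ⊛ F d ℓ)) ≈⟨ F-cong g (≋-sym (F-⊛ h W ℓ)) ⟩
      F g (F h (W ⊛ ℓ)) ≈⟨ F-cong g (F-cong h (≋-sym (mono-∷ʳ w l))) ⟩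
      F g (F h (mono (w ++ (l ∷ [])))) ∎
      where ℓ = mono (l ∷ [])
            W = mono w

  F-++ : ∀ g h p → F (g ++ h) p ≋ F g (F h p)
  F-++ g h = linear-unique (F-linear (g ++ h)) (linear-∘ (F-linear g) (F-linear h)) (λ w → F-++-mono w g h)

  z^ : ℕ → P
  z^ zero = 𝟙
  z^ (suc k) = z^ k ⊛ zP

  z^-+ : ∀ a b → z^ a ⊛ z^ b ≋ z^ (b +ℕ a)
  z^-+ a zero = ⊛-identityʳ (z^ a)
  z^-+ a (suc b) = ≋-trans (≋-sym (⊛-assoc (z^ a) (z^ b) zP)) (⊛-congˡ zP (z^-+ a b))

  z^-comm : ∀ a b → z^ a ⊛ z^ b ≋ z^ b ⊛ z^ a
  z^-comm a b = ≋-trans (z^-+ a b) (≋-trans (≡→≋ (cong z^ (NP.+-comm b a))) (≋-sym (z^-+ b a)))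

  IsZMonomial : P → Set
  IsZMonomial μ = Σ ℚ λ c → Σ ℕ λ k → μ ≋ c · z^ k

  IsZMonomial-cong : ∀ {μ ν} → μ ≋ ν → IsZMonomial μ → IsZMonomial ν
  IsZMonomial-cong e (c , k , f) = c , k , ≋-trans (≋-sym e) f

  IsZMonomial-z^ : ∀ c k → IsZMonomial (c · z^ k)
  IsZMonomial-z^ c k = c , k , ≋-refl

  IsZMonomial-⊛ : ∀ {p q} → IsZMonomial p → IsZMonomial q → IsZMonomial (p ⊛ q)
  IsZMonomial-⊛ (c , a , e) (d , b , f) = c *ℚ d , b +ℕ a , ≋-trans (⊛-cong e f) (≋-trans (·-⊛-· c d (z^ a) (z^ b)) (·-cong (c *ℚ d) (z^-+ a b)))

  IsZMonomial-z : IsZMonomial zP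
  IsZMonomial-z = 1ℚ , 1 , ≋-sym (≋-trans (·-identityˡ (z^ 1)) (⊛-identityˡ zP))

  IsZMonomial-𝟙 : IsZMonomial 𝟙
  IsZMonomial-𝟙 = 1ℚ , 0 , ≋-sym (·-identityˡ 𝟙)

  IsZMonomial-𝟘 : IsZMonomial 𝟘
  IsZMonomial-𝟘 = 0ℚ , 0 , ≋-sym (·-zeroˡ 𝟙)

  IsZMonomial-comm : ∀ {p q} → IsZMonomial p → IsZMonomial q → p ⊛ q ≋ q ⊛ p
  IsZMonomial-comm (c , a , e) (d , b , f) = ≋-trans (⊛-cong e f) (≋-trans (·-⊛-· c d (z^ a) (z^ b))
    (≋-trans (≋-trans (≡→≋ (cong (_· (z^ a ⊛ z^ b)) (QP.*-comm c d))) (·-cong (d *ℚ c) (z^-comm a b)))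
    (≋-sym (≋-trans (⊛-cong f e) (·-⊛-· d c (z^ b) (z^ a))))))

  F-z^ : ∀ f k → F f (z^ k) ≋ ε f · z^ k
  F-z^ f zero = F-𝟙 f
  F-z^ f (suc k) = begin
      F f (z^ k ⊛ zP) ≈⟨ F-⊛-gen f (z^ k) zP gen-z ⟩
      sumΔ f (λ a b → F a (z^ k) ⊛ F b zP) ≈⟨ sumΔ-cong f (λ a b → ≋-trans (⊛-congʳ (F a (z^ k)) (F-z b)) (⊛-·ʳ (ε b) (F a (z^ k)) zP)) ⟩
      sumΔ f (λ a b → ε b · (F a (z^ k) ⊛ zP)) ≈⟨ sumΔ-counitʳ f (λ a b → F a (z^ k) ⊛ zP) ⟩
      F f (z^ k) ⊛ zP ≈⟨ ⊛-congˡ zP (F-z^ f k) ⟩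
      (ε f · z^ k) ⊛ zP ≈⟨ ⊛-·ˡ (ε f) (z^ k) zP ⟩
      ε f · z^ (suc k) ∎

  F-zMonomial : ∀ f {μ} → IsZMonomial μ → F f μ ≋ ε f · μ
  F-zMonomial f {μ} (c , k , e) = ≋-trans (F-cong f e) (≋-trans (hom-· (F-linear f) c (z^ k)) (≋-trans (·-cong c (F-z^ f k))
    (≋-trans (·-assoc c (ε f) (z^ k)) (≋-trans (≡→≋ (cong (_· z^ k) (QP.*-comm c (ε f)))) (≋-trans (≋-sym (·-assoc (ε f) c (z^ k))) (·-cong (ε f) (≋-sym e)))))))

  F-zMonomial-⊛ : ∀ f {μ} → IsZMonomial μ → ∀ Y → F f (μ ⊛ Y) ≋ μ ⊛ F f Y
  F-zMonomial-⊛ f {μ} zμ Y = begin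
      F f (μ ⊛ Y) ≈⟨ F-⊛ f μ Y ⟩
      sumΔ f (λ a b → F a μ ⊛ F b Y) ≈⟨ sumΔ-cong f (λ a b → ≋-trans (⊛-congˡ (F b Y) (F-zMonomial a zμ)) (⊛-·ˡ (ε a) μ (F b Y))) ⟩
      sumΔ f (λ a b → ε a · (μ ⊛ F b Y)) ≈⟨ sumΔ-counitˡ f (λ a b → μ ⊛ F b Y) ⟩
      μ ⊛ F f Y ∎

  -- The antipode

  app : HC → P → P
  app = apply F

  app-linear : ∀ h → IsLinear (app h)
  app-linear h = linear-sumL h (λ cf → linear-∘ (linear-· (proj₁ cf)) (F-linear (proj₂ cf)))

  app-++ : ∀ h h' p → app (h ++ h') p ≋ app h p ⊕ app h' p
  app-++ h h' p = sumL-++ h h' _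

  app-map : ∀ (f : ℚ × Forest → ℚ × Forest) (k : ℚ → ℚ) (m : Forest → Forest) → (∀ c g → f (c , g) ≡ (k c , m g)) →
    ∀ h p → app (map f h) p ≋ sumL h (λ cf → k (proj₁ cf) · F (m (proj₂ cf)) p)
  app-map f k m e [] p = ≋-refl
  app-map f k m e ((c , g) ∷ h) p rewrite e c g = ⊕-congʳ (k c · F (m g) p) (app-map f k m e h p)

  app-concatMap : ∀ {A : Set} (f : A → HC) (h : List A) p → app (concatMap f h) p ≋ sumL h (λ cf → app (f cf) p)
  app-concatMap f h p = sumL-concatMap f h _

  app-⊛H : ∀ A B p → app (A ⊛H B) p ≋ app A (app B p)
  app-⊛H [] B p = ≋-refl
  app-⊛H ((c , v) ∷ A) B p = ≋-trans (app-++ (map (λ { (d , w) → (c *ℚ d , v ++ w) }) B) (A ⊛H B) p)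
    (⊕-cong (≋-trans (app-map _ (c *ℚ_) (v ++_) (λ d w → refl) B p)
      (≋-trans (sumL-cong B (λ dw → ≋-trans (≋-sym (·-assoc c (proj₁ dw) _)) (·-cong c (·-cong (proj₁ dw) (F-++ v (proj₂ dw) p)))))
      (≋-trans (sumL-· B c _) (·-cong c (≋-trans (sumL-cong B (λ dw → ≋-sym (hom-· (F-linear v) (proj₁ dw) (F (proj₂ dw) p))))
        (≋-sym (hom-sumL (F-linear v) B (λ dw → proj₁ dw · F (proj₂ dw) p))))))))
      (app-⊛H A B p))

  app-single : ∀ f p → app ((1ℚ , f) ∷ []) p ≋ F f p
  app-single f p = ≋-trans (⊕-idʳ (1ℚ · F f p)) (·-identityˡ (F f p))

  -- Defs computes S with a fuel argument; any fuel at least the number of vertices gives the same map.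
  mutual
    Sfuel-irrelevant : ∀ m k t → size t ≤ℕ m → size t ≤ℕ k → ∀ p → app (Sfuel m t) p ≋ app (Sfuel k t) p
    Sfuel-irrelevant (suc m) (suc k) (B₊ fs) (s≤s lm) (s≤s lk) p = ≋-trans (Sfuel-B₊ m fs p) (≋-trans (⊝-cong
      (sumL-cong-All (ΔF fs) (All.map (λ {ab} A →
        SFfuel-irrelevant m k (proj₁ ab) (≤-trans (IsΔTerm-left-≤ fs (proj₁ ab) (proj₂ ab) A) lm) (≤-trans (IsΔTerm-left-≤ fs (proj₁ ab) (proj₂ ab) A) lk) _)
            (all-IsΔTerm fs))))
      (≋-sym (Sfuel-B₊ k fs p)))

    SFfuel-irrelevant : ∀ m k x → sizeF x ≤ℕ m → sizeF x ≤ℕ k → ∀ p → app (SFfuel m x) p ≋ app (SFfuel k x) p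
    SFfuel-irrelevant m k [] lm lk p = ≋-refl
    SFfuel-irrelevant m k (t ∷ ts) lm lk p = ≋-trans (app-⊛H (SFfuel m ts) (Sfuel m t) p)
      (≋-trans (≋-trans (resp≋ (app-linear (SFfuel m ts)) (Sfuel-irrelevant m k t (≤-trans (NP.m≤m+n (size t) (sizeF ts)) lm)
          (≤-trans (NP.m≤m+n (size t) (sizeF ts)) lk) p))
                        (SFfuel-irrelevant m k ts (≤-trans (NP.m≤n+m (sizeF ts) (size t)) lm) (≤-trans (NP.m≤n+m (sizeF ts) (size t)) lk) _))
      (≋-sym (app-⊛H (SFfuel k ts) (Sfuel k t) p)))

    Sfuel-B₊ : ∀ m fs p → app (Sfuel (suc m) (B₊ fs)) p ≋ ⊝ sumL (ΔF fs) (λ ab → app (SFfuel m (proj₁ ab)) (F (B₊ (proj₂ ab) ∷ []) p))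
    Sfuel-B₊ m fs p = ≋-trans (app-map _ -_ (λ g → g) (λ c g → refl) CM p)
      (≋-trans (sumL-cong CM (λ cf → ≋-trans (≡→≋ (cong (_· F (proj₂ cf) p) (neg-1 (proj₁ cf)))) (≋-sym (·-assoc (- 1ℚ) (proj₁ cf) (F (proj₂ cf) p)))))
      (≋-trans (sumL-· CM (- 1ℚ) (λ cf → proj₁ cf · F (proj₂ cf) p)) (⊝-cong (≋-trans (app-concatMap PL (ΔF fs) p) (sumL-cong (ΔF fs) (λ ab →
        ≋-trans (app-⊛H (SFfuel m (proj₁ ab)) ((1ℚ , B₊ (proj₂ ab) ∷ []) ∷ []) p) (resp≋ (app-linear (SFfuel m (proj₁ ab))) (app-single (B₊ (proj₂ ab) ∷ []) p))))))))
      where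
      PL : Forest × Forest → HC
      PL ab = SFfuel m (proj₁ ab) ⊛H ((1ℚ , B₊ (proj₂ ab) ∷ []) ∷ [])
      CM : HC
      CM = concatMap PL (ΔF fs)
      neg-1 : ∀ c → - c ≡ (- 1ℚ) *ℚ c
      neg-1 c = solve 1 (λ c → :- c := con (- 1ℚ) :* c) refl c

  S̃ : Forest → P → P
  S̃ x p = app (SForest x) p

  S̃ᵀ : Tree → P → P
  S̃ᵀ t p = app (Sfuel (size t) t) p

  app-S : ∀ (h : HC) p → app (S h) p ≋ sumL h (λ cf → proj₁ cf · S̃ (proj₂ cf) p)
  app-S h p = ≋-trans (app-concatMap _ h p) (sumL-cong h λ cf →
      ≋-trans (app-map _ (proj₁ cf *ℚ_) (λ g → g) (λ d g → refl) (SForest (proj₂ cf)) p)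
      (≋-trans (sumL-cong (SForest (proj₂ cf)) (λ dg → ≋-sym (·-assoc (proj₁ cf) (proj₁ dg) (F (proj₂ dg) p))))
      (sumL-· (SForest (proj₂ cf)) (proj₁ cf) (λ dg → proj₁ dg · F (proj₂ dg) p))))

  S̃-linear : ∀ x → IsLinear (S̃ x)
  S̃-linear x = app-linear (SForest x)

  S̃ᵀ-linear : ∀ t → IsLinear (S̃ᵀ t)
  S̃ᵀ-linear t = app-linear (Sfuel (size t) t)

  S̃-[] : ∀ p → S̃ [] p ≋ p
  S̃-[] p = ≋-trans (app-single [] p) (F-[] p)

  S̃-∷ : ∀ t ts p → S̃ (t ∷ ts) p ≋ S̃ ts (S̃ᵀ t p)
  S̃-∷ t ts p = ≋-trans (app-⊛H (SFfuel N ts) (Sfuel N t) p)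
    (≋-trans (resp≋ (app-linear (SFfuel N ts)) (Sfuel-irrelevant N (size t) t (NP.m≤m+n (size t) (sizeF ts)) NP.≤-refl p))
    (SFfuel-irrelevant N (sizeF ts) ts (NP.m≤n+m (sizeF ts) (size t)) NP.≤-refl _))
    where N = size t +ℕ sizeF ts

  S̃ᵀ-B₊ : ∀ fs p → S̃ᵀ (B₊ fs) p ≋ ⊝ sumΔ fs (λ a b → S̃ a (F (B₊ b ∷ []) p))
  S̃ᵀ-B₊ fs p = ≋-trans (Sfuel-B₊ (sizeF fs) fs p) (⊝-cong (sumL-cong-All (ΔF fs) (All.map (λ {ab} A →
    SFfuel-irrelevant (sizeF fs) (sizeF (proj₁ ab)) (proj₁ ab) (IsΔTerm-left-≤ fs (proj₁ ab) (proj₂ ab) A) NP.≤-refl _) (all-IsΔTerm fs))))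

  S̃-single : ∀ t p → S̃ (t ∷ []) p ≋ S̃ᵀ t p
  S̃-single t p = ≋-trans (S̃-∷ t [] p) (S̃-[] (S̃ᵀ t p))

  S̃-++ : ∀ g h p → S̃ (g ++ h) p ≋ S̃ h (S̃ g p)
  S̃-++ [] h p = resp≋ (S̃-linear h) (≋-sym (S̃-[] p))
  S̃-++ (t ∷ g) h p = ≋-trans (S̃-∷ t (g ++ h) p) (≋-trans (S̃-++ g h (S̃ᵀ t p)) (resp≋ (S̃-linear h) (≋-sym (S̃-∷ t g p))))

  S̃⋆F̃ᵀ≋𝟘 : ∀ t Y → sumΔT t (λ a b → S̃ a (F b Y)) ≋ 𝟘
  S̃⋆F̃ᵀ≋𝟘 (B₊ fs) Y = ≋-trans (sumΔT-B fs (λ a b → S̃ a (F b Y))) (≋-trans (⊕-congˡ X (≋-trans (S̃-single (B₊ fs) (F [] Y))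
    (≋-trans (resp≋ (S̃ᵀ-linear (B₊ fs)) (F-[] Y)) (S̃ᵀ-B₊ fs Y)))) (≋-trans (⊕-comm (⊝ X) X) (⊖-inverseʳ X)))
    where X = sumΔ fs (λ a b → S̃ a (F (B₊ b ∷ []) Y))

  S̃⋆F̃≋ε : ∀ m p → sumΔ m (λ a b → S̃ a (F b p)) ≋ ε m · p
  S̃⋆F̃≋ε [] p = ≋-trans (sumΔ-[] (λ a b → S̃ a (F b p))) (≋-trans (S̃-[] (F [] p)) (≋-trans (F-[] p) (≋-sym (·-identityˡ p))))
  S̃⋆F̃≋ε (t ∷ ts) p = begin
      sumΔ (t ∷ ts) (λ a b → S̃ a (F b p)) ≈⟨ sumΔ-cons t ts (λ a b → S̃ a (F b p)) ⟩
      sumΔT t (λ a b → sumΔ ts (λ c d → S̃ (a ++ c) (F (b ++ d) p))) ≈⟨ sumΔT-cong t (λ a b → sumΔ-cong ts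
          (λ c d → ≋-trans (S̃-++ a c _) (resp≋ (S̃-linear c) (resp≋ (S̃-linear a) (F-++ b d p))))) ⟩
      sumΔT t (λ a b → sumΔ ts (λ c d → S̃ c (S̃ a (F b (F d p))))) ≈⟨ sumL-swap (ΔT t) (ΔF ts)
          (λ ab cd → S̃ (proj₁ cd) (S̃ (proj₁ ab) (F (proj₂ ab) (F (proj₂ cd) p)))) ⟩
      sumΔ ts (λ c d → sumΔT t (λ a b → S̃ c (S̃ a (F b (F d p))))) ≈⟨ sumΔ-cong ts (λ c d → ≋-sym
          (hom-sumL (S̃-linear c) (ΔT t) (λ ab → S̃ (proj₁ ab) (F (proj₂ ab) (F d p))))) ⟩
      sumΔ ts (λ c d → S̃ c (sumΔT t (λ a b → S̃ a (F b (F d p))))) ≈⟨ sumΔ-cong ts (λ c d → ≋-trans (resp≋ (S̃-linear c) (S̃⋆F̃ᵀ≋𝟘 t (F d p))) (hom-𝟘 (S̃-linear c))) ⟩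
      sumΔ ts (λ c d → 𝟘) ≈⟨ sumL-𝟘 (ΔF ts) (λ _ → 𝟘) (λ _ → ≋-refl) ⟩
      𝟘 ≈⟨ ≋-sym (·-zeroˡ p) ⟩
      0ℚ · p ∎

  -- Polynomials in z inverting f ↦ f̃(z_s^δ)

  -- ν(f) is the polynomial in z for which N = ν(f)(z − z_s^δ) + ε(f) satisfies
  -- Σ_{(f)} f̃′(z_s^δ) N(f″) = ε(f) z_s^δ (E⋆N below); the recursion is read off from (II).
  mutual
    νᵀ : Tree → P
    νᵀ (B₊ c) = zP ⊛ ν c ⊖ ε c · 𝟙

    ν : Forest → P
    ν [] = 𝟘
    ν (t ∷ ts) = νᵀ t ⊛ (zP ⊛ ν ts ⊕ ε ts · 𝟙)

  ν̂ : Forest → P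
  ν̂ ts = zP ⊛ ν ts ⊕ ε ts · 𝟙

  ν̂-[] : ν̂ [] ≋ 𝟙
  ν̂-[] = ≋-trans (⊕-congˡ (1ℚ · 𝟙) (⊛-zeroʳ zP)) (·-identityˡ 𝟙)

  ν̂-∷ : ∀ t ts → ν̂ (t ∷ ts) ≋ zP ⊛ ν (t ∷ ts)
  ν̂-∷ t ts = ≋-trans (⊕-congʳ (zP ⊛ ν (t ∷ ts)) (·-zeroˡ 𝟙)) (⊕-idʳ _)

  ν-single : ∀ t → ν (t ∷ []) ≋ νᵀ t
  ν-single t = ≋-trans (⊛-congʳ (νᵀ t) ν̂-[]) (⊛-identityʳ (νᵀ t))

  νᵀ-• : νᵀ (B₊ []) ≋ (- 1ℚ) · 𝟙
  νᵀ-• = ≋-trans (⊕-congˡ (⊝ (1ℚ · 𝟙)) (⊛-zeroʳ zP)) (≋-trans (⊝-cong (·-identityˡ 𝟙)) ≋-refl)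

  νᵀ-B₊∷ : ∀ t ts → νᵀ (B₊ (t ∷ ts)) ≋ zP ⊛ ν (t ∷ ts)
  νᵀ-B₊∷ t ts = ≋-trans (⊕-congʳ (zP ⊛ ν (t ∷ ts)) (⊝-cong (·-zeroˡ 𝟙))) (⊕-idʳ _)

  mutual
    IsZMonomial-νᵀ : ∀ t → IsZMonomial (νᵀ t)
    IsZMonomial-νᵀ (B₊ []) = IsZMonomial-cong (≋-sym νᵀ-•) (IsZMonomial-z^ (- 1ℚ) 0)
    IsZMonomial-νᵀ (B₊ (t ∷ ts)) = IsZMonomial-cong (≋-sym (νᵀ-B₊∷ t ts)) (IsZMonomial-⊛ IsZMonomial-z (IsZMonomial-ν (t ∷ ts)))

    IsZMonomial-ν : ∀ x → IsZMonomial (ν x)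
    IsZMonomial-ν [] = IsZMonomial-𝟘
    IsZMonomial-ν (t ∷ ts) = IsZMonomial-⊛ (IsZMonomial-νᵀ t) (IsZMonomial-ν̂ ts)

    IsZMonomial-ν̂ : ∀ ts → IsZMonomial (ν̂ ts)
    IsZMonomial-ν̂ [] = IsZMonomial-cong (≋-sym ν̂-[]) IsZMonomial-𝟙
    IsZMonomial-ν̂ (t ∷ ts) = IsZMonomial-cong (≋-sym (ν̂-∷ t ts)) (IsZMonomial-⊛ IsZMonomial-z (IsZMonomial-ν (t ∷ ts)))

  IsΔTermᵀ-right : Tree → Forest × Forest → Set
  IsΔTermᵀ-right t ab = (proj₂ ab ≡ []) ⊎ (Σ Tree λ s' → (proj₂ ab ≡ s' ∷ []) × (size s' ≤ℕ size t))

  all-IsΔTermᵀ-right : ∀ t → All (IsΔTermᵀ-right t) (ΔT t)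
  all-IsΔTermᵀ-right (B₊ fs) = inj₁ refl ∷ All.map⁺ (All.map (λ {ab} A → inj₂ (B₊ (proj₂ ab) , refl , s≤s (IsΔTerm-right-≤ fs (proj₁ ab) (proj₂ ab) A))) (all-IsΔTerm fs))

  zMonomial-swap : ∀ {a b} → IsZMonomial a → IsZMonomial b → a ⊛ (zP ⊛ b) ≋ b ⊛ (zP ⊛ a)
  zMonomial-swap {a} {b} za zb = ≋-trans (IsZMonomial-comm za (IsZMonomial-⊛ IsZMonomial-z zb)) (≋-trans (⊛-congˡ a (IsZMonomial-comm IsZMonomial-z zb)) (⊛-assoc b zP a))

  module AtGenerator (s : Fin (suc n)) where
    u : P
    u = zδ s
    v : P
    v = vδ s
    gen-u : Gen u
    gen-u = gen-zδ s
    E : Forest → P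
    E x = F x u
    N : Forest → P
    N x = ν x ⊛ v ⊕ ε x · 𝟙

    E-++ : ∀ a c → E (a ++ c) ≋ F a (E c)
    E-++ a c = F-++-gen a c u gen-u

    F-v : ∀ x → F x v ≋ ε x · zP ⊖ E x
    F-v x = ≋-trans (hom-⊖ (F-linear x) zP u) (⊕-congˡ (⊝ E x) (F-z x))

    N-[] : N [] ≋ 𝟙
    N-[] = ·-identityˡ 𝟙

    N-∷ : ∀ t ts → N (t ∷ ts) ≋ ν (t ∷ ts) ⊛ v
    N-∷ t ts = ≋-trans (⊕-congʳ (ν (t ∷ ts) ⊛ v) (·-zeroˡ 𝟙)) (⊕-idʳ _)

    N-single : ∀ t → N (t ∷ []) ≋ νᵀ t ⊛ v
    N-single t = ≋-trans (N-∷ t []) (⊛-congˡ v (ν-single t))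

    E-• : E (B₊ [] ∷ []) ≋ u ⊛ v
    E-• = ⟨ RR.I-zδ s ⟩

    -- The polynomial q of (II): F(B₊ f)(u) = q (2z − u) (z − u) with q (z − u) = f̃(u).
    qII : Tree → Forest → P
    qII t ts = proj₁ (RR.II-zδ t ts s)
    qII⊛v : ∀ t ts → qII t ts ⊛ v ≋ E (t ∷ ts)
    qII⊛v t ts = ⟨ proj₁ (proj₂ (RR.II-zδ t ts s)) ⟩
    E-B₊ : ∀ t ts → E (B₊ (t ∷ ts) ∷ []) ≋ qII t ts ⊛ (zP ⊕ v) ⊛ v
    E-B₊ t ts = ≋-trans ⟨ proj₂ (proj₂ (RR.II-zδ t ts s)) ⟩ (⊛-congˡ v (⊛-congʳ (qII t ts) (⊕-assoc zP zP (⊝ u))))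

    E⋆Nᵀ≋𝟘 : Tree → Set
    E⋆Nᵀ≋𝟘 t = sumΔT t (λ a b → E a ⊛ N b) ≋ 𝟘
    E⋆N≋εu : Forest → Set
    E⋆N≋εu x = sumΔ x (λ a b → E a ⊛ N b) ≋ ε x · u

    E⋆Nᵀ-• : E⋆Nᵀ≋𝟘 (B₊ [])
    E⋆Nᵀ-• = begin
        sumΔT (B₊ []) (λ a b → E a ⊛ N b) ≈⟨ sumΔT-B [] (λ a b → E a ⊛ N b) ⟩
        E (B₊ [] ∷ []) ⊛ N [] ⊕ sumΔ [] (λ a b → E a ⊛ N (B₊ b ∷ [])) ≈⟨ ⊕-cong (⊛-cong E-• N-[]) (sumΔ-[] (λ a b → E a ⊛ N (B₊ b ∷ []))) ⟩
        (u ⊛ v) ⊛ 𝟙 ⊕ E [] ⊛ N (B₊ [] ∷ []) ≈⟨ ⊕-cong (⊛-identityʳ (u ⊛ v)) (⊛-cong (F-[] u) (≋-trans (N-single (B₊ [])) (⊛-congˡ v νᵀ-•))) ⟩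
        u ⊛ v ⊕ u ⊛ ((- 1ℚ · 𝟙) ⊛ v) ≈⟨ ⊕-congʳ (u ⊛ v) (≋-trans (⊛-congʳ u (≋-trans (⊛-·ˡ (- 1ℚ) 𝟙 v) (·-cong (- 1ℚ) (⊛-identityˡ v)))) (⊛-·ʳ (- 1ℚ) u v)) ⟩
        u ⊛ v ⊖ u ⊛ v ≈⟨ ⊖-inverseʳ (u ⊛ v) ⟩
        𝟘 ∎

    E⋆ν≋⊝qII : ∀ t' ts' → E⋆N≋εu (t' ∷ ts') → sumΔ (t' ∷ ts') (λ a c → E a ⊛ ν c) ≋ ⊝ qII t' ts'
    E⋆ν≋⊝qII t' ts' rb = ⊕≋𝟘⇒≋⊝ X q (⊛vδ≋𝟘⇒≋𝟘 s (X ⊕ q) (≋-trans (⊛-⊕ˡ X q v) (≋-trans (⊕-congʳ (X ⊛ v) (qII⊛v t' ts')) Xv)))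
      where
      b = t' ∷ ts'
      q = qII t' ts'
      X = sumΔ b (λ a c → E a ⊛ ν c)
      Xv : X ⊛ v ⊕ E b ≋ 𝟘
      Xv = begin
          X ⊛ v ⊕ E b ≈⟨ ⊕-cong (⊛-sumLˡ (ΔF b) (λ ac → E (proj₁ ac) ⊛ ν (proj₂ ac)) v) (≋-sym (sumΔ-counitʳ b (λ a c → E a))) ⟩
          sumΔ b (λ a c → (E a ⊛ ν c) ⊛ v) ⊕ sumΔ b (λ a c → ε c · E a) ≈⟨ ≋-sym (sumL-⊕ (ΔF b) _ _) ⟩
          sumΔ b (λ a c → (E a ⊛ ν c) ⊛ v ⊕ ε c · E a) ≈⟨ sumΔ-cong b (λ a c → ≋-sym (≋-trans (⊛-⊕ʳ (E a) (ν c ⊛ v) (ε c · 𝟙))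
                                                          (⊕-cong (≋-sym (⊛-assoc (E a) (ν c) v)) (≋-trans (⊛-·ʳ (ε c) (E a) 𝟙) (·-cong (ε c) (⊛-identityʳ (E a))))))) ⟩
          sumΔ b (λ a c → E a ⊛ N c) ≈⟨ rb ⟩
          0ℚ · u ≈⟨ ·-zeroˡ u ⟩
          𝟘 ∎

    E⊛N-B₊ : ∀ a c → E a ⊛ N (B₊ c ∷ []) ≋ (E a ⊛ ν c) ⊛ (zP ⊛ v) ⊖ ε c · (E a ⊛ v)
    E⊛N-B₊ a c = begin
        E a ⊛ N (B₊ c ∷ []) ≈⟨ ⊛-congʳ (E a) (N-single (B₊ c)) ⟩
        E a ⊛ ((zP ⊛ ν c ⊖ ε c · 𝟙) ⊛ v) ≈⟨ ⊛-congʳ (E a) (≋-trans (⊛-⊖ˡ (zP ⊛ ν c) (ε c · 𝟙) v)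
               (⊖-cong (≋-trans (⊛-congˡ v (IsZMonomial-comm IsZMonomial-z (IsZMonomial-ν c))) (⊛-assoc (ν c) zP v))
                   (≋-trans (⊛-·ˡ (ε c) 𝟙 v) (·-cong (ε c) (⊛-identityˡ v))))) ⟩
        E a ⊛ (ν c ⊛ (zP ⊛ v) ⊖ ε c · v) ≈⟨ ≋-trans (⊛-⊖ʳ (E a) (ν c ⊛ (zP ⊛ v)) (ε c · v)) (⊖-cong (≋-sym (⊛-assoc (E a) (ν c) (zP ⊛ v))) (⊛-·ʳ (ε c) (E a) v)) ⟩
        (E a ⊛ ν c) ⊛ (zP ⊛ v) ⊖ ε c · (E a ⊛ v) ∎

    -- Axiom (II) writes E (B₊ b) = q (z + v) v with q v = E b; the two terms cancel against
    -- those coming from ν(B₊ b) = z ν(b) − ε(b).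
    E⋆Nᵀ-B₊ : ∀ t' ts' → E⋆N≋εu (t' ∷ ts') → E⋆Nᵀ≋𝟘 (B₊ (t' ∷ ts'))
    E⋆Nᵀ-B₊ t' ts' rb = begin
        sumΔT (B₊ b) (λ a c → E a ⊛ N c) ≈⟨ sumΔT-B b (λ a c → E a ⊛ N c) ⟩
        E (B₊ b ∷ []) ⊛ N [] ⊕ sumΔ b (λ a c → E a ⊛ N (B₊ c ∷ [])) ≈⟨ ⊕-cong (≋-trans (⊛-congʳ (E (B₊ b ∷ [])) N-[]) (⊛-identityʳ _)) (sumΔ-cong b E⊛N-B₊) ⟩
        E (B₊ b ∷ []) ⊕ sumΔ b (λ a c → (E a ⊛ ν c) ⊛ (zP ⊛ v) ⊖ ε c · (E a ⊛ v)) ≈⟨ ⊕-congʳ (E (B₊ b ∷ [])) (≋-trans (sumL-⊕ (ΔF b) _ _)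
             (⊕-cong (≋-sym (⊛-sumLˡ (ΔF b) (λ ac → E (proj₁ ac) ⊛ ν (proj₂ ac)) (zP ⊛ v)))
                     (≋-trans (sumL-· (ΔF b) (- 1ℚ) (λ ac → ε (proj₂ ac) · (E (proj₁ ac) ⊛ v))) (⊝-cong (sumΔ-counitʳ b (λ a c → E a ⊛ v)))))) ⟩
        E (B₊ b ∷ []) ⊕ (X ⊛ (zP ⊛ v) ⊖ E b ⊛ v) ≈⟨ ⊕-cong (E-B₊ t' ts') (⊖-cong (⊛-congˡ (zP ⊛ v) (E⋆ν≋⊝qII t' ts' rb)) (⊛-congˡ v (≋-sym (qII⊛v t' ts')))) ⟩
        q ⊛ (zP ⊕ v) ⊛ v ⊕ ((⊝ q) ⊛ (zP ⊛ v) ⊖ (q ⊛ v) ⊛ v) ≈⟨ ⊕-cong (≋-trans (⊛-assoc q (zP ⊕ v) v) (≋-trans (⊛-congʳ q (⊛-⊕ˡ zP v v)) (⊛-⊕ʳ q (zP ⊛ v) (v ⊛ v))))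
                                                                      (⊖-cong (⊛-·ˡ (- 1ℚ) q (zP ⊛ v)) (⊛-assoc q v v)) ⟩
        (q ⊛ (zP ⊛ v) ⊕ q ⊛ (v ⊛ v)) ⊕ (⊝ (q ⊛ (zP ⊛ v)) ⊖ q ⊛ (v ⊛ v)) ≈⟨ ⊕-⊝-⊖-cancel (q ⊛ (zP ⊛ v)) (q ⊛ (v ⊛ v)) ⟩
        𝟘 ∎
      where
      b = t' ∷ ts'
      q = qII t' ts'
      X = sumΔ b (λ a c → E a ⊛ ν c)

    N-∷-tree : ∀ s' d → E⋆Nᵀ≋𝟘 s' → N (s' ∷ d) ≋ sumΔ (s' ∷ []) (λ b1 b2 → F b1 (N d) ⊛ N b2)
    N-∷-tree s' [] rt = ≋-sym (begin
        sumΔ (s' ∷ []) (λ b1 b2 → F b1 (N []) ⊛ N b2) ≈⟨ sumΔ-single s' (λ b1 b2 → F b1 (N []) ⊛ N b2) ⟩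
        sumΔT s' (λ b1 b2 → F b1 (N []) ⊛ N b2) ≈⟨ sumΔT-cong s' (λ b1 b2 → ≋-trans (⊛-congˡ (N b2) (≋-trans (F-cong b1 N-[]) (F-𝟙 b1)))
            (≋-trans (⊛-·ˡ (ε b1) 𝟙 (N b2)) (·-cong (ε b1) (⊛-identityˡ (N b2))))) ⟩
        sumΔT s' (λ b1 b2 → ε b1 · N b2) ≈⟨ sumΔT-counitˡ s' (λ b1 b2 → N b2) ⟩
        N (s' ∷ []) ∎)
    N-∷-tree s' (d0 ∷ ds) rt = begin
        N (s' ∷ d) ≈⟨ N-∷ s' d ⟩
        (νᵀ s' ⊛ ν̂ d) ⊛ v ≈⟨ ⊛-congˡ v (⊛-congʳ (νᵀ s') (ν̂-∷ d0 ds)) ⟩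
        (νᵀ s' ⊛ (zP ⊛ ν d)) ⊛ v ≈⟨ ⊛-congˡ v (zMonomial-swap (IsZMonomial-νᵀ s') (IsZMonomial-ν d)) ⟩
        (ν d ⊛ (zP ⊛ νᵀ s')) ⊛ v ≈⟨ ≋-trans (⊛-assoc (ν d) (zP ⊛ νᵀ s') v) (⊛-congʳ (ν d) (⊛-assoc zP (νᵀ s') v)) ⟩
        ν d ⊛ (zP ⊛ (νᵀ s' ⊛ v)) ≈⟨ ⊛-congʳ (ν d) (≋-trans (⊛-congʳ zP (≋-sym (N-single s'))) (≋-sym (⊖-identityʳ (zP ⊛ N (s' ∷ []))))) ⟩
        ν d ⊛ (zP ⊛ N (s' ∷ []) ⊖ 𝟘) ≈⟨ ⊛-congʳ (ν d) (⊖-cong (≋-sym (sumΔT-counitˡ s' (λ b1 b2 → zP ⊛ N b2))) (≋-sym rt)) ⟩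
        ν d ⊛ (sumΔT s' (λ b1 b2 → ε b1 · (zP ⊛ N b2)) ⊖ sumΔT s' (λ b1 b2 → E b1 ⊛ N b2)) ≈⟨ ⊛-congʳ (ν d) (≋-trans (⊕-congʳ (sumΔT s' (λ b1 b2 → ε b1 · (zP ⊛ N b2)))
              (≋-sym (sumL-· (ΔT s') (- 1ℚ) (λ bb → E (proj₁ bb) ⊛ N (proj₂ bb))))) (≋-sym (sumL-⊕ (ΔT s') _ _))) ⟩
        ν d ⊛ sumΔT s' (λ b1 b2 → ε b1 · (zP ⊛ N b2) ⊖ E b1 ⊛ N b2) ≈⟨ ⊛-sumLʳ (ΔT s') _ (ν d) ⟩
        sumΔT s' (λ b1 b2 → ν d ⊛ (ε b1 · (zP ⊛ N b2) ⊖ E b1 ⊛ N b2)) ≈⟨ sumΔT-cong s' (λ b1 b2 → ⊛-congʳ (ν d) (≋-trans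
              (⊖-cong (≋-sym (⊛-·ˡ (ε b1) zP (N b2))) ≋-refl) (≋-sym (⊛-⊖ˡ (ε b1 · zP) (E b1) (N b2))))) ⟩
        sumΔT s' (λ b1 b2 → ν d ⊛ ((ε b1 · zP ⊖ E b1) ⊛ N b2)) ≈⟨ sumΔT-cong s' (λ b1 b2 → ≋-trans (≋-sym (⊛-assoc (ν d) _ (N b2)))
              (⊛-congˡ (N b2) (≋-trans (⊛-congʳ (ν d) (≋-sym (F-v b1))) (≋-sym (F-zMonomial-⊛ b1 (IsZMonomial-ν d) v))))) ⟩
        sumΔT s' (λ b1 b2 → F b1 (ν d ⊛ v) ⊛ N b2) ≈⟨ sumΔT-cong s' (λ b1 b2 → ⊛-congˡ (N b2) (F-cong b1 (≋-sym (N-∷ d0 ds)))) ⟩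
        sumΔT s' (λ b1 b2 → F b1 (N d) ⊛ N b2) ≈⟨ ≋-sym (sumΔ-single s' (λ b1 b2 → F b1 (N d) ⊛ N b2)) ⟩
        sumΔ (s' ∷ []) (λ b1 b2 → F b1 (N d) ⊛ N b2) ∎
      where d = d0 ∷ ds

    N-++-ΔTerm : ∀ t ab d → IsΔTermᵀ-right t ab → (∀ s' → size s' ≤ℕ size t → E⋆Nᵀ≋𝟘 s') →
      N (proj₂ ab ++ d) ≋ sumΔ (proj₂ ab) (λ b1 b2 → F b1 (N d) ⊛ N b2)
    N-++-ΔTerm t (a , .[]) d (inj₁ refl) rts = ≋-sym (≋-trans (sumΔ-[] (λ b1 b2 → F b1 (N d) ⊛ N b2))
      (≋-trans (⊛-cong (F-[] (N d)) N-[]) (⊛-identityʳ (N d))))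
    N-++-ΔTerm t (a , .(s' ∷ [])) d (inj₂ (s' , refl , le)) rts = N-∷-tree s' d (rts s' le)

    E⋆N-∷ : ∀ t ts → (∀ s' → size s' ≤ℕ size t → E⋆Nᵀ≋𝟘 s') → E⋆N≋εu ts → E⋆N≋εu (t ∷ ts)
    E⋆N-∷ t ts rts rel = begin
        sumΔ (t ∷ ts) (λ x y → E x ⊛ N y) ≈⟨ sumΔ-cons t ts (λ x y → E x ⊛ N y) ⟩
        sumΔT t (λ a b → sumΔ ts (λ c d → E (a ++ c) ⊛ N (b ++ d))) ≈⟨ sumL-cong-All (ΔT t) (All.map (λ {ab} B →
             sumΔ-cong ts (λ c d → ⊛-cong (E-++ (proj₁ ab) c) (N-++-ΔTerm t ab d B rts))) (all-IsΔTermᵀ-right t)) ⟩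
        sumΔT t (λ a b → sumΔ ts (λ c d → F a (E c) ⊛ sumΔ b (λ b1 b2 → F b1 (N d) ⊛ N b2))) ≈⟨ sumΔT-cong t (λ a b → sumΔ-cong ts (λ c d →
             ≋-trans (⊛-sumLʳ (ΔF b) (λ bb → F (proj₁ bb) (N d) ⊛ N (proj₂ bb)) (F a (E c)))
               (sumΔ-cong b (λ b1 b2 → ≋-sym (⊛-assoc (F a (E c)) (F b1 (N d)) (N b2)))))) ⟩
        sumΔT t (λ a b → sumΔ ts (λ c d → sumΔ b (λ b1 b2 → (F a (E c) ⊛ F b1 (N d)) ⊛ N b2))) ≈⟨ sumΔT-cong t
            (λ a b → sumΔ-swap ts b (λ c d b1 b2 → (F a (E c) ⊛ F b1 (N d)) ⊛ N b2)) ⟩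
        sumΔT t (λ a b → sumΔ b (λ b1 b2 → sumΔ ts (λ c d → (F a (E c) ⊛ F b1 (N d)) ⊛ N b2))) ≈⟨ ≋-sym
            (sumΔT-coassoc t (λ a1 a2 b → sumΔ ts (λ c d → (F a1 (E c) ⊛ F a2 (N d)) ⊛ N b))) ⟩
        sumΔT t (λ a b → sumΔ a (λ a1 a2 → sumΔ ts (λ c d → (F a1 (E c) ⊛ F a2 (N d)) ⊛ N b))) ≈⟨ sumΔT-cong t
            (λ a b → ≋-trans (sumΔ-swap a ts (λ a1 a2 c d → (F a1 (E c) ⊛ F a2 (N d)) ⊛ N b))
             (sumΔ-cong ts (λ c d → ≋-sym (⊛-sumLˡ (ΔF a) (λ aa → F (proj₁ aa) (E c) ⊛ F (proj₂ aa) (N d)) (N b))))) ⟩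
        sumΔT t (λ a b → sumΔ ts (λ c d → sumΔ a (λ a1 a2 → F a1 (E c) ⊛ F a2 (N d)) ⊛ N b)) ≈⟨ sumΔT-cong t
            (λ a b → sumΔ-cong ts (λ c d → ⊛-congˡ (N b) (≋-sym (F-⊛ a (E c) (N d))))) ⟩
        sumΔT t (λ a b → sumΔ ts (λ c d → F a (E c ⊛ N d) ⊛ N b)) ≈⟨ sumΔT-cong t (λ a b → ≋-trans
            (≋-sym (⊛-sumLˡ (ΔF ts) (λ cd → F a (E (proj₁ cd) ⊛ N (proj₂ cd))) (N b)))
             (⊛-congˡ (N b) (≋-sym (hom-sumΔ (F-linear a) ts (λ c d → E c ⊛ N d))))) ⟩
        sumΔT t (λ a b → F a (sumΔ ts (λ c d → E c ⊛ N d)) ⊛ N b) ≈⟨ sumΔT-cong t (λ a b → ≋-trans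
            (⊛-congˡ (N b) (≋-trans (F-cong a rel) (hom-· (F-linear a) (ε ts) u))) (⊛-·ˡ (ε ts) (E a) (N b))) ⟩
        sumΔT t (λ a b → ε ts · (E a ⊛ N b)) ≈⟨ sumL-· (ΔT t) (ε ts) (λ ab → E (proj₁ ab) ⊛ N (proj₂ ab)) ⟩
        ε ts · sumΔT t (λ a b → E a ⊛ N b) ≈⟨ ·-cong (ε ts) (rts t NP.≤-refl) ⟩
        ε ts · 𝟘 ≈⟨ ≋-sym (·-zeroˡ u) ⟩
        0ℚ · u ∎

    E⋆N-[] : E⋆N≋εu []
    E⋆N-[] = ≋-trans (sumΔ-[] (λ a b → E a ⊛ N b)) (≋-trans (⊛-cong (F-[] u) N-[]) (≋-trans (⊛-identityʳ u) (≋-sym (·-identityˡ u))))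

    mutual
      E⋆Nᵀ-bounded : ∀ k t → size t ≤ℕ k → E⋆Nᵀ≋𝟘 t
      E⋆Nᵀ-bounded zero t le with ≤-trans (size-pos t) le
      ... | ()
      E⋆Nᵀ-bounded (suc k) (B₊ []) _ = E⋆Nᵀ-•
      E⋆Nᵀ-bounded (suc k) (B₊ (t' ∷ ts')) (s≤s le) = E⋆Nᵀ-B₊ t' ts' (E⋆N-bounded k (t' ∷ ts') le)

      E⋆N-bounded : ∀ k x → sizeF x ≤ℕ k → E⋆N≋εu x
      E⋆N-bounded k [] _ = E⋆N-[]
      E⋆N-bounded k (t ∷ ts) le = E⋆N-∷ t ts (λ s' le' → E⋆Nᵀ-bounded k s' (≤-trans le' (≤-trans (NP.m≤m+n (size t) (sizeF ts)) le)))
                                          (E⋆N-bounded k ts (≤-trans (NP.m≤n+m (sizeF ts) (size t)) le))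

    E⋆N : ∀ x → E⋆N≋εu x
    E⋆N x = E⋆N-bounded (sizeF x) x NP.≤-refl

    Kern : Forest → Forest → P
    Kern x y = sumΔ x (λ a b → F a (N y) ⊛ N b)

    Kern-expand : ∀ x y → Kern x y ≋ ν y ⊛ (zP ⊛ N x ⊖ ε x · u) ⊕ ε y · N x
    Kern-expand x y = begin
        sumΔ x (λ a b → F a (N y) ⊛ N b) ≈⟨ sumΔ-cong x (λ a b → ≋-trans (⊛-congˡ (N b) (≋-trans (hom-⊕ (F-linear a) (ν y ⊛ v) (ε y · 𝟙))
              (⊕-cong (≋-trans (F-zMonomial-⊛ a (IsZMonomial-ν y) v) (⊛-congʳ (ν y) (F-v a))) (≋-trans (hom-· (F-linear a) (ε y) 𝟙) (·-cong (ε y) (F-𝟙 a))))))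
              (≋-trans (⊛-⊕ˡ (ν y ⊛ (ε a · zP ⊖ E a)) (ε y · (ε a · 𝟙)) (N b))
              (⊕-cong (≋-trans (⊛-assoc (ν y) (ε a · zP ⊖ E a) (N b)) (⊛-congʳ (ν y) (≋-trans (⊛-⊖ˡ (ε a · zP) (E a) (N b)) (⊖-cong (⊛-·ˡ (ε a) zP (N b)) ≋-refl))))
                      (≋-trans (⊛-·ˡ (ε y) (ε a · 𝟙) (N b)) (·-cong (ε y) (≋-trans (⊛-·ˡ (ε a) 𝟙 (N b)) (·-cong (ε a) (⊛-identityˡ (N b))))))))) ⟩
        sumΔ x (λ a b → ν y ⊛ (ε a · (zP ⊛ N b) ⊖ E a ⊛ N b) ⊕ ε y · (ε a · N b)) ≈⟨ sumL-⊕ (ΔF x) _ _ ⟩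
        sumΔ x (λ a b → ν y ⊛ (ε a · (zP ⊛ N b) ⊖ E a ⊛ N b)) ⊕ sumΔ x (λ a b → ε y · (ε a · N b)) ≈⟨ ⊕-cong
              (≋-trans (≋-sym (⊛-sumLʳ (ΔF x) (λ ab → ε (proj₁ ab) · (zP ⊛ N (proj₂ ab)) ⊖ E (proj₁ ab) ⊛ N (proj₂ ab)) (ν y)))
                (⊛-congʳ (ν y) (≋-trans (sumL-⊕ (ΔF x) _ _) (⊕-cong (sumΔ-counitˡ x (λ a b → zP ⊛ N b))
                   (≋-trans (sumL-· (ΔF x) (- 1ℚ) (λ ab → E (proj₁ ab) ⊛ N (proj₂ ab))) (⊝-cong (E⋆N x)))))))
              (≋-trans (sumL-· (ΔF x) (ε y) (λ ab → ε (proj₁ ab) · N (proj₂ ab))) (·-cong (ε y) (sumΔ-counitˡ x (λ a b → N b)))) ⟩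
        ν y ⊛ (zP ⊛ N x ⊖ ε x · u) ⊕ ε y · N x ∎

    KernNF : Forest → Forest → P
    KernNF x y = (ν y ⊛ (zP ⊛ (ν x ⊛ v)) ⊕ ε x · (ν y ⊛ v)) ⊕ (ε y · (ν x ⊛ v) ⊕ ε y · (ε x · 𝟙))

    Kern≋KernNF : ∀ x y → Kern x y ≋ KernNF x y
    Kern≋KernNF x y = ≋-trans (Kern-expand x y) (⊕-cong inner (·-⊕ (ε y) (ν x ⊛ v) (ε x · 𝟙)))
      where
      inner : ν y ⊛ (zP ⊛ N x ⊖ ε x · u) ≋ ν y ⊛ (zP ⊛ (ν x ⊛ v)) ⊕ ε x · (ν y ⊛ v)
      inner = ≋-trans (⊛-congʳ (ν y) mid) (≋-trans (⊛-⊕ʳ (ν y) (zP ⊛ (ν x ⊛ v)) (ε x · v)) (⊕-congʳ (ν y ⊛ (zP ⊛ (ν x ⊛ v))) (⊛-·ʳ (ε x) (ν y) v)))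
        where
        mid : zP ⊛ N x ⊖ ε x · u ≋ zP ⊛ (ν x ⊛ v) ⊕ ε x · v
        mid = pair≡⇒≋ midΣ
          where
          midΣ : ∀ g → pair (zP ⊛ N x ⊖ ε x · u) g ≡ pair (zP ⊛ (ν x ⊛ v) ⊕ ε x · v) g
          midΣ g = trans (trans (pair-⊖ (zP ⊛ N x) (ε x · u) g) (cong₂ (λ a b → a +ℚ (- 1ℚ) *ℚ b)
                 (trans (≋⇒pair≡ (⊛-⊕ʳ zP (ν x ⊛ v) (ε x · 𝟙)) g) (trans (pair-++ (zP ⊛ (ν x ⊛ v)) (zP ⊛ (ε x · 𝟙)) g)
                   (cong (pair (zP ⊛ (ν x ⊛ v)) g +ℚ_) (trans (≋⇒pair≡ (≋-trans (⊛-·ʳ (ε x) zP 𝟙) (·-cong (ε x) (⊛-identityʳ zP))) g) (pair-· (ε x) zP g)))))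
                 (pair-· (ε x) u g)))
            (trans (solve 4 (λ a e z w → (a :+ e :* z) :+ con (- 1ℚ) :* (e :* w) := a :+ e :* (z :+ con (- 1ℚ) :* w)) refl
                      (pair (zP ⊛ (ν x ⊛ v)) g) (ε x) (pair zP g) (pair u g))
            (sym (trans (pair-++ (zP ⊛ (ν x ⊛ v)) (ε x · v) g) (cong (pair (zP ⊛ (ν x ⊛ v)) g +ℚ_) (trans (pair-· (ε x) v g) (cong (ε x *ℚ_) (pair-⊖ zP u g)))))))

    KernNF-sym : ∀ x y → KernNF x y ≋ KernNF y x
    KernNF-sym x y = pair≡⇒≋ λ g → trans (e1 g) (trans (cong (λ a → (a +ℚ ε x *ℚ pair (ν y ⊛ v) g) +ℚ (ε y *ℚ pair (ν x ⊛ v) g +ℚ ε y *ℚ (ε x *ℚ pair 𝟙 g)))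
        (≋⇒pair≡ Asym g))
        (trans (solve 6 (λ a b1 b2 o ex ey → (a :+ ex :* b1) :+ (ey :* b2 :+ ey :* (ex :* o))
                                                           := (a :+ ey :* b2) :+ (ex :* b1 :+ ex :* (ey :* o))) refl
        (pair (ν x ⊛ (zP ⊛ (ν y ⊛ v))) g) (pair (ν y ⊛ v) g) (pair (ν x ⊛ v) g) (pair 𝟙 g) (ε x) (ε y))
        (sym (e2 g))))
      where
      Asym : ν y ⊛ (zP ⊛ (ν x ⊛ v)) ≋ ν x ⊛ (zP ⊛ (ν y ⊛ v))
      Asym = ≋-trans (⊛-congʳ (ν y) (≋-sym (⊛-assoc zP (ν x) v))) (≋-trans (≋-sym (⊛-assoc (ν y) (zP ⊛ ν x) v))
        (≋-trans (⊛-congˡ v (zMonomial-swap (IsZMonomial-ν y) (IsZMonomial-ν x))) (≋-trans (⊛-assoc (ν x) (zP ⊛ ν y) v) (⊛-congʳ (ν x) (⊛-assoc zP (ν y) v)))))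
      eg : ∀ x y g → pair (KernNF x y) g ≡ (pair (ν y ⊛ (zP ⊛ (ν x ⊛ v))) g +ℚ ε x *ℚ pair (ν y ⊛ v) g) +ℚ (ε y *ℚ pair (ν x ⊛ v) g +ℚ ε y *ℚ (ε x *ℚ pair 𝟙 g))
      eg x y g = trans (pair-++ (ν y ⊛ (zP ⊛ (ν x ⊛ v)) ⊕ ε x · (ν y ⊛ v)) (ε y · (ν x ⊛ v) ⊕ ε y · (ε x · 𝟙)) g)
        (cong₂ _+ℚ_ (trans (pair-++ (ν y ⊛ (zP ⊛ (ν x ⊛ v))) (ε x · (ν y ⊛ v)) g) (cong (pair (ν y ⊛ (zP ⊛ (ν x ⊛ v))) g +ℚ_) (pair-· (ε x) (ν y ⊛ v) g)))
              (trans (pair-++ (ε y · (ν x ⊛ v)) (ε y · (ε x · 𝟙)) g) (cong₂ _+ℚ_ (pair-· (ε y) (ν x ⊛ v) g)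
                 (trans (pair-· (ε y) (ε x · 𝟙) g) (cong (ε y *ℚ_) (pair-· (ε x) 𝟙 g))))))
      e1 : ∀ g → pair (KernNF x y) g ≡ (pair (ν y ⊛ (zP ⊛ (ν x ⊛ v))) g +ℚ ε x *ℚ pair (ν y ⊛ v) g) +ℚ (ε y *ℚ pair (ν x ⊛ v) g +ℚ ε y *ℚ (ε x *ℚ pair 𝟙 g))
      e1 = eg x y
      e2 : ∀ g → pair (KernNF y x) g ≡ (pair (ν x ⊛ (zP ⊛ (ν y ⊛ v))) g +ℚ ε y *ℚ pair (ν x ⊛ v) g) +ℚ (ε x *ℚ pair (ν y ⊛ v) g +ℚ ε x *ℚ (ε y *ℚ pair 𝟙 g))
      e2 = eg y x

    Kern-[] : Kern [] [] ≋ 𝟙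
    Kern-[] = ≋-trans (sumΔ-[] (λ a b → F a (N []) ⊛ N b)) (≋-trans (⊛-cong (≋-trans (F-[] (N [])) N-[]) N-[]) (⊛-identityʳ 𝟙))

    Kern-sym : ∀ x y → Kern x y ≋ Kern y x
    Kern-sym x y = ≋-trans (Kern≋KernNF x y) (≋-trans (KernNF-sym x y) (≋-sym (Kern≋KernNF y x)))

    sumΔ²-FF⊛Kern : ∀ g h → sumΔ g (λ g1 g2 → sumΔ h (λ h1 h2 → F g1 (F h1 u) ⊛ Kern g2 h2)) ≋ ε h · (ε g · u)
    sumΔ²-FF⊛Kern g h = begin
        sumΔ g (λ g1 g2 → sumΔ h (λ h1 h2 → F g1 (F h1 u) ⊛ Kern g2 h2)) ≈⟨ sumΔ-swap g h (λ g1 g2 h1 h2 → F g1 (F h1 u) ⊛ Kern g2 h2) ⟩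
        sumΔ h (λ h1 h2 → sumΔ g (λ g1 g2 → F g1 (E h1) ⊛ Kern g2 h2)) ≈⟨ sumΔ-cong h (λ h1 h2 → sumΔ-cong g (λ g1 g2 →
              ≋-trans (⊛-sumLʳ (ΔF g2) (λ bb → F (proj₁ bb) (N h2) ⊛ N (proj₂ bb)) (F g1 (E h1)))
                (sumΔ-cong g2 (λ b1 b2 → ≋-sym (⊛-assoc (F g1 (E h1)) (F b1 (N h2)) (N b2)))))) ⟩
        sumΔ h (λ h1 h2 → sumΔ g (λ g1 g2 → sumΔ g2 (λ b1 b2 → (F g1 (E h1) ⊛ F b1 (N h2)) ⊛ N b2))) ≈⟨ sumΔ-cong h
            (λ h1 h2 → ≋-sym (sumΔ-coassoc g (λ a1 a2 b → (F a1 (E h1) ⊛ F a2 (N h2)) ⊛ N b))) ⟩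
        sumΔ h (λ h1 h2 → sumΔ g (λ m g3 → sumΔ m (λ m1 m2 → (F m1 (E h1) ⊛ F m2 (N h2)) ⊛ N g3))) ≈⟨ sumΔ-cong h (λ h1 h2 → sumΔ-cong g (λ m g3 →
              ≋-trans (≋-sym (⊛-sumLˡ (ΔF m) (λ mm → F (proj₁ mm) (E h1) ⊛ F (proj₂ mm) (N h2)) (N g3))) (⊛-congˡ (N g3) (≋-sym (F-⊛ m (E h1) (N h2)))))) ⟩
        sumΔ h (λ h1 h2 → sumΔ g (λ m g3 → F m (E h1 ⊛ N h2) ⊛ N g3)) ≈⟨ sumΔ-swap h g (λ h1 h2 m g3 → F m (E h1 ⊛ N h2) ⊛ N g3) ⟩
        sumΔ g (λ m g3 → sumΔ h (λ h1 h2 → F m (E h1 ⊛ N h2) ⊛ N g3)) ≈⟨ sumΔ-cong g (λ m g3 → ≋-trans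
            (≋-sym (⊛-sumLˡ (ΔF h) (λ hh → F m (E (proj₁ hh) ⊛ N (proj₂ hh))) (N g3)))
              (⊛-congˡ (N g3) (≋-trans (≋-sym (hom-sumΔ (F-linear m) h (λ h1 h2 → E h1 ⊛ N h2))) (≋-trans (F-cong m (E⋆N h)) (hom-· (F-linear m) (ε h) u))))) ⟩
        sumΔ g (λ m g3 → (ε h · E m) ⊛ N g3) ≈⟨ sumΔ-cong g (λ m g3 → ⊛-·ˡ (ε h) (E m) (N g3)) ⟩
        sumΔ g (λ m g3 → ε h · (E m ⊛ N g3)) ≈⟨ sumL-· (ΔF g) (ε h) (λ mm → E (proj₁ mm) ⊛ N (proj₂ mm)) ⟩
        ε h · sumΔ g (λ m g3 → E m ⊛ N g3) ≈⟨ ·-cong (ε h) (E⋆N g) ⟩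
        ε h · (ε g · u) ∎

  -- Commutativity of rooted tree maps

  Commute : Forest → Forest → Set
  Commute g h = ∀ p → F g (F h p) ≋ F h (F g p)

  -- Kern g h is symmetric, and summing g̃′h̃′(u) ⊛ Kern g″ h″ over Δg, Δh gives ε(g) ε(h) u. Comparing
  -- the two orders of g and h, all terms vanish by induction except g̃h̃(u) − h̃g̃(u) itself.
  F-comm-zδ : ∀ s g h → (∀ g' h' → sizeF g' +ℕ sizeF h' <ℕ sizeF g +ℕ sizeF h → Commute g' h') → F g (F h (zδ s)) ≋ F h (F g (zδ s))
  F-comm-zδ s g h IH = ⊖≋𝟘⇒≋ Dgh
    where
    open AtGenerator s
    D : Forest → Forest → P
    D g1 h1 = F g1 (F h1 u) ⊖ F h1 (F g1 u)
    T : Forest → Forest → Forest → Forest → P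
    T g1 g2 h1 h2 = D g1 h1 ⊛ Kern g2 h2
    Sum0 : sumΔ g (λ g1 g2 → sumΔ h (λ h1 h2 → T g1 g2 h1 h2)) ≋ 𝟘
    Sum0 = begin
        sumΔ g (λ g1 g2 → sumΔ h (λ h1 h2 → T g1 g2 h1 h2)) ≈⟨ sumΔ-cong g (λ g1 g2 → ≋-trans (sumΔ-cong h (λ h1 h2 → ⊛-⊖ˡ (F g1 (F h1 u)) (F h1 (F g1 u)) (Kern g2 h2)))
              (sumL-⊖ (ΔF h) (λ hh → F g1 (F (proj₁ hh) u) ⊛ Kern g2 (proj₂ hh)) (λ hh → F (proj₁ hh) (F g1 u) ⊛ Kern g2 (proj₂ hh)))) ⟩
        sumΔ g (λ g1 g2 → sumΔ h (λ h1 h2 → F g1 (F h1 u) ⊛ Kern g2 h2) ⊖ sumΔ h (λ h1 h2 → F h1 (F g1 u) ⊛ Kern g2 h2)) ≈⟨ sumL-⊖ (ΔF g) _ _ ⟩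
        sumΔ g (λ g1 g2 → sumΔ h (λ h1 h2 → F g1 (F h1 u) ⊛ Kern g2 h2)) ⊖ sumΔ g (λ g1 g2 → sumΔ h (λ h1 h2 → F h1 (F g1 u) ⊛ Kern g2 h2)) ≈⟨ ⊖-cong (sumΔ²-FF⊛Kern g h)
              (≋-trans (sumΔ-swap g h (λ g1 g2 h1 h2 → F h1 (F g1 u) ⊛ Kern g2 h2))
                (≋-trans (sumΔ-cong h (λ h1 h2 → sumΔ-cong g (λ g1 g2 → ⊛-congʳ (F h1 (F g1 u)) (Kern-sym g2 h2)))) (sumΔ²-FF⊛Kern h g))) ⟩
        ε h · (ε g · u) ⊖ ε g · (ε h · u) ≈⟨ ≋⇒⊖≋𝟘 (≋-trans (·-assoc (ε h) (ε g) u) (≋-trans (≡→≋ (cong (_· u) (QP.*-comm (ε h) (ε g))))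
            (≋-sym (·-assoc (ε g) (ε h) u)))) ⟩
        𝟘 ∎
    Dz : ∀ g1 h1 → sizeF g1 +ℕ sizeF h1 <ℕ sizeF g +ℕ sizeF h → D g1 h1 ≋ 𝟘
    Dz g1 h1 lt = ≋⇒⊖≋𝟘 (IH g1 h1 lt u)
    Sum-iso : sumΔ g (λ g1 g2 → sumΔ h (λ h1 h2 → T g1 g2 h1 h2)) ≋ D g h ⊛ Kern [] []
    Sum-iso = ≋-trans (sumΔ-isolateˡ g (λ g1 g2 → sumΔ h (λ h1 h2 → T g1 g2 h1 h2))
        (λ g1 g2 lt → sumL-𝟘-All (ΔF h) _ (All.map (λ {hh} A →
          ≋-trans (⊛-congˡ (Kern g2 (proj₂ hh)) (Dz g1 (proj₁ hh) (NP.+-mono-<-≤ lt (IsΔTerm-left-≤ h (proj₁ hh) (proj₂ hh) A)))) ≋-refl) (all-IsΔTerm h))))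
      (sumΔ-isolateˡ h (λ h1 h2 → T g [] h1 h2) (λ h1 h2 lt → ≋-trans (⊛-congˡ (Kern [] h2) (Dz g h1 (NP.+-monoʳ-< (sizeF g) lt))) ≋-refl))
    Dgh : D g h ≋ 𝟘
    Dgh = ≋-trans (≋-sym (⊛-identityʳ (D g h))) (≋-trans (⊛-congʳ (D g h) (≋-sym Kern-[])) (≋-trans (≋-sym Sum-iso) Sum0))

  CommuteBelow : Forest → Forest → Set
  CommuteBelow g h = ∀ g' h' → sizeF g' +ℕ sizeF h' <ℕ sizeF g +ℕ sizeF h → Commute g' h'

  commute-leftΔ : ∀ g h W → CommuteBelow g h → F g (F h W) ≋ F h (F g W) → ∀ g1 g2 h1 h2 → IsΔTerm g (g1 , g2) → IsΔTerm h (h1 , h2) → F g1 (F h1 W) ≋ F h1 (F g1 W)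
  commute-leftΔ g h W IH IHw g1 g2 h1 h2 A B with IsΔTerm-left g g1 g2 A | IsΔTerm-left h h1 h2 B
  ... | inj₁ (refl , _) | inj₁ (refl , _) = IHw
  ... | inj₂ lt | _ = IH g1 h1 (NP.+-mono-<-≤ lt (IsΔTerm-left-≤ h h1 h2 B)) W
  ... | inj₁ _ | inj₂ lt = IH g1 h1 (NP.+-mono-≤-< (IsΔTerm-left-≤ g g1 g2 A) lt) W

  commute-rightΔ : ∀ g h W → CommuteBelow g h → F g (F h W) ≋ F h (F g W) → ∀ g1 g2 h1 h2 → IsΔTerm g (g1 , g2) → IsΔTerm h (h1 , h2) → F g2 (F h2 W) ≋ F h2 (F g2 W)
  commute-rightΔ g h W IH IHw g1 g2 h1 h2 A B with IsΔTerm-right g g1 g2 A | IsΔTerm-right h h1 h2 B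
  ... | inj₁ (refl , _) | inj₁ (refl , _) = IHw
  ... | inj₂ lt | _ = IH g2 h2 (NP.+-mono-<-≤ lt (IsΔTerm-right-≤ h h1 h2 B)) W
  ... | inj₁ _ | inj₂ lt = IH g2 h2 (NP.+-mono-≤-< (IsΔTerm-right-≤ g g1 g2 A) lt) W

  F-comm-eigen : ∀ g h (q : P) → (∀ f → F f q ≋ ε f · q) → F g (F h q) ≋ F h (F g q)
  F-comm-eigen g h q e = ≋-trans (F-cong g (e h)) (≋-trans (hom-· (F-linear g) (ε h) q) (≋-trans (·-cong (ε h) (e g))
    (≋-trans (·-assoc (ε h) (ε g) q) (≋-trans (≡→≋ (cong (_· q) (QP.*-comm (ε h) (ε g)))) (≋-trans (≋-sym (·-assoc (ε g) (ε h) q))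
    (≋-sym (≋-trans (F-cong h (e g)) (≋-trans (hom-· (F-linear h) (ε g) q) (·-cong (ε g) (e h))))))))))

  F-comm-step : ∀ g h → CommuteBelow g h → Commute g h
  F-comm-step g h IH = linear-unique (linear-∘ (F-linear g) (F-linear h)) (linear-∘ (F-linear h) (F-linear g))
      (snoc-ind (λ w → F g (F h (mono w)) ≋ F h (F g (mono w))) (F-comm-eigen g h 𝟙 F-𝟙) step)
    where
    Gcase : ∀ u → Gen u → F g (F h u) ≋ F h (F g u)
    Gcase .zP gen-z = F-comm-eigen g h zP F-z
    Gcase .(zδ s) (gen-zδ s) = F-comm-zδ s g h IH
    step : ∀ w l → F g (F h (mono w)) ≋ F h (F g (mono w)) → F g (F h (mono (w ++ (l ∷ [])))) ≋ F h (F g (mono (w ++ (l ∷ []))))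
    step w l IHw = begin
        F g (F h (mono (w ++ (l ∷ [])))) ≈⟨ F-cong g (F-cong h (mono-∷ʳ w l)) ⟩
        F g (F h (W ⊛ ℓ)) ≈⟨ F-cong g (F-⊛ h W ℓ) ⟩
        F g (sumΔ h (λ h1 h2 → F h1 W ⊛ F h2 ℓ)) ≈⟨ hom-sumΔ (F-linear g) h (λ h1 h2 → F h1 W ⊛ F h2 ℓ) ⟩
        sumΔ h (λ h1 h2 → F g (F h1 W ⊛ F h2 ℓ)) ≈⟨ sumΔ-cong h (λ h1 h2 → F-⊛ g (F h1 W) (F h2 ℓ)) ⟩
        sumΔ h (λ h1 h2 → sumΔ g (λ g1 g2 → F g1 (F h1 W) ⊛ F g2 (F h2 ℓ))) ≈⟨ sumL-cong-All (ΔF h) (All.map (λ {hh} B →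
              sumL-cong-All (ΔF g) (All.map (λ {gg} A →
                ⊛-cong (commute-leftΔ g h W IH IHw (proj₁ gg) (proj₂ gg) (proj₁ hh) (proj₂ hh) A B)
                       (commute-rightΔ g h ℓ IH (agree-on-letters (linear-∘ (F-linear g) (F-linear h)) (linear-∘ (F-linear h) (F-linear g)) Gcase l) (proj₁ gg)
                           (proj₂ gg) (proj₁ hh) (proj₂ hh) A B)) (all-IsΔTerm g))) (all-IsΔTerm h)) ⟩
        sumΔ h (λ h1 h2 → sumΔ g (λ g1 g2 → F h1 (F g1 W) ⊛ F h2 (F g2 ℓ))) ≈⟨ sumΔ-swap h g (λ h1 h2 g1 g2 → F h1 (F g1 W) ⊛ F h2 (F g2 ℓ)) ⟩
        sumΔ g (λ g1 g2 → sumΔ h (λ h1 h2 → F h1 (F g1 W) ⊛ F h2 (F g2 ℓ))) ≈⟨ sumΔ-cong g (λ g1 g2 → ≋-sym (F-⊛ h (F g1 W) (F g2 ℓ))) ⟩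
        sumΔ g (λ g1 g2 → F h (F g1 W ⊛ F g2 ℓ)) ≈⟨ ≋-sym (hom-sumΔ (F-linear h) g (λ g1 g2 → F g1 W ⊛ F g2 ℓ)) ⟩
        F h (sumΔ g (λ g1 g2 → F g1 W ⊛ F g2 ℓ)) ≈⟨ F-cong h (≋-sym (F-⊛ g W ℓ)) ⟩
        F h (F g (W ⊛ ℓ)) ≈⟨ F-cong h (F-cong g (≋-sym (mono-∷ʳ w l))) ⟩
        F h (F g (mono (w ++ (l ∷ [])))) ∎
      where W = mono w
            ℓ = mono (l ∷ [])

  F-comm-bounded : ∀ k g h → sizeF g +ℕ sizeF h ≤ℕ k → Commute g h
  F-comm-bounded zero g h le = F-comm-step g h (λ g' h' lt → ⊥-elim (NP.n≮0 (NP.<-≤-trans lt le)))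
  F-comm-bounded (suc k) g h le = F-comm-step g h (λ g' h' lt → F-comm-bounded k g' h' (NP.≤-pred (NP.<-≤-trans lt le)))

  F-comm : ∀ g h → Commute g h
  F-comm g h = F-comm-bounded (sizeF g +ℕ sizeF h) g h NP.≤-refl

  -- The antipode law

  τ-linear : IsLinear {suc n} τ
  τ-linear = record { resp≋ = τ-cong ; hom-⊕ = τ-⊕ ; hom-· = τ-· }

  K : Forest → P → P
  K x p = sumΔ x (λ a b → F a (τ (F b p)))

  K-linear : ∀ x → IsLinear (K x)
  K-linear x = linear-sumΔ x (λ a b → linear-∘ (F-linear a) (linear-∘ τ-linear (F-linear b)))

  AntipodeLaw : Forest → Set
  AntipodeLaw x = ∀ p → S̃ x p ≋ τ (F x (τ p))

  KLaw : Forest → Set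
  KLaw x = ∀ p → K x p ≋ ε x · τ p

  AntipodeLaw⇒KLaw : ∀ x → All (λ ab → AntipodeLaw (proj₁ ab)) (ΔF x) → KLaw x
  AntipodeLaw⇒KLaw x th p = begin
      sumΔ x (λ a b → F a (τ (F b p))) ≈⟨ sumL-cong-All (ΔF x) (All.map (λ {ab} t →
            ≋-trans (≋-sym (τ-involutive (F (proj₁ ab) (τ (F (proj₂ ab) p))))) (τ-cong (≋-sym (t (F (proj₂ ab) p))))) th) ⟩
      sumΔ x (λ a b → τ (S̃ a (F b p))) ≈⟨ ≋-sym (hom-sumΔ τ-linear x (λ a b → S̃ a (F b p))) ⟩
      τ (sumΔ x (λ a b → S̃ a (F b p))) ≈⟨ τ-cong (S̃⋆F̃≋ε x p) ⟩
      τ (ε x · p) ≈⟨ τ-· (ε x) p ⟩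
      ε x · τ p ∎

  KLaw⇒AntipodeLaw : ∀ x → All (λ ab → KLaw (proj₂ ab)) (ΔF x) → AntipodeLaw x
  KLaw⇒AntipodeLaw x ks p = begin
      S̃ x p ≈⟨ ≋-sym (sumΔ-counitʳ x (λ a b → S̃ a p)) ⟩
      sumΔ x (λ a b → ε b · S̃ a p) ≈⟨ sumL-cong-All (ΔF x) (All.map (λ {ab} k →
            ≋-trans (≋-sym (hom-· (S̃-linear (proj₁ ab)) (ε (proj₂ ab)) p)) (resp≋ (S̃-linear (proj₁ ab))
              (≋-sym (≋-trans (k (τ p)) (·-cong (ε (proj₂ ab)) (τ-involutive p)))))) ks) ⟩
      sumΔ x (λ a b → S̃ a (K b (τ p))) ≈⟨ sumΔ-cong x (λ a b → hom-sumΔ (S̃-linear a) b (λ b1 b2 → F b1 (τ (F b2 (τ p))))) ⟩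
      sumΔ x (λ a b → sumΔ b (λ b1 b2 → S̃ a (F b1 (τ (F b2 (τ p)))))) ≈⟨ ≋-sym (sumΔ-coassoc x (λ a1 a2 b → S̃ a1 (F a2 (τ (F b (τ p)))))) ⟩
      sumΔ x (λ c d → sumΔ c (λ c1 c2 → S̃ c1 (F c2 (τ (F d (τ p)))))) ≈⟨ sumΔ-cong x (λ c d → S̃⋆F̃≋ε c (τ (F d (τ p)))) ⟩
      sumΔ x (λ c d → ε c · τ (F d (τ p))) ≈⟨ sumΔ-counitˡ x (λ c d → τ (F d (τ p))) ⟩
      τ (F x (τ p)) ∎

  AntipodeLaw-[] : AntipodeLaw []
  AntipodeLaw-[] p = ≋-trans (S̃-[] p) (≋-sym (≋-trans (τ-cong (F-[] (τ p))) (τ-involutive p)))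

  AntipodeLaw-∷ : ∀ t ts → AntipodeLaw (t ∷ []) → AntipodeLaw ts → AntipodeLaw (t ∷ ts)
  AntipodeLaw-∷ t ts th1 th2 p = begin
      S̃ (t ∷ ts) p ≈⟨ S̃-∷ t ts p ⟩
      S̃ ts (S̃ᵀ t p) ≈⟨ resp≋ (S̃-linear ts) (≋-trans (≋-sym (S̃-single t p)) (th1 p)) ⟩
      S̃ ts (τ (F (t ∷ []) (τ p))) ≈⟨ th2 _ ⟩
      τ (F ts (τ (τ (F (t ∷ []) (τ p))))) ≈⟨ τ-cong (F-cong ts (τ-involutive _)) ⟩
      τ (F ts (F (t ∷ []) (τ p))) ≈⟨ τ-cong (F-comm ts (t ∷ []) (τ p)) ⟩
      τ (F (t ∷ []) (F ts (τ p))) ≈⟨ τ-cong (≋-sym (F-++ (t ∷ []) ts (τ p))) ⟩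
      τ (F (t ∷ ts) (τ p)) ∎

  K-eigen : ∀ x q → (∀ f → F f q ≋ ε f · q) → τ q ≋ q → K x q ≋ ε x · τ q
  K-eigen x q e tq = begin
      sumΔ x (λ a b → F a (τ (F b q))) ≈⟨ sumΔ-cong x (λ a b → ≋-trans (F-cong a (≋-trans (τ-cong (e b)) (τ-· (ε b) q))) (hom-· (F-linear a) (ε b) (τ q))) ⟩
      sumΔ x (λ a b → ε b · F a (τ q)) ≈⟨ sumΔ-counitʳ x (λ a b → F a (τ q)) ⟩
      F x (τ q) ≈⟨ F-cong x tq ⟩
      F x q ≈⟨ e x ⟩
      ε x · q ≈⟨ ·-cong (ε x) (≋-sym tq) ⟩
      ε x · τ q ∎

  K-𝟙 : ∀ x → K x 𝟙 ≋ ε x · τ 𝟙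
  K-𝟙 x = K-eigen x 𝟙 F-𝟙 τ-𝟙

  K-z : ∀ x → K x zP ≋ ε x · τ zP
  K-z x = K-eigen x zP F-z τ-z

  K-⊛ : ∀ x W q → (∀ C B2 A1 D → IsΔTerm x (C , B2) → IsΔTerm C (A1 , D) → K D W ≋ ε D · τ W) → K x (W ⊛ q) ≋ K x q ⊛ τ W
  K-⊛ x W q hyp = begin
      sumΔ x (λ A B → F A (τ (F B (W ⊛ q)))) ≈⟨ sumΔ-cong x (λ A B → ≋-trans (F-cong A (≋-trans (τ-cong (F-⊛ B W q)) (hom-sumΔ τ-linear B (λ B1 B2 → F B1 W ⊛ F B2 q))))
            (≋-trans (hom-sumΔ (F-linear A) B (λ B1 B2 → τ (F B1 W ⊛ F B2 q))) (sumΔ-cong B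
                (λ B1 B2 → ≋-trans (F-cong A (τ-⊛ (F B1 W) (F B2 q))) (F-⊛ A (τ (F B2 q)) (τ (F B1 W))))))) ⟩
      sumΔ x (λ A B → sumΔ B (λ B1 B2 → sumΔ A (λ A1 A2 → F A1 (τ (F B2 q)) ⊛ F A2 (τ (F B1 W))))) ≈⟨ ≋-sym
          (sumΔ-coassoc x (λ A B1 B2 → sumΔ A (λ A1 A2 → F A1 (τ (F B2 q)) ⊛ F A2 (τ (F B1 W))))) ⟩
      sumΔ x (λ C B2 → sumΔ C (λ A B1 → sumΔ A (λ A1 A2 → F A1 (τ (F B2 q)) ⊛ F A2 (τ (F B1 W))))) ≈⟨ sumΔ-cong x
          (λ C B2 → sumΔ-coassoc C (λ A1 A2 B1 → F A1 (τ (F B2 q)) ⊛ F A2 (τ (F B1 W)))) ⟩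
      sumΔ x (λ C B2 → sumΔ C (λ A1 D → sumΔ D (λ A2 B1 → F A1 (τ (F B2 q)) ⊛ F A2 (τ (F B1 W))))) ≈⟨ sumΔ-cong x
          (λ C B2 → sumΔ-cong C (λ A1 D → ≋-sym (⊛-sumLʳ (ΔF D) (λ ab → F (proj₁ ab) (τ (F (proj₂ ab) W))) (F A1 (τ (F B2 q)))))) ⟩
      sumΔ x (λ C B2 → sumΔ C (λ A1 D → F A1 (τ (F B2 q)) ⊛ K D W)) ≈⟨ sumL-cong-All (ΔF x) (All.map (λ {cb} Ax → sumL-cong-All (ΔF (proj₁ cb)) (All.map (λ {ad} Ac →
            ≋-trans (⊛-congʳ (F (proj₁ ad) (τ (F (proj₂ cb) q))) (hyp (proj₁ cb) (proj₂ cb) (proj₁ ad) (proj₂ ad) Ax Ac))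
                (⊛-·ʳ (ε (proj₂ ad)) (F (proj₁ ad) (τ (F (proj₂ cb) q))) (τ W))) (all-IsΔTerm (proj₁ cb)))) (all-IsΔTerm x)) ⟩
      sumΔ x (λ C B2 → sumΔ C (λ A1 D → ε D · (F A1 (τ (F B2 q)) ⊛ τ W))) ≈⟨ sumΔ-cong x (λ C B2 → sumΔ-counitʳ C (λ A1 D → F A1 (τ (F B2 q)) ⊛ τ W)) ⟩
      sumΔ x (λ C B2 → F C (τ (F B2 q)) ⊛ τ W) ≈⟨ ≋-sym (⊛-sumLˡ (ΔF x) (λ cb → F (proj₁ cb) (τ (F (proj₂ cb) q))) (τ W)) ⟩
      K x q ⊛ τ W ∎

  module KAtGenerator (s : Fin (suc n)) where
    open AtGenerator s

    τu≋v : τ u ≋ v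
    τu≋v = τ-zδ≋vδ s
    τv≋u : τ v ≋ u
    τv≋u = τ-vδ≋zδ s

    Q : Forest → P
    Q [] = 𝟘
    Q (t' ∷ ts') = τ (qII t' ts')

    τE-∷ : ∀ t' ts' → τ (E (t' ∷ ts')) ≋ u ⊛ Q (t' ∷ ts')
    τE-∷ t' ts' = ≋-trans (τ-cong (≋-sym (qII⊛v t' ts'))) (≋-trans (τ-⊛ (qII t' ts') v) (⊛-congˡ (Q (t' ∷ ts')) τv≋u))

    τE : ∀ b → τ (E b) ≋ u ⊛ Q b ⊕ ε b · v
    τE [] = ≋-trans (τ-cong (F-[] u)) (≋-trans τu≋v (≋-sym (≋-trans (⊕-congˡ (1ℚ · v) (⊛-zeroʳ u)) (·-identityˡ v))))
    τE (t' ∷ ts') = ≋-trans (τE-∷ t' ts') (≋-sym (≋-trans (⊕-congʳ (u ⊛ Q (t' ∷ ts')) (·-zeroˡ v)) (⊕-idʳ _)))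

    τE-B₊ : ∀ b → τ (E (B₊ b ∷ [])) ≋ u ⊛ (zP ⊛ Q b) ⊕ u ⊛ τ (E b)
    τE-B₊ [] = ≋-trans (τ-cong E-•) (≋-trans (τ-⊛ u v) (≋-trans (⊛-cong τv≋u τu≋v) (≋-sym (≋-trans (⊕-cong (≋-trans (⊛-congʳ u (⊛-zeroʳ zP)) (⊛-zeroʳ u))
               (⊛-congʳ u (≋-trans (τ-cong (F-[] u)) τu≋v))) ≋-refl))))
    τE-B₊ (t' ∷ ts') = begin
        τ (E (B₊ b ∷ [])) ≈⟨ τ-cong (E-B₊ t' ts') ⟩
        τ ((q ⊛ (zP ⊕ v)) ⊛ v) ≈⟨ τ-⊛ (q ⊛ (zP ⊕ v)) v ⟩
        τ v ⊛ τ (q ⊛ (zP ⊕ v)) ≈⟨ ⊛-cong τv≋u (τ-⊛ q (zP ⊕ v)) ⟩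
        u ⊛ (τ (zP ⊕ v) ⊛ Q b) ≈⟨ ⊛-congʳ u (⊛-congˡ (Q b) (≋-trans (τ-⊕ zP v) (⊕-cong τ-z τv≋u))) ⟩
        u ⊛ ((zP ⊕ u) ⊛ Q b) ≈⟨ ≋-trans (⊛-congʳ u (⊛-⊕ˡ zP u (Q b))) (⊛-⊕ʳ u (zP ⊛ Q b) (u ⊛ Q b)) ⟩
        u ⊛ (zP ⊛ Q b) ⊕ u ⊛ (u ⊛ Q b) ≈⟨ ⊕-congʳ (u ⊛ (zP ⊛ Q b)) (⊛-congʳ u (≋-sym (τE-∷ t' ts'))) ⟩
        u ⊛ (zP ⊛ Q b) ⊕ u ⊛ τ (E b) ∎
      where b = t' ∷ ts'
            q = qII t' ts'

    M : Forest → P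
    M d = sumΔ d (λ d1 d2 → F d1 (Q d2))

    F-u⊛ : ∀ x (Y : Forest → P) → sumΔ x (λ a b → F a (u ⊛ Y b)) ≋ sumΔ x (λ c d → E c ⊛ sumΔ d (λ d1 d2 → F d1 (Y d2)))
    F-u⊛ x Y = begin
        sumΔ x (λ a b → F a (u ⊛ Y b)) ≈⟨ sumΔ-cong x (λ a b → F-⊛ a u (Y b)) ⟩
        sumΔ x (λ a b → sumΔ a (λ a1 a2 → E a1 ⊛ F a2 (Y b))) ≈⟨ sumΔ-coassoc x (λ a1 a2 b → E a1 ⊛ F a2 (Y b)) ⟩
        sumΔ x (λ c d → sumΔ d (λ d1 d2 → E c ⊛ F d1 (Y d2))) ≈⟨ sumΔ-cong x (λ c d → ≋-sym (⊛-sumLʳ (ΔF d) (λ dd → F (proj₁ dd) (Y (proj₂ dd))) (E c))) ⟩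
        sumΔ x (λ c d → E c ⊛ sumΔ d (λ d1 d2 → F d1 (Y d2))) ∎

    E⋆M : ∀ d → KLaw d → sumΔ d (λ c e → E c ⊛ M e) ≋ E d ⊖ ε d · u
    E⋆M d kd = pair≡⇒≋ λ g → trans (solve 2 (λ S W → S := (S :+ W) :+ con (- 1ℚ) :* W) refl (pair Sm g) (pair W g))
        (trans (cong (_+ℚ (- 1ℚ) *ℚ pair W g) (trans (sym (pair-++ Sm W g)) (≋⇒pair≡ key g)))
        (trans (cong₂ (λ a b → a +ℚ (- 1ℚ) *ℚ b) (trans (pair-· (ε d) v g) (cong (ε d *ℚ_) (pair-⊖ zP u g))) (pair-⊖ (ε d · zP) (E d) g))
        (trans (cong (λ b → ε d *ℚ (pair zP g +ℚ (- 1ℚ) *ℚ pair u g) +ℚ (- 1ℚ) *ℚ (b +ℚ (- 1ℚ) *ℚ pair (E d) g)) (pair-· (ε d) zP g))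
        (trans (solve 4 (λ e Z U Ed → e :* (Z :+ con (- 1ℚ) :* U) :+ con (- 1ℚ) :* (e :* Z :+ con (- 1ℚ) :* Ed) := Ed :+ con (- 1ℚ) :* (e :* U)) refl
                 (ε d) (pair zP g) (pair u g) (pair (E d) g))
        (sym (trans (pair-⊖ (E d) (ε d · u) g) (cong (λ b → pair (E d) g +ℚ (- 1ℚ) *ℚ b) (pair-· (ε d) u g))))))))
      where
      Sm = sumΔ d (λ c e → E c ⊛ M e)
      W = ε d · zP ⊖ E d
      key : Sm ⊕ W ≋ ε d · v
      key = begin
          Sm ⊕ W ≈⟨ ⊕-cong (≋-sym (F-u⊛ d Q)) (≋-sym (≋-trans (sumΔ-counitʳ d (λ a b → F a v)) (F-v d))) ⟩
          sumΔ d (λ a b → F a (u ⊛ Q b)) ⊕ sumΔ d (λ a b → ε b · F a v) ≈⟨ ≋-sym (sumL-⊕ (ΔF d) _ _) ⟩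
          sumΔ d (λ a b → F a (u ⊛ Q b) ⊕ ε b · F a v) ≈⟨ sumΔ-cong d (λ a b → ≋-sym (≋-trans (F-cong a (τE b))
              (≋-trans (hom-⊕ (F-linear a) (u ⊛ Q b) (ε b · v)) (⊕-congʳ (F a (u ⊛ Q b)) (hom-· (F-linear a) (ε b) v))))) ⟩
          K d u ≈⟨ kd u ⟩
          ε d · τ u ≈⟨ ·-cong (ε d) τu≋v ⟩
          ε d · v ∎

    E⋆ε⊖N : ∀ d → sumΔ d (λ c e → E c ⊛ (ε e · 𝟙 ⊖ N e)) ≋ E d ⊖ ε d · u
    E⋆ε⊖N d = ≋-trans (sumΔ-cong d (λ c e → ≋-trans (⊛-⊖ʳ (E c) (ε e · 𝟙) (N e)) (⊖-cong (≋-trans (⊛-·ʳ (ε e) (E c) 𝟙) (·-cong (ε e) (⊛-identityʳ (E c)))) ≋-refl)))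
      (≋-trans (sumL-⊖ (ΔF d) _ _) (⊖-cong (sumΔ-counitʳ d (λ c e → E c)) (E⋆N d)))

    -- The term ([] , d) of Δd contributes u ⊛ X d, and u is not a zero divisor.
    E⋆-injective : (B : ℕ) (X Y : Forest → P) → (∀ d → sizeF d ≤ℕ B → sumΔ d (λ c e → E c ⊛ X e) ≋ sumΔ d (λ c e → E c ⊛ Y e)) →
           ∀ d → sizeF d ≤ℕ B → X d ≋ Y d
    E⋆-injective B X Y h d lb = Uk (sizeF d) d NP.≤-refl lb
      where
      core : ∀ d → sizeF d ≤ℕ B → (∀ e → sizeF e <ℕ sizeF d → X e ≋ Y e) → X d ≋ Y d
      core d lb rec = ⊖≋𝟘⇒≋ (zδ⊛≋𝟘⇒≋𝟘 s (X d ⊖ Y d) (≋-trans (⊛-congˡ (X d ⊖ Y d) (≋-sym (F-[] u)))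
          (≋-trans (≋-sym (sumΔ-isolateʳ d (λ c e → E c ⊛ (X e ⊖ Y e)) zz)) tot)))
        where
        zz : ∀ c e → sizeF e <ℕ sizeF d → E c ⊛ (X e ⊖ Y e) ≋ 𝟘
        zz c e lt = ≋-trans (⊛-congʳ (E c) (≋⇒⊖≋𝟘 (rec e lt))) (⊛-zeroʳ (E c))
        tot : sumΔ d (λ c e → E c ⊛ (X e ⊖ Y e)) ≋ 𝟘
        tot = ≋-trans (sumΔ-cong d (λ c e → ⊛-⊖ʳ (E c) (X e) (Y e))) (≋-trans (sumL-⊖ (ΔF d) _ _) (≋⇒⊖≋𝟘 (h d lb)))
      Uk : ∀ k d → sizeF d ≤ℕ k → sizeF d ≤ℕ B → X d ≋ Y d
      Uk zero d lk lb = core d lb (λ e lt → ⊥-elim (NP.n≮0 (NP.<-≤-trans lt lk)))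
      Uk (suc k') d lk lb = core d lb (λ e lt → Uk k' e (NP.≤-pred (NP.<-≤-trans lt lk)) (≤-trans (NP.<⇒≤ lt) lb))

    M≋ε⊖N : (B : ℕ) → (∀ d → sizeF d ≤ℕ B → KLaw d) → ∀ d → sizeF d ≤ℕ B → M d ≋ ε d · 𝟙 ⊖ N d
    M≋ε⊖N B ks = E⋆-injective B M (λ e → ε e · 𝟙 ⊖ N e) (λ d le → ≋-trans (E⋆M d (ks d le)) (≋-sym (E⋆ε⊖N d)))

    ε⊖N≋⊝νv : ∀ d → ε d · 𝟙 ⊖ N d ≋ ⊝ (ν d ⊛ v)
    ε⊖N≋⊝νv d = pair≡⇒≋ λ g → trans (pair-⊖ (ε d · 𝟙) (N d) g) (trans (cong₂ (λ a b → a +ℚ (- 1ℚ) *ℚ b) (pair-· (ε d) 𝟙 g)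
      (trans (pair-++ (ν d ⊛ v) (ε d · 𝟙) g) (cong (pair (ν d ⊛ v) g +ℚ_) (pair-· (ε d) 𝟙 g))))
      (trans (solve 3 (λ e o w → e :* o :+ con (- 1ℚ) :* (w :+ e :* o) := con (- 1ℚ) :* w) refl (ε d) (pair 𝟙 g) (pair (ν d ⊛ v) g))
        (sym (pair-· (- 1ℚ) (ν d ⊛ v) g))))

    K-tree-u-expand : ∀ f → K (B₊ f ∷ []) u ≋ ⊝ E (B₊ f ∷ []) ⊕ sumΔ f (λ a b → F a (τ (E (B₊ b ∷ []))))
    K-tree-u-expand f = ≋-trans (sumΔ-single t (λ a b → F a (τ (E b)))) (≋-trans (sumΔT-B f (λ a b → F a (τ (E b))))
        (⊕-congˡ (sumΔ f (λ a b → F a (τ (E (B₊ b ∷ []))))) t̃τu))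
      where
      t = B₊ f
      t̃τu : F (t ∷ []) (τ (E [])) ≋ ⊝ E (t ∷ [])
      t̃τu = ≋-trans (F-cong (t ∷ []) (≋-trans (τ-cong (F-[] u)) τu≋v)) (≋-trans (F-v (t ∷ [])) (⊕-congˡ (⊝ E (t ∷ [])) (·-zeroˡ zP)))

    sumΔ-F-u⊛τE : ∀ t' ts' → (∀ y → sizeF y ≤ℕ sizeF (t' ∷ ts') → KLaw y) →
      sumΔ (t' ∷ ts') (λ a b → F a (u ⊛ τ (E b))) ≋ qII t' ts' ⊛ (v ⊛ v)
    sumΔ-F-u⊛τE t' ts' ks = begin
        sumΔ ff (λ a b → F a (u ⊛ τ (E b))) ≈⟨ F-u⊛ ff (λ b → τ (E b)) ⟩
        sumΔ ff (λ c d → E c ⊛ K d u) ≈⟨ sumL-cong-All (ΔF ff) (All.map (λ {cd} Ac →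
              ≋-trans (⊛-congʳ (E (proj₁ cd)) (≋-trans (ks (proj₂ cd) (IsΔTerm-right-≤ ff (proj₁ cd) (proj₂ cd) Ac) u) (·-cong (ε (proj₂ cd)) τu≋v)))
                  (⊛-·ʳ (ε (proj₂ cd)) (E (proj₁ cd)) v)) (all-IsΔTerm ff)) ⟩
        sumΔ ff (λ c d → ε d · (E c ⊛ v)) ≈⟨ sumΔ-counitʳ ff (λ c d → E c ⊛ v) ⟩
        E ff ⊛ v ≈⟨ ⊛-congˡ v (≋-sym (qII⊛v t' ts')) ⟩
        (q ⊛ v) ⊛ v ≈⟨ ⊛-assoc q v v ⟩
        q ⊛ (v ⊛ v) ∎
      where
      ff = t' ∷ ts'
      q = qII t' ts'

    sumΔ-F-u⊛zQ : ∀ t' ts' → (∀ y → sizeF y ≤ℕ sizeF (t' ∷ ts') → KLaw y) →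
      sumΔ (t' ∷ ts') (λ a b → F a (u ⊛ (zP ⊛ Q b))) ≋ qII t' ts' ⊛ (zP ⊛ v)
    sumΔ-F-u⊛zQ t' ts' ks = begin
        sumΔ ff (λ a b → F a (u ⊛ (zP ⊛ Q b))) ≈⟨ F-u⊛ ff (λ b → zP ⊛ Q b) ⟩
        sumΔ ff (λ c d → E c ⊛ sumΔ d (λ d1 d2 → F d1 (zP ⊛ Q d2))) ≈⟨ sumΔ-cong ff (λ c d → ⊛-congʳ (E c)
            (≋-trans (sumΔ-cong d (λ d1 d2 → F-zMonomial-⊛ d1 IsZMonomial-z (Q d2)))
              (≋-sym (⊛-sumLʳ (ΔF d) (λ dd → F (proj₁ dd) (Q (proj₂ dd))) zP)))) ⟩
        sumΔ ff (λ c d → E c ⊛ (zP ⊛ M d)) ≈⟨ sumL-cong-All (ΔF ff) (All.map (λ {cd} Ac →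
              ⊛-congʳ (E (proj₁ cd)) (⊛-congʳ zP (≋-trans (M≋ε⊖N (sizeF ff) ks (proj₂ cd) (IsΔTerm-right-≤ ff (proj₁ cd) (proj₂ cd) Ac)) (ε⊖N≋⊝νv (proj₂ cd)))))
                  (all-IsΔTerm ff)) ⟩
        sumΔ ff (λ c d → E c ⊛ (zP ⊛ ⊝ (ν d ⊛ v))) ≈⟨ sumΔ-cong ff (λ c d → ≋-trans (⊛-congʳ (E c) (≋-trans (⊛-·ʳ (- 1ℚ) zP (ν d ⊛ v))
              (·-cong (- 1ℚ) (≋-trans (≋-sym (⊛-assoc zP (ν d) v)) (≋-trans (⊛-congˡ v (IsZMonomial-comm IsZMonomial-z (IsZMonomial-ν d))) (⊛-assoc (ν d) zP v))))))
              (≋-trans (⊛-·ʳ (- 1ℚ) (E c) (ν d ⊛ (zP ⊛ v))) (⊝-cong (≋-sym (⊛-assoc (E c) (ν d) (zP ⊛ v)))))) ⟩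
        sumΔ ff (λ c d → ⊝ ((E c ⊛ ν d) ⊛ (zP ⊛ v))) ≈⟨ sumL-· (ΔF ff) (- 1ℚ) (λ cd → (E (proj₁ cd) ⊛ ν (proj₂ cd)) ⊛ (zP ⊛ v)) ⟩
        ⊝ sumΔ ff (λ c d → (E c ⊛ ν d) ⊛ (zP ⊛ v)) ≈⟨ ⊝-cong (≋-trans (≋-sym (⊛-sumLˡ (ΔF ff) (λ cd → E (proj₁ cd) ⊛ ν (proj₂ cd)) (zP ⊛ v)))
            (⊛-congˡ (zP ⊛ v) (E⋆ν≋⊝qII t' ts' (E⋆N ff)))) ⟩
        ⊝ ((⊝ q) ⊛ (zP ⊛ v)) ≈⟨ ≋-trans (⊝-cong (⊛-·ˡ (- 1ℚ) q (zP ⊛ v))) (≋-trans (·-assoc (- 1ℚ) (- 1ℚ) A)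
            (≋-trans (≡→≋ (cong (_· A) (solve 0 (con (- 1ℚ) :* con (- 1ℚ) := con 1ℚ) refl))) (·-identityˡ A))) ⟩
        A ∎
      where
      ff = t' ∷ ts'
      q = qII t' ts'
      A = q ⊛ (zP ⊛ v)

    K-tree-u : ∀ f → (∀ y → sizeF y ≤ℕ sizeF f → KLaw y) → K (B₊ f ∷ []) u ≋ 𝟘
    K-tree-u [] ks = ≋-trans (K-tree-u-expand []) (≋-trans (⊕-cong (⊝-cong E-•)
        (≋-trans (sumΔ-[] (λ a b → F a (τ (E (B₊ b ∷ []))))) (≋-trans (F-[] _) (≋-trans (τ-cong E-•) (≋-trans (τ-⊛ u v) (⊛-cong τv≋u τu≋v))))))
        (⊝-inverseˡ (u ⊛ v)))
    K-tree-u (t' ∷ ts') ks = ≋-trans (K-tree-u-expand ff) (≋-trans (⊕-cong (⊝-cong (≋-trans (E-B₊ t' ts') E-B₊-expand))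
        (≋-trans (sumΔ-cong ff (λ a b → ≋-trans (F-cong a (τE-B₊ b)) (hom-⊕ (F-linear a) (u ⊛ (zP ⊛ Q b)) (u ⊛ τ (E b)))))
        (≋-trans (sumL-⊕ (ΔF ff) _ _) (⊕-cong (sumΔ-F-u⊛zQ t' ts' ks) (sumΔ-F-u⊛τE t' ts' ks)))))
        (⊝-inverseˡ (q ⊛ (zP ⊛ v) ⊕ q ⊛ (v ⊛ v))))
      where
      ff = t' ∷ ts'
      q = qII t' ts'
      E-B₊-expand : (q ⊛ (zP ⊕ v)) ⊛ v ≋ q ⊛ (zP ⊛ v) ⊕ q ⊛ (v ⊛ v)
      E-B₊-expand = ≋-trans (⊛-assoc q (zP ⊕ v) v) (≋-trans (⊛-congʳ q (⊛-⊕ˡ zP v v)) (⊛-⊕ʳ q (zP ⊛ v) (v ⊛ v)))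

  BothLawsBelow : Forest → Set
  BothLawsBelow x = ∀ y → sizeF y <ℕ sizeF x → AntipodeLaw y × KLaw y

  KLaw-[] : KLaw []
  KLaw-[] p = ≋-trans (sumΔ-[] (λ a b → F a (τ (F b p)))) (≋-trans (F-[] _) (≋-trans (τ-cong (F-[] p)) (≋-sym (·-identityˡ (τ p)))))

  KLaw-ΔΔTerm : ∀ x W → BothLawsBelow x → K x W ≋ ε x · τ W → ∀ C B2 A1 D → IsΔTerm x (C , B2) → IsΔTerm C (A1 , D) → K D W ≋ ε D · τ W
  KLaw-ΔΔTerm x W ih IHw C B2 A1 D Ax Ac with IsΔTerm-left x C B2 Ax | IsΔTerm-right C A1 D Ac
  ... | inj₁ (refl , _) | inj₁ (refl , _) = IHw
  ... | inj₁ (refl , _) | inj₂ lt = proj₂ (ih D lt) W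
  ... | inj₂ lt | _ = proj₂ (ih D (NP.≤-<-trans (IsΔTerm-right-≤ C A1 D Ac) lt)) W

  KLaw-tree : ∀ f → BothLawsBelow (B₊ f ∷ []) → KLaw (B₊ f ∷ [])
  KLaw-tree f ih = linear-unique (K-linear x) (linear-∘ (linear-· (ε x)) τ-linear) (snoc-ind (λ w → K x (mono w) ≋ ε x · τ (mono w)) (K-𝟙 x) step)
    where
    x = B₊ f ∷ []
    ks : ∀ y → sizeF y ≤ℕ sizeF f → KLaw y
    ks y le = proj₂ (ih y (s≤s (≤-trans le (NP.m≤m+n (sizeF f) 0))))
    Kgen : ∀ u → Gen u → K x u ≋ ε x · τ u
    Kgen .zP gen-z = K-z x
    Kgen .(zδ s) (gen-zδ s) = ≋-trans (KAtGenerator.K-tree-u s f ks) (≋-sym (·-zeroˡ (τ (zδ s))))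
    step : ∀ w l → K x (mono w) ≋ ε x · τ (mono w) → K x (mono (w ++ (l ∷ []))) ≋ ε x · τ (mono (w ++ (l ∷ [])))
    step w l IHw = begin
        K x (mono (w ++ (l ∷ []))) ≈⟨ resp≋ (K-linear x) (mono-∷ʳ w l) ⟩
        K x (W ⊛ ℓ) ≈⟨ K-⊛ x W ℓ (KLaw-ΔΔTerm x W ih IHw) ⟩
        K x ℓ ⊛ τ W ≈⟨ ⊛-congˡ (τ W) (agree-on-letters (K-linear x) (linear-∘ (linear-· (ε x)) τ-linear) Kgen l) ⟩
        (ε x · τ ℓ) ⊛ τ W ≈⟨ ⊛-·ˡ (ε x) (τ ℓ) (τ W) ⟩
        ε x · (τ ℓ ⊛ τ W) ≈⟨ ·-cong (ε x) (≋-sym (τ-⊛ W ℓ)) ⟩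
        ε x · τ (W ⊛ ℓ) ≈⟨ ·-cong (ε x) (τ-cong (≋-sym (mono-∷ʳ w l))) ⟩
        ε x · τ (mono (w ++ (l ∷ []))) ∎
      where W = mono w
            ℓ = mono (l ∷ [])

  both-laws-step : ∀ x → BothLawsBelow x → AntipodeLaw x × KLaw x
  both-laws-step [] ih = AntipodeLaw-[] , KLaw-[]
  both-laws-step (B₊ f ∷ []) ih = th , kt
    where
    x = B₊ f ∷ []
    kt = KLaw-tree f ih
    th = KLaw⇒AntipodeLaw x (All.map (λ {ab} A → aux (proj₁ ab) (proj₂ ab) A) (all-IsΔTerm x))
      where
      aux : ∀ a b → IsΔTerm x (a , b) → KLaw b
      aux a b A with IsΔTerm-right x a b A
      ... | inj₁ (refl , _) = kt
      ... | inj₂ lt = proj₂ (ih b lt)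
  both-laws-step (t ∷ t2 ∷ ts) ih = th , AntipodeLaw⇒KLaw x (All.map (λ {ab} A → aux (proj₁ ab) (proj₂ ab) A) (all-IsΔTerm x))
    where
    x = t ∷ t2 ∷ ts
    th : AntipodeLaw x
    th = AntipodeLaw-∷ t (t2 ∷ ts) (proj₁ (ih (t ∷ []) (NP.+-monoʳ-< (size t) (NP.≤-trans (size-pos t2) (NP.m≤m+n (size t2) (sizeF ts))))))
                             (proj₁ (ih (t2 ∷ ts) (NP.+-monoˡ-≤ (sizeF (t2 ∷ ts)) (size-pos t))))
    aux : ∀ a b → IsΔTerm x (a , b) → AntipodeLaw a
    aux a b A with IsΔTerm-left x a b A
    ... | inj₁ (refl , _) = th
    ... | inj₂ lt = proj₁ (ih a lt)

  both-laws-bounded : ∀ k x → sizeF x ≤ℕ k → AntipodeLaw x × KLaw x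
  both-laws-bounded zero x le = both-laws-step x (λ y lt → ⊥-elim (NP.n≮0 (NP.<-≤-trans lt le)))
  both-laws-bounded (suc k) x le = both-laws-step x (λ y lt → both-laws-bounded k y (NP.≤-pred (NP.<-≤-trans lt le)))

  antipode-law : ∀ x → AntipodeLaw x
  antipode-law x = proj₁ (both-laws-bounded (sizeF x) x NP.≤-refl)

  antipode-theorem : ∀ (h : HC) p → app (S h) p ≋ τ (app h (τ p))
  antipode-theorem h p = begin
      app (S h) p ≈⟨ app-S h p ⟩
      sumL h (λ cf → proj₁ cf · S̃ (proj₂ cf) p) ≈⟨ sumL-cong h (λ cf → ≋-trans (·-cong (proj₁ cf) (antipode-law (proj₂ cf) p))
          (≋-sym (τ-· (proj₁ cf) (F (proj₂ cf) (τ p))))) ⟩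
      sumL h (λ cf → τ (proj₁ cf · F (proj₂ cf) (τ p))) ≈⟨ ≋-sym (hom-sumL τ-linear h (λ cf → proj₁ cf · F (proj₂ cf) (τ p))) ⟩
      τ (app h (τ p)) ∎

theorem2p5 : (n : ℕ) (F : Forest → Poly (suc n) → Poly (suc n)) →
    IsRootedTreeMaps F →
    (f : HC) (p : Poly (suc n)) →
    apply F (S f) p ≈ τ (apply F f (τ p))
theorem2p5 n F R f p = un (RootedTreeMaps.antipode-theorem {n} F R f p)
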